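{- Let $A$ be any formula of $\mathsf{PA}^{\unlhd}$ built from atomic formulas using $\neg$, $\vee$, bounded universal quantifiers $\forall z \unlhd t$, and unbounded universal quantifiers $\forall z$ (and, optionally, $\wedge$ treated as a primitive symbol). Write its Shoenfield-like bounded functional interpretation as $A^U \equiv \tilde\forall \underline{x}\, \tilde\exists \underline{y}\, A_U(\underline{x},\underline{y})$. Then the bounded functional interpretation of its Krivine negative translation has the form $(A^K)^B \equiv \tilde\exists \underline{Y}\, \tilde\forall \underline{x}\, (A^K)_B(\underline{Y},\underline{x})$, where $\underline{x}$ is a tuple of variables of the same types as the tuple $\underline{x}$ in $A^U$ and $\underline{Y}$ is a tuple of variables with $\underline{Y}\underline{x}$ of the same types as $\underline{y}$, and: 1. $\mathsf{HA}^{\unlhd} + \mathsf{BLEM} \vdash \tilde\forall \underline{Y},\underline{x}\, [A_U(\underline{x},\underline{Y}\underline{x}) \leftrightarrow (A^K)_B(\underline{Y},\underline{x})]$; 2. $\mathsf{HA}^{\unlhd} + \mathsf{BLEM} + \mathsf{bMAC} \vdash A^U \leftrightarrow (A^K)^B$.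
   Context: $\mathsf{HA}$ is Heyting arithmetic in all finite types (with a minimal treatment of equality and no extensionality, as in Troelstra). $\mathsf{HA}^{\unlhd}$ (Heyting arithmetic with majorizability) is obtained from $\mathsf{HA}$ by: adding atomic formulas $t \unlhd_\rho q$ for every finite type $\rho$ ($t,q$ terms of type $\rho$); adding bounded quantifiers $\forall x \unlhd t\, A$ and $\exists x \unlhd t\, A$ ($x$ not occurring in $t$) with axioms $\forall x \unlhd t\, A \leftrightarrow \forall x (x \unlhd t \to A)$ and $\exists x \unlhd t\, A \leftrightarrow \exists x (x \unlhd t \wedge A)$; adding the axioms $x \unlhd_0 y \leftrightarrow x \le_0 y$ and $x \unlhd y \to \forall u \unlhd v (xu \unlhd yv \wedge yu \unlhd yv)$ and the rule: from $A_b \wedge u \unlhd v \to tu \unlhd qv \wedge qu \unlhd qv$ infer $A_b \to t \unlhd q$ (for bounded $A_b$, with $u,v$ not free in $A_b,t,q$); and extending induction to the new formulas. $\mathsf{PA}^{\unlhd}$ is the classical counterpart. A formula is bounded if all its quantifiers are bounded. Notation: underlined letters denote (possibly empty) tuples; $\underline{t}\unlhd\underline{t}$ means $t_1\unlhd t_1\wedge\dots\wedge t_n \unlhd t_n$; $\tilde\forall \underline{x} A :\equiv \forall \underline{x}(\underline{x}\unlhd\underline{x} \to A)$, $\tilde\exists \underline{x} A :\equiv \exists \underline{x}(\underline{x}\unlhd\underline{x}\wedge A)$, $\tilde\forall \underline{x}\unlhd\underline{t}\, A :\equiv \forall \underline{x}\unlhd \underline{t}(\underline{x}\unlhd\underline{x}\to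 A)$, $\tilde\exists \underline{x}\unlhd\underline{t}\, A :\equiv \exists \underline{x}\unlhd \underline{t}(\underline{x}\unlhd\underline{x}\wedge A)$. $\mathsf{BLEM}$: $A_b \vee \neg A_b$ for all bounded $A_b$. $\mathsf{bMAC}$: $\tilde\forall \underline{x}\,\tilde\exists \underline{y}\, A_b(\underline{x},\underline{y}) \to \tilde\exists \underline{Y}\,\tilde\forall \underline{x}\,\tilde\exists \underline{y}\unlhd \underline{Y}\underline{x}\, A_b(\underline{x},\underline{y})$ for bounded $A_b$. Krivine negative translation: $A^K :\equiv \neg A_K$, where $A_K :\equiv \neg A$ for atomic $A$; $(\neg A)_K :\equiv \neg A_K$; $(A\vee B)_K :\equiv A_K \wedge B_K$; $(\forall x\unlhd t A)_K :\equiv \exists x \unlhd t A_K$; $(\forall x A)_K :\equiv \exists x A_K$; if $\wedge$ is primitive, $(A\wedge B)_K :\equiv A_K \vee B_K$. Bounded functional interpretation $B$ (for formulas of $\mathsf{HA}^{\unlhd}$ built from atomic formulas, $\bot,\wedge,\vee,\to,\forall\unlhd,\exists\unlhd,\forall,\exists$): $A^B \equiv \tilde\exists\underline{x}\,\tilde\forall\underline{y}\, A_B(\underline{x},\underline{y})$, defined inductively. For atomic $A$: $A^B :\equiv A_B :\equiv A$ with empty tuples. If $A^B \equiv \tilde\exists\underline{x}\tilde\forall\underline{y} A_B(\underline{x},\underline{y})$ and $B^B\equiv \tilde\exists\underline{x'}\tilde\forall\underline{y'} B_B(\underline{x'},\underline{y'})$, then: $(A\wedge B)^B :\equiv \tilde\exists\underline{x},\underline{x'}\tilde\forall\underline{y},\underline{y'}[A_B(\underline{x},\underline{y})\wedge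 B_B(\underline{x'},\underline{y'})]$; $(A\vee B)^B :\equiv \tilde\exists\underline{x},\underline{x'}\tilde\forall\underline{y},\underline{y'}[\tilde\forall\underline{\tilde y}\unlhd\underline{y} A_B(\underline{x},\underline{\tilde y})\vee \tilde\forall\underline{\tilde y'}\unlhd\underline{y'} B_B(\underline{x'},\underline{\tilde y'})]$; $(A\to B)^B :\equiv \tilde\exists\underline{X'},\underline{Y}\tilde\forall\underline{x},\underline{y'}[\tilde\forall\underline{y}\unlhd\underline{Y}\underline{x}\underline{y'} A_B(\underline{x},\underline{y}) \to B_B(\underline{X'}\underline{x},\underline{y'})]$; $(\forall z\unlhd t A)^B :\equiv \tilde\exists\underline{x}\tilde\forall\underline{y}\forall z\unlhd t A_B(\underline{x},\underline{y})$; $(\exists z\unlhd t A)^B :\equiv \tilde\exists\underline{x}\tilde\forall\underline{y}\exists z\unlhd t\tilde\forall\underline{\tilde y}\unlhd\underline{y} A_B(\underline{x},\underline{\tilde y})$; $(\forall z A)^B :\equiv \tilde\exists\underline{X}\tilde\forall w,\underline{y}\forall z\unlhd w A_B(\underline{X}w,\underline{y})$; $(\exists z A)^B :\equiv \tilde\exists w,\underline{x}\tilde\forall\underline{y}\exists z\unlhd w\tilde\forall\underline{\tilde y}\unlhd\underline{y} A_B(\underline{x},\underline{\tilde y})$; in each case the matrix after the displayed $\tilde\exists\,\tilde\forall$ prefix is by definition the corresponding $(\cdot)_B$. In particular $(\neg A)^B \equiv \tilde\exists\underline{Y}\tilde\forall\underline{x}\,\neg\tilde\forall\underline{y}\unlhd\underline{Y}\underline{x}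 A_B(\underline{x},\underline{y})$ with $(\neg A)_B(\underline{Y},\underline{x}) \equiv \neg\tilde\forall\underline{y}\unlhd\underline{Y}\underline{x} A_B(\underline{x},\underline{y})$ (taking $\neg C :\equiv C\to\bot$). Shoenfield-like bounded functional interpretation $U$ (for formulas of $\mathsf{PA}^{\unlhd}$ built from $\neg,\vee,\forall\unlhd,\forall$, optionally $\wedge$): $A^U\equiv\tilde\forall\underline{x}\tilde\exists\underline{y} A_U(\underline{x},\underline{y})$, defined inductively. For atomic $A$: $A^U :\equiv A_U :\equiv A$ with empty tuples. If $A^U\equiv\tilde\forall\underline{x}\tilde\exists\underline{y}A_U(\underline{x},\underline{y})$ and $B^U\equiv\tilde\forall\underline{x'}\tilde\exists\underline{y'}B_U(\underline{x'},\underline{y'})$, then: $(\neg A)^U :\equiv \tilde\forall\underline{Y}\tilde\exists\underline{x}\,\tilde\exists\underline{\tilde x}\unlhd\underline{x}\neg A_U(\underline{\tilde x},\underline{Y}\underline{\tilde x})$; $(A\vee B)^U :\equiv \tilde\forall\underline{x},\underline{x'}\tilde\exists\underline{y},\underline{y'}[A_U(\underline{x},\underline{y})\vee B_U(\underline{x'},\underline{y'})]$; $(\forall z\unlhd t A)^U :\equiv \tilde\forall\underline{x}\tilde\exists\underline{y}\forall z\unlhd t A_U(\underline{x},\underline{y})$; $(\forall z A)^U :\equiv \tilde\forall w,\underline{x}\tilde\exists\underline{y}\forall z\unlhd w A_U(\underline{x},\underline{y})$; if $\wedge$ is primitive, $(A\wedge B)^U :\equiv \tilde\forall\underline{x},\underline{x'}\tilde\exists\underline{y},\underline{y'}[A_U(\underline{x},\underline{y})\wedge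 B_U(\underline{x'},\underline{y'})]$; again the matrix after the displayed prefix is by definition the corresponding $(\cdot)_U$. -}

module Defs where

open import Data.List using (List; []; _∷_; _++_; map; foldr)
open import Data.List.Membership.Propositional using (_∈_)
open import Data.Product using (_×_; _,_)
open import Data.Sum using (_⊎_)
open import Data.Empty using (⊥)

-- Finite types, contexts, variables (typed de Bruijn indices)

infixr 7 _⇒_
data Ty : Set where
  ι   : Ty
  _⇒_ : Ty → Ty → Ty

Ctx : Set
Ctx = List Ty

data Var : Ctx → Ty → Set where
  here  : ∀ {Γ ρ} → Var (ρ ∷ Γ) ρ
  there : ∀ {Γ ρ σ} → Var Γ ρ → Var (σ ∷ Γ) ρ

_⇒*_ : List Ty → Ty → Ty
ρs ⇒* σ = foldr _⇒_ σ ρs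

-- Terms of HA^ω (Troelstra's combinatory language: 0, S, Π, Σ, R)

infixl 9 _·_
data Tm (Γ : Ctx) : Ty → Set where
  var   : ∀ {ρ} → Var Γ ρ → Tm Γ ρ
  zero' : Tm Γ ι
  suc'  : Tm Γ (ι ⇒ ι)
  Πc    : ∀ {ρ σ} → Tm Γ (ρ ⇒ σ ⇒ ρ)
  Σc    : ∀ {ρ σ τ} → Tm Γ ((ρ ⇒ σ ⇒ τ) ⇒ (ρ ⇒ σ) ⇒ ρ ⇒ τ)
  Rc    : ∀ {ρ} → Tm Γ (ι ⇒ ρ ⇒ (ρ ⇒ ι ⇒ ρ) ⇒ ρ)
  _·_   : ∀ {ρ σ} → Tm Γ (ρ ⇒ σ) → Tm Γ ρ → Tm Γ σ

infixr 5 _∷ₜ_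
data Tms (Γ : Ctx) : List Ty → Set where
  []ₜ  : Tms Γ []
  _∷ₜ_ : ∀ {ρ ρs} → Tm Γ ρ → Tms Γ ρs → Tms Γ (ρ ∷ ρs)

Ren : Ctx → Ctx → Set
Ren Γ Δ = ∀ {ρ} → Var Γ ρ → Var Δ ρ

idR : ∀ {Γ} → Ren Γ Γ
idR v = v

_∘R_ : ∀ {Γ Δ Θ} → Ren Δ Θ → Ren Γ Δ → Ren Γ Θ
(r ∘R s) v = r (s v)

wkR : ∀ {Γ σ} → Ren Γ (σ ∷ Γ)
wkR = there

liftR : ∀ {Γ Δ σ} → Ren Γ Δ → Ren (σ ∷ Γ) (σ ∷ Δ)
liftR r here      = here
liftR r (there v) = there (r v)

renTm : ∀ {Γ Δ ρ} → Ren Γ Δ → Tm Γ ρ → Tm Δ ρ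
renTm r (var v) = var (r v)
renTm r zero'   = zero'
renTm r suc'    = suc'
renTm r Πc      = Πc
renTm r Σc      = Σc
renTm r Rc      = Rc
renTm r (t · s) = renTm r t · renTm r s

renTms : ∀ {Γ Δ ρs} → Ren Γ Δ → Tms Γ ρs → Tms Δ ρs
renTms r []ₜ       = []ₜ
renTms r (t ∷ₜ ts) = renTm r t ∷ₜ renTms r ts

Sub : Ctx → Ctx → Set
Sub Γ Δ = ∀ {ρ} → Var Γ ρ → Tm Δ ρ

liftS : ∀ {Γ Δ σ} → Sub Γ Δ → Sub (σ ∷ Γ) (σ ∷ Δ)
liftS s here      = var here
liftS s (there v) = renTm there (s v)

subTm : ∀ {Γ Δ ρ} → Sub Γ Δ → Tm Γ ρ → Tm Δ ρ
subTm s (var v) = s v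
subTm s zero'   = zero'
subTm s suc'    = suc'
subTm s Πc      = Πc
subTm s Σc      = Σc
subTm s Rc      = Rc
subTm s (t · u) = subTm s t · subTm s u

_++ˢ_ : ∀ {Γ Δ ρs} → Tms Δ ρs → Sub Γ Δ → Sub (ρs ++ Γ) Δ
([]ₜ ++ˢ s) v                = s v
((t ∷ₜ ts) ++ˢ s) here       = t
((t ∷ₜ ts) ++ˢ s) (there v)  = (ts ++ˢ s) v

sub1 : ∀ {Γ ρ} → Tm Γ ρ → Sub (ρ ∷ Γ) Γ
sub1 t = (t ∷ₜ []ₜ) ++ˢ var

app* : ∀ {Γ ρs σ} → Tm Γ (ρs ⇒* σ) → Tms Γ ρs → Tm Γ σ
app* f []ₜ       = f
app* f (t ∷ₜ ts) = app* (f · t) ts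

appTms : ∀ {Γ ρs} (σs : List Ty) → Tms Γ (map (ρs ⇒*_) σs) → Tms Γ ρs → Tms Γ σs
appTms []       []ₜ       xs = []ₜ
appTms (σ ∷ σs) (f ∷ₜ fs) xs = app* f xs ∷ₜ appTms σs fs xs

appEach : ∀ {Γ ρ} (σs : List Ty) → Tms Γ (map (ρ ⇒_) σs) → Tm Γ ρ → Tms Γ σs
appEach []       []ₜ       w = []ₜ
appEach (σ ∷ σs) (f ∷ₜ fs) w = (f · w) ∷ₜ appEach σs fs w

splitTms : ∀ {Γ} (as : List Ty) {bs : List Ty} → Tms Γ (as ++ bs) → Tms Γ as × Tms Γ bs
splitTms []       ts        = []ₜ , ts
splitTms (a ∷ as) (t ∷ₜ ts) with splitTms as ts
... | us , vs = (t ∷ₜ us) , vs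

Ic : ∀ {Γ ρ} → Tm Γ (ρ ⇒ ρ)
Ic {ρ = ρ} = Σc {ρ = ρ} {σ = ρ ⇒ ρ} {τ = ρ} · Πc · Πc

-- pred a = R a 0 (Π I)
predc : ∀ {Γ} → Tm Γ (ι ⇒ ι)
predc = Σc · (Σc · Rc · (Πc · zero')) · (Πc · (Πc · Ic))

-- λ a b. pred a
predK : ∀ {Γ} → Tm Γ (ι ⇒ ι ⇒ ι)
predK = Σc · (Πc · Πc) · predc

monus : ∀ {Γ} → Tm Γ ι → Tm Γ ι → Tm Γ ι
monus s t = Rc · t · s · predK

infix  6 _≐_ _⊴_
infixr 5 _∧'_
infixr 4 _∨'_
infixr 3 _⊃_ _⇔_

data Fm (Γ : Ctx) : Set where
  _≐_  : Tm Γ ι → Tm Γ ι → Fm Γ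
  _⊴_  : ∀ {ρ} → Tm Γ ρ → Tm Γ ρ → Fm Γ
  ⊥'   : Fm Γ
  _∧'_ : Fm Γ → Fm Γ → Fm Γ
  _∨'_ : Fm Γ → Fm Γ → Fm Γ
  _⊃_  : Fm Γ → Fm Γ → Fm Γ
  ∀⊴   : ∀ {ρ} → Tm Γ ρ → Fm (ρ ∷ Γ) → Fm Γ   -- ∀ z ⊴ t A  (z not in t)
  ∃⊴   : ∀ {ρ} → Tm Γ ρ → Fm (ρ ∷ Γ) → Fm Γ
  ∀'   : ∀ {ρ} → Fm (ρ ∷ Γ) → Fm Γ
  ∃'   : ∀ {ρ} → Fm (ρ ∷ Γ) → Fm Γ

¬' : ∀ {Γ} → Fm Γ → Fm Γ
¬' A = A ⊃ ⊥'

_⇔_ : ∀ {Γ} → Fm Γ → Fm Γ → Fm Γ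
A ⇔ C = (A ⊃ C) ∧' (C ⊃ A)

Leq : ∀ {Γ} → Tm Γ ι → Tm Γ ι → Fm Γ
Leq s t = monus s t ≐ zero'

renFm : ∀ {Γ Δ} → Ren Γ Δ → Fm Γ → Fm Δ
renFm r (t ≐ s)  = renTm r t ≐ renTm r s
renFm r (t ⊴ s)  = renTm r t ⊴ renTm r s
renFm r ⊥'       = ⊥'
renFm r (A ∧' C) = renFm r A ∧' renFm r C
renFm r (A ∨' C) = renFm r A ∨' renFm r C
renFm r (A ⊃ C)  = renFm r A ⊃ renFm r C
renFm r (∀⊴ t A) = ∀⊴ (renTm r t) (renFm (liftR r) A)
renFm r (∃⊴ t A) = ∃⊴ (renTm r t) (renFm (liftR r) A)
renFm r (∀' A)   = ∀' (renFm (liftR r) A)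
renFm r (∃' A)   = ∃' (renFm (liftR r) A)

subFm : ∀ {Γ Δ} → Sub Γ Δ → Fm Γ → Fm Δ
subFm s (t ≐ u)  = subTm s t ≐ subTm s u
subFm s (t ⊴ u)  = subTm s t ⊴ subTm s u
subFm s ⊥'       = ⊥'
subFm s (A ∧' C) = subFm s A ∧' subFm s C
subFm s (A ∨' C) = subFm s A ∨' subFm s C
subFm s (A ⊃ C)  = subFm s A ⊃ subFm s C
subFm s (∀⊴ t A) = ∀⊴ (subTm s t) (subFm (liftS s) A)
subFm s (∃⊴ t A) = ∃⊴ (subTm s t) (subFm (liftS s) A)
subFm s (∀' A)   = ∀' (subFm (liftS s) A)
subFm s (∃' A)   = ∃' (subFm (liftS s) A)

wkFm : ∀ {Γ σ} → Fm Γ → Fm (σ ∷ Γ)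
wkFm = renFm there

wkTm : ∀ {Γ σ ρ} → Tm Γ ρ → Tm (σ ∷ Γ) ρ
wkTm = renTm there

sucS : ∀ {Γ} → Sub (ι ∷ Γ) (ι ∷ Γ)
sucS = ((suc' · var here) ∷ₜ []ₜ) ++ˢ (λ v → var (there v))

_[_] : ∀ {Γ ρ} → Fm (ρ ∷ Γ) → Tm Γ ρ → Fm Γ
A [ t ] = subFm (sub1 t) A

data Bounded {Γ : Ctx} : Fm Γ → Set where
  b≐ : ∀ {t s} → Bounded (t ≐ s)
  b⊴ : ∀ {ρ} {t s : Tm Γ ρ} → Bounded (t ⊴ s)
  b⊥ : Bounded ⊥'
  b∧ : ∀ {A C} → Bounded A → Bounded C → Bounded (A ∧' C)
  b∨ : ∀ {A C} → Bounded A → Bounded C → Bounded (A ∨' C)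
  b⊃ : ∀ {A C} → Bounded A → Bounded C → Bounded (A ⊃ C)
  b∀ : ∀ {ρ} {t : Tm Γ ρ} {A} → Bounded A → Bounded (∀⊴ t A)
  b∃ : ∀ {ρ} {t : Tm Γ ρ} {A} → Bounded A → Bounded (∃⊴ t A)

v0 : ∀ {Γ ρ} → Tm (ρ ∷ Γ) ρ
v0 = var here

∀̃ : ∀ {Γ ρ} → Fm (ρ ∷ Γ) → Fm Γ
∀̃ A = ∀' ((v0 ⊴ v0) ⊃ A)

∃̃ : ∀ {Γ ρ} → Fm (ρ ∷ Γ) → Fm Γ
∃̃ A = ∃' ((v0 ⊴ v0) ∧' A)

∀̃⊴ : ∀ {Γ ρ} → Tm Γ ρ → Fm (ρ ∷ Γ) → Fm Γ
∀̃⊴ t A = ∀⊴ t ((v0 ⊴ v0) ⊃ A)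

∃̃⊴ : ∀ {Γ ρ} → Tm Γ ρ → Fm (ρ ∷ Γ) → Fm Γ
∃̃⊴ t A = ∃⊴ t ((v0 ⊴ v0) ∧' A)

-- A formula "with free tuple of variables of types ρs" over context Δ,
-- given as a function of the tuple (in any extension Δ' of Δ).
KF : Ctx → List Ty → Set
KF Δ ρs = ∀ {Δ'} → Ren Δ Δ' → Tms Δ' ρs → Fm Δ'

∀̃* : ∀ {Δ} (ρs : List Ty) → KF Δ ρs → Fm Δ
∀̃* []       k = k idR []ₜ
∀̃* (ρ ∷ ρs) k = ∀̃ (∀̃* ρs (λ r ts → k (r ∘R there) (var (r here) ∷ₜ ts)))

∃̃* : ∀ {Δ} (ρs : List Ty) → KF Δ ρs → Fm Δ
∃̃* []       k = k idR []ₜ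
∃̃* (ρ ∷ ρs) k = ∃̃ (∃̃* ρs (λ r ts → k (r ∘R there) (var (r here) ∷ₜ ts)))

∀̃⊴* : ∀ {Δ} (ρs : List Ty) → Tms Δ ρs → KF Δ ρs → Fm Δ
∀̃⊴* []       []ₜ       k = k idR []ₜ
∀̃⊴* (ρ ∷ ρs) (t ∷ₜ ts) k =
  ∀̃⊴ t (∀̃⊴* ρs (renTms there ts) (λ r us → k (r ∘R there) (var (r here) ∷ₜ us)))

∃̃⊴* : ∀ {Δ} (ρs : List Ty) → Tms Δ ρs → KF Δ ρs → Fm Δ
∃̃⊴* []       []ₜ       k = k idR []ₜ
∃̃⊴* (ρ ∷ ρs) (t ∷ₜ ts) k =
  ∃̃⊴ t (∃̃⊴* ρs (renTms there ts) (λ r us → k (r ∘R there) (var (r here) ∷ₜ us)))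

-- The proof system of HA^⊴ (natural deduction), over a theory T of
-- additional axioms.

Theory : Set₁
Theory = ∀ {Γ} → Fm Γ → Set

_∪T_ : Theory → Theory → Theory
(T₁ ∪T T₂) A = T₁ A ⊎ T₂ A

data _▷_ {Γ : Ctx} : ∀ {ρ} → Tm Γ ρ → Tm Γ ρ → Set where
  βΠ  : ∀ {ρ σ} {x : Tm Γ ρ} {y : Tm Γ σ} → (Πc · x · y) ▷ x
  βΣ  : ∀ {ρ σ τ} {x : Tm Γ (ρ ⇒ σ ⇒ τ)} {y : Tm Γ (ρ ⇒ σ)} {z : Tm Γ ρ} →
        (Σc · x · y · z) ▷ (x · z · (y · z))
  βR0 : ∀ {ρ} {y : Tm Γ ρ} {z : Tm Γ (ρ ⇒ ι ⇒ ρ)} → (Rc · zero' · y · z) ▷ y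
  βRS : ∀ {ρ} {x : Tm Γ ι} {y : Tm Γ ρ} {z : Tm Γ (ρ ⇒ ι ⇒ ρ)} →
        (Rc · (suc' · x) · y · z) ▷ (z · (Rc · x · y · z) · x)

data Der (T : Theory) : (Γ : Ctx) → List (Fm Γ) → Fm Γ → Set where
  ax    : ∀ {Γ Hs A} → T A → Der T Γ Hs A
  hyp   : ∀ {Γ Hs A} → A ∈ Hs → Der T Γ Hs A
  ⊥E    : ∀ {Γ Hs A} → Der T Γ Hs ⊥' → Der T Γ Hs A
  ∧I    : ∀ {Γ Hs A C} → Der T Γ Hs A → Der T Γ Hs C → Der T Γ Hs (A ∧' C)
  ∧E₁   : ∀ {Γ Hs A C} → Der T Γ Hs (A ∧' C) → Der T Γ Hs A
  ∧E₂   : ∀ {Γ Hs A C} → Der T Γ Hs (A ∧' C) → Der T Γ Hs C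
  ∨I₁   : ∀ {Γ Hs A C} → Der T Γ Hs A → Der T Γ Hs (A ∨' C)
  ∨I₂   : ∀ {Γ Hs A C} → Der T Γ Hs C → Der T Γ Hs (A ∨' C)
  ∨E    : ∀ {Γ Hs A C D} → Der T Γ Hs (A ∨' C) → Der T Γ (A ∷ Hs) D →
          Der T Γ (C ∷ Hs) D → Der T Γ Hs D
  ⊃I    : ∀ {Γ Hs A C} → Der T Γ (A ∷ Hs) C → Der T Γ Hs (A ⊃ C)
  ⊃E    : ∀ {Γ Hs A C} → Der T Γ Hs (A ⊃ C) → Der T Γ Hs A → Der T Γ Hs C
  ∀I    : ∀ {Γ Hs ρ} {A : Fm (ρ ∷ Γ)} → Der T (ρ ∷ Γ) (map wkFm Hs) A → Der T Γ Hs (∀' A)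
  ∀E    : ∀ {Γ Hs ρ} {A : Fm (ρ ∷ Γ)} → Der T Γ Hs (∀' A) → (t : Tm Γ ρ) → Der T Γ Hs (A [ t ])
  ∃I    : ∀ {Γ Hs ρ} {A : Fm (ρ ∷ Γ)} (t : Tm Γ ρ) → Der T Γ Hs (A [ t ]) → Der T Γ Hs (∃' A)
  ∃E    : ∀ {Γ Hs ρ C} {A : Fm (ρ ∷ Γ)} → Der T Γ Hs (∃' A) →
          Der T (ρ ∷ Γ) (A ∷ map wkFm Hs) (wkFm C) → Der T Γ Hs C
  ∀⊴ax  : ∀ {Γ Hs ρ} (t : Tm Γ ρ) (A : Fm (ρ ∷ Γ)) →
          Der T Γ Hs (∀⊴ t A ⇔ ∀' ((v0 ⊴ wkTm t) ⊃ A))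
  ∃⊴ax  : ∀ {Γ Hs ρ} (t : Tm Γ ρ) (A : Fm (ρ ∷ Γ)) →
          Der T Γ Hs (∃⊴ t A ⇔ ∃' ((v0 ⊴ wkTm t) ∧' A))
  ≐refl : ∀ {Γ Hs} (t : Tm Γ ι) → Der T Γ Hs (t ≐ t)
  ≐sub  : ∀ {Γ Hs} {t s : Tm Γ ι} (A : Fm (ι ∷ Γ)) →
          Der T Γ Hs (t ≐ s) → Der T Γ Hs (A [ t ]) → Der T Γ Hs (A [ s ])
  conv→ : ∀ {Γ Hs ρ} {t s : Tm Γ ρ} (A : Fm (ρ ∷ Γ)) → t ▷ s →
          Der T Γ Hs (A [ t ]) → Der T Γ Hs (A [ s ])
  conv← : ∀ {Γ Hs ρ} {t s : Tm Γ ρ} (A : Fm (ρ ∷ Γ)) → t ▷ s →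
          Der T Γ Hs (A [ s ]) → Der T Γ Hs (A [ t ])
  sucNZ : ∀ {Γ Hs} (t : Tm Γ ι) → Der T Γ Hs (¬' (suc' · t ≐ zero'))
  sucInj : ∀ {Γ Hs} (t s : Tm Γ ι) → Der T Γ Hs ((suc' · t ≐ suc' · s) ⊃ (t ≐ s))
  ind   : ∀ {Γ Hs} (A : Fm (ι ∷ Γ)) →
          Der T Γ Hs (A [ zero' ]) →
          Der T Γ Hs (∀' (A ⊃ subFm sucS A)) →
          Der T Γ Hs (∀' A)
  ⊴₀    : ∀ {Γ Hs} (t s : Tm Γ ι) → Der T Γ Hs ((t ⊴ s) ⇔ Leq t s)
  ⊴app  : ∀ {Γ Hs ρ σ} (x y : Tm Γ (ρ ⇒ σ)) (v : Tm Γ ρ) →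
          Der T Γ Hs ((x ⊴ y) ⊃ ∀⊴ v ((wkTm x · v0 ⊴ wkTm y · wkTm v) ∧'
                                       (wkTm y · v0 ⊴ wkTm y · wkTm v)))
  ⊴rule : ∀ {Γ Hs ρ σ} (A : Fm Γ) → Bounded A → (t q : Tm Γ (ρ ⇒ σ)) →
          Der T (ρ ∷ ρ ∷ Γ) []
            ((wkFm (wkFm A) ∧' (var (there here) ⊴ var here)) ⊃
             ((wkTm (wkTm t) · var (there here) ⊴ wkTm (wkTm q) · var here) ∧'
              (wkTm (wkTm q) · var (there here) ⊴ wkTm (wkTm q) · var here))) →
          Der T Γ Hs (A ⊃ (t ⊴ q))

HA⊴ : Theory
HA⊴ _ = ⊥

data BLEM : Theory where
  blem : ∀ {Γ} (A : Fm Γ) → Bounded A → BLEM (A ∨' ¬' A)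

inst : ∀ {Γ Δ xs ys} → Fm (ys ++ xs ++ Γ) → Ren Γ Δ → Tms Δ xs → Tms Δ ys → Fm Δ
inst A r x y = subFm (y ++ˢ (x ++ˢ (λ v → var (r v)))) A

data bMAC : Theory where
  bmac : ∀ {Γ} (xs ys : List Ty) (A : Fm (ys ++ xs ++ Γ)) → Bounded A →
    bMAC ( ∀̃* xs (λ r x → ∃̃* ys (λ r₂ y → inst A (r₂ ∘R r) (renTms r₂ x) y))
         ⊃ ∃̃* (map (xs ⇒*_) ys) (λ r Y →
             ∀̃* xs (λ r₂ x →
               ∃̃⊴* ys (appTms ys (renTms r₂ Y) x) (λ r₃ y →
                 inst A (r₃ ∘R (r₂ ∘R r)) (renTms r₃ x) y))))

-- Interpretations: a pair of type tuples and a matrix, given as a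
-- formula-valued function of the two tuples of (terms for) the variables.

record Interp (Γ : Ctx) : Set where
  field
    xs  : List Ty
    ys  : List Ty
    mat : ∀ {Δ} → Ren Γ Δ → Tms Δ xs → Tms Δ ys → Fm Δ

EAform : ∀ {Γ} → Interp Γ → Fm Γ
EAform I = ∃̃* xs (λ r x → ∀̃* ys (λ r₂ y → mat (r₂ ∘R r) (renTms r₂ x) y))
  where open Interp I

AEform : ∀ {Γ} → Interp Γ → Fm Γ
AEform I = ∀̃* xs (λ r x → ∃̃* ys (λ r₂ y → mat (r₂ ∘R r) (renTms r₂ x) y))
  where open Interp I

atomI : ∀ {Γ} → Fm Γ → Interp Γ
atomI φ = record { xs = [] ; ys = [] ; mat = λ r _ _ → renFm r φ }

andI : ∀ {Γ} → Interp Γ → Interp Γ → Interp Γ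
andI I J = record
  { xs = I.xs ++ J.xs ; ys = I.ys ++ J.ys
  ; mat = λ r x y → let (x₁ , x₂) = splitTms I.xs x ; (y₁ , y₂) = splitTms I.ys y
                    in I.mat r x₁ y₁ ∧' J.mat r x₂ y₂ }
  where module I = Interp I ; module J = Interp J

allBI : ∀ {Γ ρ} → Tm Γ ρ → Interp (ρ ∷ Γ) → Interp Γ
allBI t I = record
  { xs = I.xs ; ys = I.ys
  ; mat = λ r x y → ∀⊴ (renTm r t) (I.mat (liftR r) (renTms there x) (renTms there y)) }
  where module I = Interp I

orB : ∀ {Γ} → Interp Γ → Interp Γ → Interp Γ
orB I J = record
  { xs = I.xs ++ J.xs ; ys = I.ys ++ J.ys
  ; mat = λ r x y → let (x₁ , x₂) = splitTms I.xs x ; (y₁ , y₂) = splitTms I.ys y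
                    in ∀̃⊴* I.ys y₁ (λ r₂ ỹ → I.mat (r₂ ∘R r) (renTms r₂ x₁) ỹ)
                    ∨' ∀̃⊴* J.ys y₂ (λ r₂ ỹ → J.mat (r₂ ∘R r) (renTms r₂ x₂) ỹ) }
  where module I = Interp I ; module J = Interp J

impB : ∀ {Γ} → Interp Γ → Interp Γ → Interp Γ
impB I J = record
  { xs = map (I.xs ⇒*_) J.xs ++ map ((I.xs ++ J.ys) ⇒*_) I.ys
  ; ys = I.xs ++ J.ys
  ; mat = λ r XY xy → let (X , Y) = splitTms (map (I.xs ⇒*_) J.xs) XY
                          (x , y) = splitTms I.xs xy
                      in ∀̃⊴* I.ys (appTms I.ys Y xy) (λ r₂ ỹ → I.mat (r₂ ∘R r) (renTms r₂ x) ỹ)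
                         ⊃ J.mat r (appTms J.xs X x) y }
  where module I = Interp I ; module J = Interp J

exBB : ∀ {Γ ρ} → Tm Γ ρ → Interp (ρ ∷ Γ) → Interp Γ
exBB t I = record
  { xs = I.xs ; ys = I.ys
  ; mat = λ r x y → ∃⊴ (renTm r t)
            (∀̃⊴* I.ys (renTms there y) (λ r₂ ỹ → I.mat (r₂ ∘R liftR r) (renTms (r₂ ∘R there) x) ỹ)) }
  where module I = Interp I

allB : ∀ {Γ ρ} → Interp (ρ ∷ Γ) → Interp Γ
allB {ρ = ρ} I = record
  { xs = map (ρ ⇒_) I.xs ; ys = ρ ∷ I.ys
  ; mat = λ { r X (w ∷ₜ y) → ∀⊴ w (I.mat (liftR r) (appEach I.xs (renTms there X) v0) (renTms there y)) } }
  where module I = Interp I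

exB : ∀ {Γ ρ} → Interp (ρ ∷ Γ) → Interp Γ
exB {ρ = ρ} I = record
  { xs = ρ ∷ I.xs ; ys = I.ys
  ; mat = λ { r (w ∷ₜ x) y → ∃⊴ w
              (∀̃⊴* I.ys (renTms there y) (λ r₂ ỹ → I.mat (r₂ ∘R liftR r) (renTms (r₂ ∘R there) x) ỹ)) } }
  where module I = Interp I

B : ∀ {Γ} → Fm Γ → Interp Γ
B (t ≐ s)  = atomI (t ≐ s)
B (t ⊴ s)  = atomI (t ⊴ s)
B ⊥'       = atomI ⊥'
B (A ∧' C) = andI (B A) (B C)
B (A ∨' C) = orB (B A) (B C)
B (A ⊃ C)  = impB (B A) (B C)
B (∀⊴ t A) = allBI t (B A)
B (∃⊴ t A) = exBB t (B A)
B (∀' A)   = allB (B A)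
B (∃' A)   = exB (B A)

data KFm (Γ : Ctx) : Set where
  k≐  : Tm Γ ι → Tm Γ ι → KFm Γ
  k⊴  : ∀ {ρ} → Tm Γ ρ → Tm Γ ρ → KFm Γ
  k¬  : KFm Γ → KFm Γ
  k∨  : KFm Γ → KFm Γ → KFm Γ
  k∧  : KFm Γ → KFm Γ → KFm Γ
  k∀⊴ : ∀ {ρ} → Tm Γ ρ → KFm (ρ ∷ Γ) → KFm Γ
  k∀  : ∀ {ρ} → KFm (ρ ∷ Γ) → KFm Γ

-- Krivine negative translation:  A^K :≡ ¬ A_K

KT : ∀ {Γ} → KFm Γ → Fm Γ
KT (k≐ t s)    = ¬' (t ≐ s)
KT (k⊴ t s)    = ¬' (t ⊴ s)
KT (k¬ A)      = ¬' (KT A)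
KT (k∨ A C)    = KT A ∧' KT C
KT (k∧ A C)    = KT A ∨' KT C
KT (k∀⊴ t A)   = ∃⊴ t (KT A)
KT (k∀ A)      = ∃' (KT A)

Kriv : ∀ {Γ} → KFm Γ → Fm Γ
Kriv A = ¬' (KT A)

negU : ∀ {Γ} → Interp Γ → Interp Γ
negU I = record
  { xs = map (I.xs ⇒*_) I.ys ; ys = I.xs
  ; mat = λ r Y x → ∃̃⊴* I.xs x (λ r₂ x̃ →
            ¬' (I.mat (r₂ ∘R r) x̃ (appTms I.ys (renTms r₂ Y) x̃))) }
  where module I = Interp I

orU : ∀ {Γ} → Interp Γ → Interp Γ → Interp Γ
orU I J = record
  { xs = I.xs ++ J.xs ; ys = I.ys ++ J.ys
  ; mat = λ r x y → let (x₁ , x₂) = splitTms I.xs x ; (y₁ , y₂) = splitTms I.ys y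
                    in I.mat r x₁ y₁ ∨' J.mat r x₂ y₂ }
  where module I = Interp I ; module J = Interp J

allU : ∀ {Γ ρ} → Interp (ρ ∷ Γ) → Interp Γ
allU {ρ = ρ} I = record
  { xs = ρ ∷ I.xs ; ys = I.ys
  ; mat = λ { r (w ∷ₜ x) y → ∀⊴ w (I.mat (liftR r) (renTms there x) (renTms there y)) } }
  where module I = Interp I

U : ∀ {Γ} → KFm Γ → Interp Γ
U (k≐ t s)  = atomI (t ≐ s)
U (k⊴ t s)  = atomI (t ⊴ s)
U (k¬ A)    = negU (U A)
U (k∨ A C)  = orU (U A) (U C)
U (k∧ A C)  = andI (U A) (U C)
U (k∀⊴ t A) = allBI t (U A)
U (k∀ A)    = allU (U A)

open import Relation.Binary.PropositionalEquality using (_≡_; subst; sym)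

Uxs Uys : ∀ {Γ} → KFm Γ → List Ty
Uxs A = Interp.xs (U A)
Uys A = Interp.ys (U A)

KBxs KBys : ∀ {Γ} → KFm Γ → List Ty
KBxs A = Interp.xs (B (Kriv A))
KBys A = Interp.ys (B (Kriv A))

-- Claim 1:  ∀̃ Y⃗, x⃗ [ A_U(x⃗, Y⃗x⃗) ↔ (A^K)_B(Y⃗, x⃗) ]
-- (Y⃗ ranges over types map (Uxs A ⇒*_) (Uys A), transported along eY)
Claim1 : ∀ {Γ} (A : KFm Γ) → KBxs A ≡ map (Uxs A ⇒*_) (Uys A) → KBys A ≡ Uxs A → Fm Γ
Claim1 A eY ex =
  ∀̃* (map (Uxs A ⇒*_) (Uys A)) λ r Y →
    ∀̃* (Uxs A) λ r₂ x →
      Interp.mat (U A) (r₂ ∘R r) x (appTms (Uys A) (renTms r₂ Y) x)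
      ⇔ Interp.mat (B (Kriv A)) (r₂ ∘R r)
          (subst (Tms _) (sym eY) (renTms r₂ Y)) (subst (Tms _) (sym ex) x)

Claim2 : ∀ {Γ} (A : KFm Γ) → Fm Γ
Claim2 A = AEform (U A) ⇔ EAform (B (Kriv A))

module Submission where

-- By induction on A one proves, for majorizable x⃗ and y⃗,
--   A_U(x⃗, y⃗) ↔ ¬ ∀̃ ỹ⃗ ⊴ y⃗ (A_K)_B(x⃗, ỹ⃗)
-- in HA^⊴ + BLEM; every matrix involved is bounded, so BLEM makes the double
-- negations produced by the translation harmless.  As A^K is ¬A_K and
-- (¬C)_B(Y⃗, x⃗) is ¬ ∀̃ ỹ⃗ ⊴ Y⃗x⃗ C_B(x⃗, ỹ⃗), the instance y⃗ := Y⃗x⃗ is Claim 1.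
-- Hence (A^K)^B says ∃̃ Y⃗ ∀̃ x⃗ A_U(x⃗, Y⃗x⃗), which implies A^U.  Conversely bMAC
-- turns A^U into ∃̃ Y⃗ ∀̃ x⃗ ∃̃ y⃗ ⊴ Y⃗x⃗ A_U(x⃗, y⃗), and since ∀̃ ỹ⃗ ⊴ y⃗ (A_K)_B is
-- antitone in its bound, a witness y⃗ ⊴ Y⃗x⃗ refutes ∀̃ ỹ⃗ ⊴ Y⃗x⃗ (A_K)_B(x⃗, ỹ⃗).

open import Defs
open import Axiom.UniquenessOfIdentityProofs.WithK using (uip)
open import Data.List using (List; []; _∷_; _++_; map)
open import Data.List.Properties using (++-identityʳ; map-∘; map-cong)
open import Data.List.Membership.Propositional using (_∈_)
open import Data.List.Membership.Propositional.Properties using (∈-map⁺; ∈-map⁻)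
open import Data.List.Relation.Unary.Any using (here; there)
open import Data.Product using (Σ; _×_; _,_; proj₁; proj₂)
open import Data.Sum using (inj₁; inj₂)
open import Data.Unit using (⊤; tt)
open import Relation.Binary.PropositionalEquality hiding ([_])

renTm-ext : ∀ {Γ Δ ρ} {r r' : Ren Γ Δ} → (∀ {σ} (v : Var Γ σ) → r v ≡ r' v) → (t : Tm Γ ρ) → renTm r t ≡ renTm r' t
renTm-ext e (var v) = cong var (e v)
renTm-ext e zero' = refl
renTm-ext e suc' = refl
renTm-ext e Πc = refl
renTm-ext e Σc = refl
renTm-ext e Rc = refl
renTm-ext e (t · s) = cong₂ _·_ (renTm-ext e t) (renTm-ext e s)

renTm-renTm : ∀ {Γ Δ Θ ρ} (r' : Ren Δ Θ) (r : Ren Γ Δ) {r'' : Ren Γ Θ} → (∀ {σ} (v : Var Γ σ) → r' (r v) ≡ r'' v) →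
  (t : Tm Γ ρ) → renTm r' (renTm r t) ≡ renTm r'' t
renTm-renTm r' r e (var v) = cong var (e v)
renTm-renTm r' r e zero' = refl
renTm-renTm r' r e suc' = refl
renTm-renTm r' r e Πc = refl
renTm-renTm r' r e Σc = refl
renTm-renTm r' r e Rc = refl
renTm-renTm r' r e (t · s) = cong₂ _·_ (renTm-renTm r' r e t) (renTm-renTm r' r e s)

renTm-id : ∀ {Γ ρ} (t : Tm Γ ρ) → renTm idR t ≡ t
renTm-id (var v) = refl
renTm-id zero' = refl
renTm-id suc' = refl
renTm-id Πc = refl
renTm-id Σc = refl
renTm-id Rc = refl
renTm-id (t · s) = cong₂ _·_ (renTm-id t) (renTm-id s)

subTm-renTm : ∀ {Γ Δ Θ ρ} (s : Sub Δ Θ) (r : Ren Γ Δ) {s'' : Sub Γ Θ} → (∀ {σ} (v : Var Γ σ) → s (r v) ≡ s'' v) →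
  (t : Tm Γ ρ) → subTm s (renTm r t) ≡ subTm s'' t
subTm-renTm s r e (var v) = e v
subTm-renTm s r e zero' = refl
subTm-renTm s r e suc' = refl
subTm-renTm s r e Πc = refl
subTm-renTm s r e Σc = refl
subTm-renTm s r e Rc = refl
subTm-renTm s r e (t · u) = cong₂ _·_ (subTm-renTm s r e t) (subTm-renTm s r e u)

renTm-subTm : ∀ {Γ Δ Θ ρ} (r : Ren Δ Θ) (s : Sub Γ Δ) {s'' : Sub Γ Θ} → (∀ {σ} (v : Var Γ σ) → renTm r (s v) ≡ s'' v) →
  (t : Tm Γ ρ) → renTm r (subTm s t) ≡ subTm s'' t
renTm-subTm r s e (var v) = e v
renTm-subTm r s e zero' = refl
renTm-subTm r s e suc' = refl
renTm-subTm r s e Πc = refl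
renTm-subTm r s e Σc = refl
renTm-subTm r s e Rc = refl
renTm-subTm r s e (t · u) = cong₂ _·_ (renTm-subTm r s e t) (renTm-subTm r s e u)

subTm-subTm : ∀ {Γ Δ Θ ρ} (s' : Sub Δ Θ) (s : Sub Γ Δ) {s'' : Sub Γ Θ} →
  (∀ {σ} (v : Var Γ σ) → subTm s' (s v) ≡ s'' v) → (t : Tm Γ ρ) → subTm s' (subTm s t) ≡ subTm s'' t
subTm-subTm s' s e (var v) = e v
subTm-subTm s' s e zero' = refl
subTm-subTm s' s e suc' = refl
subTm-subTm s' s e Πc = refl
subTm-subTm s' s e Σc = refl
subTm-subTm s' s e Rc = refl
subTm-subTm s' s e (t · u) = cong₂ _·_ (subTm-subTm s' s e t) (subTm-subTm s' s e u)

subTm-ext : ∀ {Γ Δ ρ} {s s' : Sub Γ Δ} → (∀ {σ} (v : Var Γ σ) → s v ≡ s' v) → (t : Tm Γ ρ) → subTm s t ≡ subTm s' t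
subTm-ext {s = s} e t = trans (cong (subTm s) (sym (renTm-id t))) (subTm-renTm s idR e t)

subTm-var : ∀ {Γ ρ} (t : Tm Γ ρ) → subTm var t ≡ t
subTm-var (var v) = refl
subTm-var zero' = refl
subTm-var suc' = refl
subTm-var Πc = refl
subTm-var Σc = refl
subTm-var Rc = refl
subTm-var (t · s) = cong₂ _·_ (subTm-var t) (subTm-var s)

renTm-as-subTm : ∀ {Γ Δ ρ} (r : Ren Γ Δ) (t : Tm Γ ρ) → subTm (λ v → var (r v)) t ≡ renTm r t
renTm-as-subTm r t = trans (sym (renTm-subTm r var (λ v → refl) t)) (cong (renTm r) (subTm-var t))

liftR-∘ : ∀ {Γ Δ Θ σ} (r' : Ren Δ Θ) (r : Ren Γ Δ) {r'' : Ren Γ Θ} → (∀ {τ} (v : Var Γ τ) → r' (r v) ≡ r'' v) →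
  ∀ {τ} (v : Var (σ ∷ Γ) τ) → liftR r' (liftR r v) ≡ liftR r'' v
liftR-∘ r' r e here = refl
liftR-∘ r' r e (there v) = cong there (e v)

liftS-liftR : ∀ {Γ Δ Θ σ} (s : Sub Δ Θ) (r : Ren Γ Δ) {s'' : Sub Γ Θ} → (∀ {τ} (v : Var Γ τ) → s (r v) ≡ s'' v) →
  ∀ {τ} (v : Var (σ ∷ Γ) τ) → liftS s (liftR r v) ≡ liftS s'' v
liftS-liftR s r e here = refl
liftS-liftR s r e (there v) = cong (renTm there) (e v)

liftR-liftS : ∀ {Γ Δ Θ σ} (r : Ren Δ Θ) (s : Sub Γ Δ) {s'' : Sub Γ Θ} → (∀ {τ} (v : Var Γ τ) → renTm r (s v) ≡ s'' v) →
  ∀ {τ} (v : Var (σ ∷ Γ) τ) → renTm (liftR r) (liftS s v) ≡ liftS s'' v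
liftR-liftS r s e here = refl
liftR-liftS r s e (there v) = trans (renTm-renTm (liftR r) there (λ _ → refl) (s v))
    (trans (sym (renTm-renTm there r (λ _ → refl) (s v))) (cong (renTm there) (e v)))

liftS-liftS : ∀ {Γ Δ Θ σ} (s' : Sub Δ Θ) (s : Sub Γ Δ) {s'' : Sub Γ Θ} →
  (∀ {τ} (v : Var Γ τ) → subTm s' (s v) ≡ s'' v) → ∀ {τ} (v : Var (σ ∷ Γ) τ) →
  subTm (liftS s') (liftS s v) ≡ liftS s'' v
liftS-liftS s' s e here = refl
liftS-liftS s' s e (there v) = trans (subTm-renTm (liftS s') there (λ _ → refl) (s v))
    (trans (sym (renTm-subTm there s' (λ _ → refl) (s v))) (cong (renTm there) (e v)))

renFm-renFm : ∀ {Γ Δ Θ} (r' : Ren Δ Θ) (r : Ren Γ Δ) {r'' : Ren Γ Θ} → (∀ {σ} (v : Var Γ σ) → r' (r v) ≡ r'' v) →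
  (A : Fm Γ) → renFm r' (renFm r A) ≡ renFm r'' A
renFm-renFm r' r e (t ≐ s) = cong₂ _≐_ (renTm-renTm r' r e t) (renTm-renTm r' r e s)
renFm-renFm r' r e (t ⊴ s) = cong₂ _⊴_ (renTm-renTm r' r e t) (renTm-renTm r' r e s)
renFm-renFm r' r e ⊥' = refl
renFm-renFm r' r e (A ∧' C) = cong₂ _∧'_ (renFm-renFm r' r e A) (renFm-renFm r' r e C)
renFm-renFm r' r e (A ∨' C) = cong₂ _∨'_ (renFm-renFm r' r e A) (renFm-renFm r' r e C)
renFm-renFm r' r e (A ⊃ C) = cong₂ _⊃_ (renFm-renFm r' r e A) (renFm-renFm r' r e C)
renFm-renFm r' r e (∀⊴ t A) = cong₂ ∀⊴ (renTm-renTm r' r e t) (renFm-renFm (liftR r') (liftR r) (liftR-∘ r' r e) A)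
renFm-renFm r' r e (∃⊴ t A) = cong₂ ∃⊴ (renTm-renTm r' r e t) (renFm-renFm (liftR r') (liftR r) (liftR-∘ r' r e) A)
renFm-renFm r' r e (∀' A) = cong ∀' (renFm-renFm (liftR r') (liftR r) (liftR-∘ r' r e) A)
renFm-renFm r' r e (∃' A) = cong ∃' (renFm-renFm (liftR r') (liftR r) (liftR-∘ r' r e) A)

subFm-renFm : ∀ {Γ Δ Θ} (s : Sub Δ Θ) (r : Ren Γ Δ) {s'' : Sub Γ Θ} → (∀ {σ} (v : Var Γ σ) → s (r v) ≡ s'' v) →
  (A : Fm Γ) → subFm s (renFm r A) ≡ subFm s'' A
subFm-renFm s r e (t ≐ u) = cong₂ _≐_ (subTm-renTm s r e t) (subTm-renTm s r e u)
subFm-renFm s r e (t ⊴ u) = cong₂ _⊴_ (subTm-renTm s r e t) (subTm-renTm s r e u)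
subFm-renFm s r e ⊥' = refl
subFm-renFm s r e (A ∧' C) = cong₂ _∧'_ (subFm-renFm s r e A) (subFm-renFm s r e C)
subFm-renFm s r e (A ∨' C) = cong₂ _∨'_ (subFm-renFm s r e A) (subFm-renFm s r e C)
subFm-renFm s r e (A ⊃ C) = cong₂ _⊃_ (subFm-renFm s r e A) (subFm-renFm s r e C)
subFm-renFm s r e (∀⊴ t A) = cong₂ ∀⊴ (subTm-renTm s r e t) (subFm-renFm (liftS s) (liftR r) (liftS-liftR s r e) A)
subFm-renFm s r e (∃⊴ t A) = cong₂ ∃⊴ (subTm-renTm s r e t) (subFm-renFm (liftS s) (liftR r) (liftS-liftR s r e) A)
subFm-renFm s r e (∀' A) = cong ∀' (subFm-renFm (liftS s) (liftR r) (liftS-liftR s r e) A)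
subFm-renFm s r e (∃' A) = cong ∃' (subFm-renFm (liftS s) (liftR r) (liftS-liftR s r e) A)

renFm-subFm : ∀ {Γ Δ Θ} (r : Ren Δ Θ) (s : Sub Γ Δ) {s'' : Sub Γ Θ} → (∀ {σ} (v : Var Γ σ) → renTm r (s v) ≡ s'' v) →
  (A : Fm Γ) → renFm r (subFm s A) ≡ subFm s'' A
renFm-subFm r s e (t ≐ u) = cong₂ _≐_ (renTm-subTm r s e t) (renTm-subTm r s e u)
renFm-subFm r s e (t ⊴ u) = cong₂ _⊴_ (renTm-subTm r s e t) (renTm-subTm r s e u)
renFm-subFm r s e ⊥' = refl
renFm-subFm r s e (A ∧' C) = cong₂ _∧'_ (renFm-subFm r s e A) (renFm-subFm r s e C)
renFm-subFm r s e (A ∨' C) = cong₂ _∨'_ (renFm-subFm r s e A) (renFm-subFm r s e C)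
renFm-subFm r s e (A ⊃ C) = cong₂ _⊃_ (renFm-subFm r s e A) (renFm-subFm r s e C)
renFm-subFm r s e (∀⊴ t A) = cong₂ ∀⊴ (renTm-subTm r s e t) (renFm-subFm (liftR r) (liftS s) (liftR-liftS r s e) A)
renFm-subFm r s e (∃⊴ t A) = cong₂ ∃⊴ (renTm-subTm r s e t) (renFm-subFm (liftR r) (liftS s) (liftR-liftS r s e) A)
renFm-subFm r s e (∀' A) = cong ∀' (renFm-subFm (liftR r) (liftS s) (liftR-liftS r s e) A)
renFm-subFm r s e (∃' A) = cong ∃' (renFm-subFm (liftR r) (liftS s) (liftR-liftS r s e) A)

subFm-subFm : ∀ {Γ Δ Θ} (s' : Sub Δ Θ) (s : Sub Γ Δ) {s'' : Sub Γ Θ} → (∀ {σ} (v : Var Γ σ) → subTm s' (s v) ≡ s'' v) →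
  (A : Fm Γ) → subFm s' (subFm s A) ≡ subFm s'' A
subFm-subFm s' s e (t ≐ u) = cong₂ _≐_ (subTm-subTm s' s e t) (subTm-subTm s' s e u)
subFm-subFm s' s e (t ⊴ u) = cong₂ _⊴_ (subTm-subTm s' s e t) (subTm-subTm s' s e u)
subFm-subFm s' s e ⊥' = refl
subFm-subFm s' s e (A ∧' C) = cong₂ _∧'_ (subFm-subFm s' s e A) (subFm-subFm s' s e C)
subFm-subFm s' s e (A ∨' C) = cong₂ _∨'_ (subFm-subFm s' s e A) (subFm-subFm s' s e C)
subFm-subFm s' s e (A ⊃ C) = cong₂ _⊃_ (subFm-subFm s' s e A) (subFm-subFm s' s e C)
subFm-subFm s' s e (∀⊴ t A) = cong₂ ∀⊴ (subTm-subTm s' s e t) (subFm-subFm (liftS s') (liftS s) (liftS-liftS s' s e) A)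
subFm-subFm s' s e (∃⊴ t A) = cong₂ ∃⊴ (subTm-subTm s' s e t) (subFm-subFm (liftS s') (liftS s) (liftS-liftS s' s e) A)
subFm-subFm s' s e (∀' A) = cong ∀' (subFm-subFm (liftS s') (liftS s) (liftS-liftS s' s e) A)
subFm-subFm s' s e (∃' A) = cong ∃' (subFm-subFm (liftS s') (liftS s) (liftS-liftS s' s e) A)

subFm-id : ∀ {Γ} {s : Sub Γ Γ} → (∀ {σ} (v : Var Γ σ) → s v ≡ var v) → (A : Fm Γ) → subFm s A ≡ A
subFm-id e (t ≐ u) = cong₂ _≐_ (trans (subTm-ext e t) (subTm-var t)) (trans (subTm-ext e u) (subTm-var u))
subFm-id e (t ⊴ u) = cong₂ _⊴_ (trans (subTm-ext e t) (subTm-var t)) (trans (subTm-ext e u) (subTm-var u))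
subFm-id e ⊥' = refl
subFm-id e (A ∧' C) = cong₂ _∧'_ (subFm-id e A) (subFm-id e C)
subFm-id e (A ∨' C) = cong₂ _∨'_ (subFm-id e A) (subFm-id e C)
subFm-id e (A ⊃ C) = cong₂ _⊃_ (subFm-id e A) (subFm-id e C)
subFm-id e (∀⊴ t A) = cong₂ ∀⊴ (trans (subTm-ext e t) (subTm-var t)) (subFm-id (lv e) A)
  where lv : ∀ {Γ σ} {s : Sub Γ Γ} → (∀ {τ} (v : Var Γ τ) → s v ≡ var v) → ∀ {τ} (v : Var (σ ∷ Γ) τ) → liftS s v ≡ var v
        lv e here = refl
        lv e (there v) = cong (renTm there) (e v)
subFm-id e (∃⊴ t A) = cong₂ ∃⊴ (trans (subTm-ext e t) (subTm-var t)) (subFm-id (lv e) A)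
  where lv : ∀ {Γ σ} {s : Sub Γ Γ} → (∀ {τ} (v : Var Γ τ) → s v ≡ var v) → ∀ {τ} (v : Var (σ ∷ Γ) τ) → liftS s v ≡ var v
        lv e here = refl
        lv e (there v) = cong (renTm there) (e v)
subFm-id e (∀' A) = cong ∀' (subFm-id (lv e) A)
  where lv : ∀ {Γ σ} {s : Sub Γ Γ} → (∀ {τ} (v : Var Γ τ) → s v ≡ var v) → ∀ {τ} (v : Var (σ ∷ Γ) τ) → liftS s v ≡ var v
        lv e here = refl
        lv e (there v) = cong (renTm there) (e v)
subFm-id e (∃' A) = cong ∃' (subFm-id (lv e) A)
  where lv : ∀ {Γ σ} {s : Sub Γ Γ} → (∀ {τ} (v : Var Γ τ) → s v ≡ var v) → ∀ {τ} (v : Var (σ ∷ Γ) τ) → liftS s v ≡ var v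
        lv e here = refl
        lv e (there v) = cong (renTm there) (e v)

renFm-as-subFm : ∀ {Γ Δ} (r : Ren Γ Δ) (A : Fm Γ) → renFm r A ≡ subFm (λ v → var (r v)) A
renFm-as-subFm r A = trans (cong (renFm r) (sym (subFm-id (λ v → refl) A))) (renFm-subFm r var (λ v → refl) A)

renFm-id : ∀ {Γ} (A : Fm Γ) → renFm idR A ≡ A
renFm-id A = trans (renFm-as-subFm idR A) (subFm-id (λ v → refl) A)

sub1-wkTm : ∀ {Γ ρ σ} (u : Tm Γ σ) (t : Tm Γ ρ) → subTm (sub1 u) (wkTm t) ≡ t
sub1-wkTm u t = trans (subTm-renTm (sub1 u) there (λ v → refl) t) (subTm-var t)

subTms : ∀ {Γ Δ ρs} → Sub Γ Δ → Tms Γ ρs → Tms Δ ρs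
subTms s []ₜ = []ₜ
subTms s (t ∷ₜ ts) = subTm s t ∷ₜ subTms s ts

subTms-renTms : ∀ {Γ Δ Θ ρs} (s : Sub Δ Θ) (r : Ren Γ Δ) {s'' : Sub Γ Θ} → (∀ {σ} (v : Var Γ σ) → s (r v) ≡ s'' v) →
  (t : Tms Γ ρs) → subTms s (renTms r t) ≡ subTms s'' t
subTms-renTms s r e []ₜ = refl
subTms-renTms s r e (t ∷ₜ ts) = cong₂ _∷ₜ_ (subTm-renTm s r e t) (subTms-renTms s r e ts)

renTms-subTms : ∀ {Γ Δ Θ ρs} (r : Ren Δ Θ) (s : Sub Γ Δ) {s'' : Sub Γ Θ} →
  (∀ {σ} (v : Var Γ σ) → renTm r (s v) ≡ s'' v) → (t : Tms Γ ρs) → renTms r (subTms s t) ≡ subTms s'' t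
renTms-subTms r s e []ₜ = refl
renTms-subTms r s e (t ∷ₜ ts) = cong₂ _∷ₜ_ (renTm-subTm r s e t) (renTms-subTms r s e ts)

renTms-renTms : ∀ {Γ Δ Θ ρs} (r' : Ren Δ Θ) (r : Ren Γ Δ) {r'' : Ren Γ Θ} → (∀ {σ} (v : Var Γ σ) → r' (r v) ≡ r'' v) →
  (t : Tms Γ ρs) → renTms r' (renTms r t) ≡ renTms r'' t
renTms-renTms r' r e []ₜ = refl
renTms-renTms r' r e (t ∷ₜ ts) = cong₂ _∷ₜ_ (renTm-renTm r' r e t) (renTms-renTms r' r e ts)

subTms-subTms : ∀ {Γ Δ Θ ρs} (s' : Sub Δ Θ) (s : Sub Γ Δ) {s'' : Sub Γ Θ} →
  (∀ {σ} (v : Var Γ σ) → subTm s' (s v) ≡ s'' v) → (t : Tms Γ ρs) → subTms s' (subTms s t) ≡ subTms s'' t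
subTms-subTms s' s e []ₜ = refl
subTms-subTms s' s e (t ∷ₜ ts) = cong₂ _∷ₜ_ (subTm-subTm s' s e t) (subTms-subTms s' s e ts)

subTms-id : ∀ {Γ ρs} {s : Sub Γ Γ} → (∀ {σ} (v : Var Γ σ) → s v ≡ var v) → (t : Tms Γ ρs) → subTms s t ≡ t
subTms-id e []ₜ = refl
subTms-id e (t ∷ₜ ts) = cong₂ _∷ₜ_ (trans (subTm-ext e t) (subTm-var t)) (subTms-id e ts)

renTms-id : ∀ {Γ ρs} (t : Tms Γ ρs) → renTms idR t ≡ t
renTms-id []ₜ = refl
renTms-id (t ∷ₜ ts) = cong₂ _∷ₜ_ (renTm-id t) (renTms-id ts)

renTms-as-subTms : ∀ {Γ Δ ρs} (r : Ren Γ Δ) (t : Tms Γ ρs) → renTms r t ≡ subTms (λ v → var (r v)) t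
renTms-as-subTms r []ₜ = refl
renTms-as-subTms r (t ∷ₜ ts) = cong₂ _∷ₜ_ (sym (renTm-as-subTm r t)) (renTms-as-subTms r ts)

renTms-ext : ∀ {Γ Δ ρs} {r r' : Ren Γ Δ} → (∀ {σ} (v : Var Γ σ) → r v ≡ r' v) → (t : Tms Γ ρs) →
  renTms r t ≡ renTms r' t
renTms-ext e []ₜ = refl
renTms-ext e (t ∷ₜ ts) = cong₂ _∷ₜ_ (renTm-ext e t) (renTms-ext e ts)

sub1-wkTms : ∀ {Γ ρs σ} (u : Tm Γ σ) (t : Tms Γ ρs) → subTms (sub1 u) (renTms there t) ≡ t
sub1-wkTms u []ₜ = refl
sub1-wkTms u (t ∷ₜ ts) = cong₂ _∷ₜ_ (sub1-wkTm u t) (sub1-wkTms u ts)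

app*-sub : ∀ {Γ Δ ρs σ} (s : Sub Γ Δ) (f : Tm Γ (ρs ⇒* σ)) (xs : Tms Γ ρs) →
  subTm s (app* f xs) ≡ app* (subTm s f) (subTms s xs)
app*-sub s f []ₜ = refl
app*-sub s f (x ∷ₜ xs) = app*-sub s (f · x) xs

appTms-sub : ∀ {Γ Δ ρs} (σs : List Ty) (s : Sub Γ Δ) (fs : Tms Γ (map (ρs ⇒*_) σs)) (xs : Tms Γ ρs) →
  subTms s (appTms σs fs xs) ≡ appTms σs (subTms s fs) (subTms s xs)
appTms-sub [] s []ₜ xs = refl
appTms-sub (σ ∷ σs) s (f ∷ₜ fs) xs = cong₂ _∷ₜ_ (app*-sub s f xs) (appTms-sub σs s fs xs)

appEach-sub : ∀ {Γ Δ ρ} (σs : List Ty) (s : Sub Γ Δ) (fs : Tms Γ (map (ρ ⇒_) σs)) (w : Tm Γ ρ) →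
  subTms s (appEach σs fs w) ≡ appEach σs (subTms s fs) (subTm s w)
appEach-sub [] s []ₜ w = refl
appEach-sub (σ ∷ σs) s (f ∷ₜ fs) w = cong ((subTm s f · subTm s w) ∷ₜ_) (appEach-sub σs s fs w)

splitTms-subTms₁ : ∀ {Γ Δ} (as : List Ty) {bs} (s : Sub Γ Δ) (t : Tms Γ (as ++ bs)) →
  proj₁ (splitTms as (subTms s t)) ≡ subTms s (proj₁ (splitTms as t))
splitTms-subTms₁ [] s t = refl
splitTms-subTms₁ (a ∷ as) s (t ∷ₜ ts) = cong (subTm s t ∷ₜ_) (splitTms-subTms₁ as s ts)

splitTms-subTms₂ : ∀ {Γ Δ} (as : List Ty) {bs} (s : Sub Γ Δ) (t : Tms Γ (as ++ bs)) →
  proj₂ (splitTms as (subTms s t)) ≡ subTms s (proj₂ (splitTms as t))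
splitTms-subTms₂ [] s t = refl
splitTms-subTms₂ (a ∷ as) s (t ∷ₜ ts) = splitTms-subTms₂ as s ts

subst₃ : ∀ {A B C : Set} (P : A → B → C → Set) {a a' b b' c c'} → a ≡ a' → b ≡ b' → c ≡ c' → P a b c → P a' b' c'
subst₃ P refl refl refl p = p

liftR-wkTm : ∀ {Γ Δ ρ σ} (r : Ren Γ Δ) (t : Tm Γ ρ) → renTm (liftR {σ = σ} r) (wkTm t) ≡ wkTm (renTm r t)
liftR-wkTm r t = trans (renTm-renTm _ there (λ v → refl) t) (sym (renTm-renTm there r (λ v → refl) t))

liftR-wkFm : ∀ {Γ Δ σ} (r : Ren Γ Δ) (A : Fm Γ) → renFm (liftR {σ = σ} r) (wkFm A) ≡ wkFm (renFm r A)
liftR-wkFm r A = trans (renFm-renFm _ there (λ v → refl) A) (sym (renFm-renFm there r (λ v → refl) A))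

map-renFm-wkFm : ∀ {Γ Δ σ} (r : Ren Γ Δ) (Hs : List (Fm Γ)) →
  map (renFm (liftR {σ = σ} r)) (map wkFm Hs) ≡ map wkFm (map (renFm r) Hs)
map-renFm-wkFm r Hs = trans (sym (map-∘ Hs)) (trans (map-cong (liftR-wkFm r) Hs) (map-∘ Hs))

renFm-[] : ∀ {Γ Δ ρ} (r : Ren Γ Δ) (t : Tm Γ ρ) (A : Fm (ρ ∷ Γ)) → renFm r (A [ t ]) ≡ (renFm (liftR r) A) [ renTm r t ]
renFm-[] r t A = trans (renFm-subFm r (sub1 t) {s'' = σ} e A) (sym (subFm-renFm (sub1 (renTm r t)) (liftR r) {s'' = σ} e' A))
  where
  σ : Sub _ _
  σ here = renTm r t
  σ (there v) = var (r v)
  e : ∀ {τ} (v : Var _ τ) → renTm r (sub1 t v) ≡ σ v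
  e here = refl
  e (there v) = refl
  e' : ∀ {τ} (v : Var _ τ) → sub1 (renTm r t) (liftR r v) ≡ σ v
  e' here = refl
  e' (there v) = refl

renFm-sucS : ∀ {Γ Δ} (r : Ren Γ Δ) (A : Fm (ι ∷ Γ)) → renFm (liftR r) (subFm sucS A) ≡ subFm sucS (renFm (liftR r) A)
renFm-sucS r A = trans (renFm-subFm (liftR r) sucS {s'' = σ} e A) (sym (subFm-renFm sucS (liftR r) {s'' = σ} e' A))
  where
  σ : Sub _ _
  σ here = suc' · var here
  σ (there v) = var (there (r v))
  e : ∀ {τ} (v : Var _ τ) → renTm (liftR r) (sucS v) ≡ σ v
  e here = refl
  e (there v) = refl
  e' : ∀ {τ} (v : Var _ τ) → sucS (liftR r v) ≡ σ v
  e' here = refl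
  e' (there v) = refl

renTm-▷ : ∀ {Γ Δ ρ} (r : Ren Γ Δ) {t s : Tm Γ ρ} → t ▷ s → renTm r t ▷ renTm r s
renTm-▷ r βΠ = βΠ
renTm-▷ r βΣ = βΣ
renTm-▷ r βR0 = βR0
renTm-▷ r βRS = βRS

renFm-Bounded : ∀ {Γ Δ} (r : Ren Γ Δ) {A : Fm Γ} → Bounded A → Bounded (renFm r A)
renFm-Bounded r b≐ = b≐
renFm-Bounded r b⊴ = b⊴
renFm-Bounded r b⊥ = b⊥
renFm-Bounded r (b∧ a c) = b∧ (renFm-Bounded r a) (renFm-Bounded r c)
renFm-Bounded r (b∨ a c) = b∨ (renFm-Bounded r a) (renFm-Bounded r c)
renFm-Bounded r (b⊃ a c) = b⊃ (renFm-Bounded r a) (renFm-Bounded r c)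
renFm-Bounded r (b∀ a) = b∀ (renFm-Bounded (liftR r) a)
renFm-Bounded r (b∃ a) = b∃ (renFm-Bounded (liftR r) a)

RenClosed : Theory → Set
RenClosed T = ∀ {Γ Δ} (r : Ren Γ Δ) {A : Fm Γ} → T A → T (renFm r A)

-- The type tuples of A^U and of (A_K)^B agree only up to propositional equality
-- (negation introduces xs ++ []), so tuples of terms are transported along it.

cast : ∀ {Δ} {as bs : List Ty} → as ≡ bs → Tms Δ as → Tms Δ bs
cast {Δ} p t = subst (Tms Δ) p t

renTms-cast : ∀ {Δ Δ'} {as bs : List Ty} (r : Ren Δ Δ') (p : as ≡ bs) (t : Tms Δ as) →
  renTms r (cast p t) ≡ cast p (renTms r t)
renTms-cast r refl t = refl

subTms-cast : ∀ {Δ Δ'} {as bs : List Ty} (s : Sub Δ Δ') (p : as ≡ bs) (t : Tms Δ as) →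
  subTms s (cast p t) ≡ cast p (subTms s t)
subTms-cast s refl t = refl

cast-cast-sym : ∀ {Δ} {as bs : List Ty} (p : as ≡ bs) (t : Tms Δ bs) → cast p (cast (sym p) t) ≡ t
cast-cast-sym refl t = refl

cast-sym-cast : ∀ {Δ} {as bs : List Ty} (p : as ≡ bs) (t : Tms Δ as) → cast (sym p) (cast p t) ≡ t
cast-sym-cast refl t = refl

cast-irrelevant : ∀ {Δ} {as bs : List Ty} (p q : as ≡ bs) (t : Tms Δ as) → cast p t ≡ cast q t
cast-irrelevant p q t = cong (λ z → cast z t) (uip p q)

cast-cast : ∀ {Δ} {as bs cs : List Ty} (p : as ≡ bs) (q : bs ≡ cs) (t : Tms Δ as) →
  cast q (cast p t) ≡ cast (trans p q) t
cast-cast refl q t = refl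

cast-∷ : ∀ {Δ} {a} {as bs : List Ty} (p : as ≡ bs) (t : Tm Δ a) (ts : Tms Δ as) →
  cast (cong (a ∷_) p) (t ∷ₜ ts) ≡ t ∷ₜ cast p ts
cast-∷ refl t ts = refl

splitTms-cast₁ : ∀ {Δ} {as as' bs bs' : List Ty} (p : as ≡ as') (q : bs ≡ bs') (t : Tms Δ (as ++ bs)) →
  proj₁ (splitTms as' (cast (cong₂ _++_ p q) t)) ≡ cast p (proj₁ (splitTms as t))
splitTms-cast₁ refl refl t = refl

splitTms-cast₂ : ∀ {Δ} {as as' bs bs' : List Ty} (p : as ≡ as') (q : bs ≡ bs') (t : Tms Δ (as ++ bs)) →
  proj₂ (splitTms as' (cast (cong₂ _++_ p q) t)) ≡ cast q (proj₂ (splitTms as t))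
splitTms-cast₂ refl refl t = refl

appTms-cast : ∀ {Δ} {as bs : List Ty} {σs σs' : List Ty} (p : as ≡ bs) (q : σs ≡ σs') (Y : Tms Δ (map (as ⇒*_) σs))
    (x : Tms Δ as) →
  appTms σs' (cast (cong₂ (λ a b → map (a ⇒*_) b) p q) Y) (cast p x) ≡ cast q (appTms σs Y x)
appTms-cast refl refl Y x = refl

splitTms-++[] : ∀ {Δ} (as : List Ty) (e : as ≡ as ++ []) (t : Tms Δ as) → proj₁ (splitTms as (cast e t)) ≡ t
splitTms-++[] [] refl []ₜ = refl
splitTms-++[] (a ∷ as) e (t ∷ₜ ts) =
  trans (cong (λ z → proj₁ (splitTms (a ∷ as) (cast z (t ∷ₜ ts)))) (uip e (cong (a ∷_) (sym (++-identityʳ as)))))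
   (trans (cong (λ z → proj₁ (splitTms (a ∷ as) z)) (cast-∷ (sym (++-identityʳ as)) t ts))
          (cong (t ∷ₜ_) (splitTms-++[] as (sym (++-identityʳ as)) ts)))

splitTms-renTms₁ : ∀ {Δ Δ'} (as : List Ty) {bs} (r : Ren Δ Δ') (t : Tms Δ (as ++ bs)) →
  proj₁ (splitTms as (renTms r t)) ≡ renTms r (proj₁ (splitTms as t))
splitTms-renTms₁ [] r t = refl
splitTms-renTms₁ (a ∷ as) r (t ∷ₜ ts) = cong (renTm r t ∷ₜ_) (splitTms-renTms₁ as r ts)

splitTms-renTms₂ : ∀ {Δ Δ'} (as : List Ty) {bs} (r : Ren Δ Δ') (t : Tms Δ (as ++ bs)) →
  proj₂ (splitTms as (renTms r t)) ≡ renTms r (proj₂ (splitTms as t))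
splitTms-renTms₂ [] r t = refl
splitTms-renTms₂ (a ∷ as) r (t ∷ₜ ts) = splitTms-renTms₂ as r ts

_++ₜ_ : ∀ {Δ as bs} → Tms Δ as → Tms Δ bs → Tms Δ (as ++ bs)
[]ₜ ++ₜ vs = vs
(u ∷ₜ us) ++ₜ vs = u ∷ₜ (us ++ₜ vs)

splitTms-++ₜ₁ : ∀ {Δ} (as : List Ty) {bs} (u : Tms Δ as) (v : Tms Δ bs) → proj₁ (splitTms as (u ++ₜ v)) ≡ u
splitTms-++ₜ₁ [] []ₜ v = refl
splitTms-++ₜ₁ (a ∷ as) (u ∷ₜ us) v = cong (u ∷ₜ_) (splitTms-++ₜ₁ as us v)

splitTms-++ₜ₂ : ∀ {Δ} (as : List Ty) {bs} (u : Tms Δ as) (v : Tms Δ bs) → proj₂ (splitTms as (u ++ₜ v)) ≡ v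
splitTms-++ₜ₂ [] []ₜ v = refl
splitTms-++ₜ₂ (a ∷ as) (u ∷ₜ us) v = splitTms-++ₜ₂ as us v

splitTms-η : ∀ {Δ} (as : List Ty) {bs} (t : Tms Δ (as ++ bs)) → proj₁ (splitTms as t) ++ₜ proj₂ (splitTms as t) ≡ t
splitTms-η [] t = refl
splitTms-η (a ∷ as) (t ∷ₜ ts) = cong (t ∷ₜ_) (splitTms-η as ts)

renTms-++ₜ : ∀ {Δ Δ'} {as bs} (r : Ren Δ Δ') (u : Tms Δ as) (v : Tms Δ bs) →
  renTms r (u ++ₜ v) ≡ renTms r u ++ₜ renTms r v
renTms-++ₜ r []ₜ v = refl
renTms-++ₜ r (u ∷ₜ us) v = cong (renTm r u ∷ₜ_) (renTms-++ₜ r us v)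

substDer : ∀ {T : Theory} {Γ Hs} {A B : Fm Γ} → A ≡ B → Der T Γ Hs A → Der T Γ Hs B
substDer refl d = d

substHyps : ∀ {T : Theory} {Γ} {Hs Hs' : List (Fm Γ)} {A} → Hs ≡ Hs' → Der T Γ Hs A → Der T Γ Hs' A
substHyps refl d = d

Der-rename : ∀ {T : Theory} → RenClosed T → ∀ {Γ Δ Hs A} (r : Ren Γ Δ) → Der T Γ Hs A →
  Der T Δ (map (renFm r) Hs) (renFm r A)
Der-rename T-ren r (ax x) = ax (T-ren r x)
Der-rename T-ren r (hyp x) = hyp (∈-map⁺ _ x)
Der-rename T-ren r (⊥E d) = ⊥E (Der-rename T-ren r d)
Der-rename T-ren r (∧I d d₁) = ∧I (Der-rename T-ren r d) (Der-rename T-ren r d₁)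
Der-rename T-ren r (∧E₁ d) = ∧E₁ (Der-rename T-ren r d)
Der-rename T-ren r (∧E₂ d) = ∧E₂ (Der-rename T-ren r d)
Der-rename T-ren r (∨I₁ d) = ∨I₁ (Der-rename T-ren r d)
Der-rename T-ren r (∨I₂ d) = ∨I₂ (Der-rename T-ren r d)
Der-rename T-ren r (∨E d d₁ d₂) = ∨E (Der-rename T-ren r d) (Der-rename T-ren r d₁) (Der-rename T-ren r d₂)
Der-rename T-ren r (⊃I d) = ⊃I (Der-rename T-ren r d)
Der-rename T-ren r (⊃E d d₁) = ⊃E (Der-rename T-ren r d) (Der-rename T-ren r d₁)
Der-rename T-ren {Hs = Hs} r (∀I d) = ∀I (substHyps (map-renFm-wkFm r Hs) (Der-rename T-ren (liftR r) d))
Der-rename T-ren r (∀E {A = A} d t) = substDer (sym (renFm-[] r t A)) (∀E (Der-rename T-ren r d) (renTm r t))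
Der-rename T-ren r (∃I {A = A} t d) = ∃I (renTm r t) (substDer (renFm-[] r t A) (Der-rename T-ren r d))
Der-rename T-ren {Hs = Hs} r (∃E {C = C} d d₁) = ∃E (Der-rename T-ren r d)
    (substDer (liftR-wkFm r C) (substHyps (cong (_ ∷_) (map-renFm-wkFm r Hs)) (Der-rename T-ren (liftR r) d₁)))
Der-rename T-ren r (∀⊴ax t A) = subst (λ u → Der _ _ _
    ((∀⊴ (renTm r t) (renFm (liftR r) A)) ⇔ ∀' ((v0 ⊴ u) ⊃ renFm (liftR r) A))) (sym (liftR-wkTm r t))
    (∀⊴ax (renTm r t) (renFm (liftR r) A))
Der-rename T-ren r (∃⊴ax t A) = subst (λ u → Der _ _ _
    ((∃⊴ (renTm r t) (renFm (liftR r) A)) ⇔ ∃' ((v0 ⊴ u) ∧' renFm (liftR r) A))) (sym (liftR-wkTm r t))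
    (∃⊴ax (renTm r t) (renFm (liftR r) A))
Der-rename T-ren r (≐refl t) = ≐refl (renTm r t)
Der-rename T-ren r (≐sub {t = t} {s} A d d₁) = substDer (sym (renFm-[] r s A))
    (≐sub (renFm (liftR r) A) (Der-rename T-ren r d) (substDer (renFm-[] r t A) (Der-rename T-ren r d₁)))
Der-rename T-ren r (conv→ {t = t} {s} A x d) = substDer (sym (renFm-[] r s A))
    (conv→ (renFm (liftR r) A) (renTm-▷ r x) (substDer (renFm-[] r t A) (Der-rename T-ren r d)))
Der-rename T-ren r (conv← {t = t} {s} A x d) = substDer (sym (renFm-[] r t A))
    (conv← (renFm (liftR r) A) (renTm-▷ r x) (substDer (renFm-[] r s A) (Der-rename T-ren r d)))
Der-rename T-ren r (sucNZ t) = sucNZ (renTm r t)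
Der-rename T-ren r (sucInj t s) = sucInj (renTm r t) (renTm r s)
Der-rename T-ren r (ind A d d₁) = ind (renFm (liftR r) A) (substDer (renFm-[] r zero' A) (Der-rename T-ren r d))
  (substDer (cong (λ B → ∀' (renFm (liftR r) A ⊃ B)) (renFm-sucS r A)) (Der-rename T-ren r d₁))
Der-rename T-ren r (⊴₀ t s) = ⊴₀ (renTm r t) (renTm r s)
Der-rename T-ren r (⊴app x y v) = subst₃
    (λ a b c → Der _ _ _ ((renTm r x ⊴ renTm r y) ⊃ ∀⊴ (renTm r v) ((a · v0 ⊴ b · c) ∧' (b · v0 ⊴ b · c))))
  (sym (liftR-wkTm r x)) (sym (liftR-wkTm r y)) (sym (liftR-wkTm r v)) (⊴app (renTm r x) (renTm r y) (renTm r v))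
Der-rename T-ren r (⊴rule {ρ = ρ} A x t q d) = ⊴rule (renFm r A) (renFm-Bounded r x) (renTm r t) (renTm r q)
    (substDer eq (Der-rename T-ren (liftR (liftR r)) d))
  where
  eq : renFm (liftR (liftR r)) ((wkFm (wkFm A) ∧' (var (there here) ⊴ var here)) ⊃
             ((wkTm (wkTm t) · var (there here) ⊴ wkTm (wkTm q) · var here) ∧'
              (wkTm (wkTm q) · var (there here) ⊴ wkTm (wkTm q) · var here)))
       ≡ ((wkFm (wkFm (renFm r A)) ∧' (var (there here) ⊴ var here)) ⊃
             ((wkTm (wkTm (renTm r t)) · var (there here) ⊴ wkTm (wkTm (renTm r q)) · var here) ∧'
              (wkTm (wkTm (renTm r q)) · var (there here) ⊴ wkTm (wkTm (renTm r q)) · var here)))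
  ww : ∀ {ρ'} (u : Tm _ ρ') → renTm (liftR (liftR {σ = ρ} r)) (wkTm {σ = ρ} (wkTm u)) ≡ wkTm (wkTm (renTm r u))
  ww u = trans (liftR-wkTm (liftR r) (wkTm u)) (cong wkTm (liftR-wkTm r u))
  eq = cong₂ (λ a b → (a ∧' (var (there here) ⊴ var here)) ⊃ b)
         (trans (liftR-wkFm (liftR r) (wkFm A)) (cong wkFm (liftR-wkFm r A)))
         (cong₂ (λ a b → (a · var (there here) ⊴ b · var here) ∧' (b · var (there here) ⊴ b · var here)) (ww t) (ww q))

_⊆_ : ∀ {Γ} → List (Fm Γ) → List (Fm Γ) → Set
Hs ⊆ Hs' = ∀ {B} → B ∈ Hs → B ∈ Hs'

⊆-map : ∀ {Γ Δ} (f : Fm Γ → Fm Δ) {Hs Hs'} → Hs ⊆ Hs' → map f Hs ⊆ map f Hs'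
⊆-map f s m with ∈-map⁻ f m
... | B , m' , refl = ∈-map⁺ f (s m')

⊆-∷ : ∀ {Γ} {A : Fm Γ} {Hs Hs'} → Hs ⊆ Hs' → (A ∷ Hs) ⊆ (A ∷ Hs')
⊆-∷ s (here p) = here p
⊆-∷ s (there m) = there (s m)

Der-weaken : ∀ {T : Theory} {Γ Hs Hs' A} → Hs ⊆ Hs' → Der T Γ Hs A → Der T Γ Hs' A
Der-weaken s (ax x) = ax x
Der-weaken s (hyp x) = hyp (s x)
Der-weaken s (⊥E d) = ⊥E (Der-weaken s d)
Der-weaken s (∧I d d₁) = ∧I (Der-weaken s d) (Der-weaken s d₁)
Der-weaken s (∧E₁ d) = ∧E₁ (Der-weaken s d)
Der-weaken s (∧E₂ d) = ∧E₂ (Der-weaken s d)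
Der-weaken s (∨I₁ d) = ∨I₁ (Der-weaken s d)
Der-weaken s (∨I₂ d) = ∨I₂ (Der-weaken s d)
Der-weaken s (∨E d d₁ d₂) = ∨E (Der-weaken s d) (Der-weaken (⊆-∷ s) d₁) (Der-weaken (⊆-∷ s) d₂)
Der-weaken s (⊃I d) = ⊃I (Der-weaken (⊆-∷ s) d)
Der-weaken s (⊃E d d₁) = ⊃E (Der-weaken s d) (Der-weaken s d₁)
Der-weaken s (∀I d) = ∀I (Der-weaken (⊆-map wkFm s) d)
Der-weaken s (∀E d t) = ∀E (Der-weaken s d) t
Der-weaken s (∃I t d) = ∃I t (Der-weaken s d)
Der-weaken s (∃E d d₁) = ∃E (Der-weaken s d) (Der-weaken (⊆-∷ (⊆-map wkFm s)) d₁)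
Der-weaken s (∀⊴ax t A) = ∀⊴ax t A
Der-weaken s (∃⊴ax t A) = ∃⊴ax t A
Der-weaken s (≐refl t) = ≐refl t
Der-weaken s (≐sub A d d₁) = ≐sub A (Der-weaken s d) (Der-weaken s d₁)
Der-weaken s (conv→ A x d) = conv→ A x (Der-weaken s d)
Der-weaken s (conv← A x d) = conv← A x (Der-weaken s d)
Der-weaken s (sucNZ t) = sucNZ t
Der-weaken s (sucInj t s₁) = sucInj t s₁
Der-weaken s (ind A d d₁) = ind A (Der-weaken s d) (Der-weaken s d₁)
Der-weaken s (⊴₀ t s₁) = ⊴₀ t s₁
Der-weaken s (⊴app x y v) = ⊴app x y v
Der-weaken s (⊴rule A x t q d) = ⊴rule A x t q d

_⊩_ : ∀ {Γ} → (T : Theory) → List (Fm Γ) → List (Fm Γ) → Set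
_⊩_ {Γ} T Hs' Hs = ∀ {B} → B ∈ Hs → Der (λ {Δ} → T {Δ}) Γ Hs' B

Der-cut : ∀ {T : Theory} → RenClosed T → ∀ {Γ Hs Hs' A} → _⊩_ T Hs' Hs → Der T Γ Hs A → Der T Γ Hs' A
Der-cut T-ren e (ax x) = ax x
Der-cut T-ren e (hyp x) = e x
Der-cut T-ren e (⊥E d) = ⊥E (Der-cut T-ren e d)
Der-cut T-ren e (∧I d d₁) = ∧I (Der-cut T-ren e d) (Der-cut T-ren e d₁)
Der-cut T-ren e (∧E₁ d) = ∧E₁ (Der-cut T-ren e d)
Der-cut T-ren e (∧E₂ d) = ∧E₂ (Der-cut T-ren e d)
Der-cut T-ren e (∨I₁ d) = ∨I₁ (Der-cut T-ren e d)
Der-cut T-ren e (∨I₂ d) = ∨I₂ (Der-cut T-ren e d)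
Der-cut T-ren e (∨E d d₁ d₂) = ∨E (Der-cut T-ren e d) (Der-cut T-ren (ext e) d₁) (Der-cut T-ren (ext e) d₂)
  where ext : ∀ {T : Theory} {Γ} {Hs Hs' : List (Fm Γ)} {A} → _⊩_ T Hs' Hs → _⊩_ T (A ∷ Hs') (A ∷ Hs)
        ext e (here refl) = hyp (here refl)
        ext e (there m) = Der-weaken there (e m)
Der-cut T-ren e (⊃I d) = ⊃I (Der-cut T-ren (ext e) d)
  where ext : ∀ {T : Theory} {Γ} {Hs Hs' : List (Fm Γ)} {A} → _⊩_ T Hs' Hs → _⊩_ T (A ∷ Hs') (A ∷ Hs)
        ext e (here refl) = hyp (here refl)
        ext e (there m) = Der-weaken there (e m)
Der-cut T-ren e (⊃E d d₁) = ⊃E (Der-cut T-ren e d) (Der-cut T-ren e d₁)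
Der-cut T-ren e (∀I d) = ∀I (Der-cut T-ren extw d)
  where extw : _⊩_ _ (map wkFm _) (map wkFm _)
        extw m with ∈-map⁻ wkFm m
        ... | B , m' , refl = Der-rename T-ren there (e m')
Der-cut T-ren e (∀E d t) = ∀E (Der-cut T-ren e d) t
Der-cut T-ren e (∃I t d) = ∃I t (Der-cut T-ren e d)
Der-cut T-ren e (∃E d d₁) = ∃E (Der-cut T-ren e d) (Der-cut T-ren extw d₁)
  where extw : _⊩_ _ (_ ∷ map wkFm _) (_ ∷ map wkFm _)
        extw (here refl) = hyp (here refl)
        extw (there m) with ∈-map⁻ wkFm m
        ... | B , m' , refl = Der-weaken there (Der-rename T-ren there (e m'))
Der-cut T-ren e (∀⊴ax t A) = ∀⊴ax t A
Der-cut T-ren e (∃⊴ax t A) = ∃⊴ax t A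
Der-cut T-ren e (≐refl t) = ≐refl t
Der-cut T-ren e (≐sub A d d₁) = ≐sub A (Der-cut T-ren e d) (Der-cut T-ren e d₁)
Der-cut T-ren e (conv→ A x d) = conv→ A x (Der-cut T-ren e d)
Der-cut T-ren e (conv← A x d) = conv← A x (Der-cut T-ren e d)
Der-cut T-ren e (sucNZ t) = sucNZ t
Der-cut T-ren e (sucInj t s) = sucInj t s
Der-cut T-ren e (ind A d d₁) = ind A (Der-cut T-ren e d) (Der-cut T-ren e d₁)
Der-cut T-ren e (⊴₀ t s) = ⊴₀ t s
Der-cut T-ren e (⊴app x y v) = ⊴app x y v
Der-cut T-ren e (⊴rule A x t q d) = ⊴rule A x t q d

Der-mono : ∀ {T : Theory} {T' : Theory} → (∀ {Γ} {A : Fm Γ} → T A → T' A) → ∀ {Γ Hs A} → Der T Γ Hs A → Der T' Γ Hs A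
Der-mono i (ax x) = ax (i x)
Der-mono i (hyp x) = hyp x
Der-mono i (⊥E d) = ⊥E (Der-mono i d)
Der-mono i (∧I d d₁) = ∧I (Der-mono i d) (Der-mono i d₁)
Der-mono i (∧E₁ d) = ∧E₁ (Der-mono i d)
Der-mono i (∧E₂ d) = ∧E₂ (Der-mono i d)
Der-mono i (∨I₁ d) = ∨I₁ (Der-mono i d)
Der-mono i (∨I₂ d) = ∨I₂ (Der-mono i d)
Der-mono i (∨E d d₁ d₂) = ∨E (Der-mono i d) (Der-mono i d₁) (Der-mono i d₂)
Der-mono i (⊃I d) = ⊃I (Der-mono i d)
Der-mono i (⊃E d d₁) = ⊃E (Der-mono i d) (Der-mono i d₁)
Der-mono i (∀I d) = ∀I (Der-mono i d)
Der-mono i (∀E d t) = ∀E (Der-mono i d) t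
Der-mono i (∃I t d) = ∃I t (Der-mono i d)
Der-mono i (∃E d d₁) = ∃E (Der-mono i d) (Der-mono i d₁)
Der-mono i (∀⊴ax t A) = ∀⊴ax t A
Der-mono i (∃⊴ax t A) = ∃⊴ax t A
Der-mono i (≐refl t) = ≐refl t
Der-mono i (≐sub A d d₁) = ≐sub A (Der-mono i d) (Der-mono i d₁)
Der-mono i (conv→ A x d) = conv→ A x (Der-mono i d)
Der-mono i (conv← A x d) = conv← A x (Der-mono i d)
Der-mono i (sucNZ t) = sucNZ t
Der-mono i (sucInj t s) = sucInj t s
Der-mono i (ind A d d₁) = ind A (Der-mono i d) (Der-mono i d₁)
Der-mono i (⊴₀ t s) = ⊴₀ t s
Der-mono i (⊴app x y v) = ⊴app x y v
Der-mono i (⊴rule A x t q d) = ⊴rule A x t q (Der-mono i d)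

-- Quantifier bodies (KF) and interpretation matrices are Agda functions of a renaming and a
-- tuple, so nothing forces them to respect substitution; the rules for the tuple quantifiers
-- apply to bodies that do (Natural).

Commutes : ∀ {Δ₁ Δ₂ ρs} → Sub Δ₁ Δ₂ → KF Δ₁ ρs → KF Δ₂ ρs → Set
Commutes {Δ₁} {Δ₂} {ρs} s k k₂ = ∀ {Θ₁ Θ₂} (s' : Sub Θ₁ Θ₂) (r₁ : Ren Δ₁ Θ₁) (r₂ : Ren Δ₂ Θ₂) →
  (∀ {σ} (v : Var Δ₁ σ) → s' (r₁ v) ≡ renTm r₂ (s v)) → (us : Tms Θ₁ ρs) → subFm s' (k r₁ us) ≡ k₂ r₂ (subTms s' us)

Natural : ∀ {Δ ρs} → KF Δ ρs → Set
Natural k = Commutes var k k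

Commutes-cong : ∀ {Δ₁ Δ₂ ρs} {s : Sub Δ₁ Δ₂} {k k' : KF Δ₁ ρs} {k₂ k₂' : KF Δ₂ ρs} →
  (∀ {Θ} (r : Ren Δ₁ Θ) us → k r us ≡ k' r us) →
      (∀ {Θ} (r : Ren Δ₂ Θ) us → k₂ r us ≡ k₂' r us) → Commutes s k k₂ → Commutes s k' k₂'
Commutes-cong e e₂ R s' r₁ r₂ c us = trans (cong (subFm s') (sym (e r₁ us))) (trans (R s' r₁ r₂ c us) (e₂ r₂ _))

liftS-wkTms : ∀ {Γ Δ σ ρs} (s : Sub Γ Δ) (t : Tms Γ ρs) →
  subTms (liftS {σ = σ} s) (renTms there t) ≡ renTms there (subTms s t)
liftS-wkTms s t = trans (subTms-renTms (liftS s) there (λ v → refl) t) (sym (renTms-subTms there s (λ v → refl) t))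

Commutes-shift : ∀ {Δ₁ Δ₂ ρ ρs} {s : Sub Δ₁ Δ₂} {k : KF Δ₁ (ρ ∷ ρs)} {k₂ : KF Δ₂ (ρ ∷ ρs)} → Commutes s k k₂ →
  Commutes (liftS {σ = ρ} s) (λ r us → k (r ∘R there) (var (r here) ∷ₜ us)) (λ r us → k₂ (r ∘R there) (var (r here) ∷ₜ us))
Commutes-shift {s = s} {k₂ = k₂} R s' r₁ r₂ e us =
  trans (R s' (r₁ ∘R there) (r₂ ∘R there) (λ v → trans (e (there v)) (renTm-renTm r₂ there (λ _ → refl) (s v)))
      (var (r₁ here) ∷ₜ us))
        (cong (λ z → k₂ (r₂ ∘R there) (z ∷ₜ subTms s' us)) (e here))

∀̃⊴*-subFm : ∀ {Δ₁ Δ₂} ρs {s : Sub Δ₁ Δ₂} (ts : Tms Δ₁ ρs) {k : KF Δ₁ ρs} {k₂ : KF Δ₂ ρs} → Commutes s k k₂ →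
  subFm s (∀̃⊴* ρs ts k) ≡ ∀̃⊴* ρs (subTms s ts) k₂
∀̃⊴*-subFm [] {s} []ₜ R = R s idR idR (λ v → sym (renTm-id (s v))) []ₜ
∀̃⊴*-subFm (ρ ∷ ρs) {s} (t ∷ₜ ts) {k} {k₂} R = cong (λ z → ∀⊴ (subTm s t) ((v0 ⊴ v0) ⊃ z))
  (trans (∀̃⊴*-subFm ρs (renTms there ts) (Commutes-shift {k = k} {k₂ = k₂} R)) (cong (λ z → ∀̃⊴* ρs z _) (liftS-wkTms s ts)))

∃̃⊴*-subFm : ∀ {Δ₁ Δ₂} ρs {s : Sub Δ₁ Δ₂} (ts : Tms Δ₁ ρs) {k : KF Δ₁ ρs} {k₂ : KF Δ₂ ρs} → Commutes s k k₂ →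
  subFm s (∃̃⊴* ρs ts k) ≡ ∃̃⊴* ρs (subTms s ts) k₂
∃̃⊴*-subFm [] {s} []ₜ R = R s idR idR (λ v → sym (renTm-id (s v))) []ₜ
∃̃⊴*-subFm (ρ ∷ ρs) {s} (t ∷ₜ ts) {k} {k₂} R = cong (λ z → ∃⊴ (subTm s t) ((v0 ⊴ v0) ∧' z))
  (trans (∃̃⊴*-subFm ρs (renTms there ts) (Commutes-shift {k = k} {k₂ = k₂} R)) (cong (λ z → ∃̃⊴* ρs z _) (liftS-wkTms s ts)))

∀̃*-subFm : ∀ {Δ₁ Δ₂} ρs {s : Sub Δ₁ Δ₂} {k : KF Δ₁ ρs} {k₂ : KF Δ₂ ρs} → Commutes s k k₂ →
  subFm s (∀̃* ρs k) ≡ ∀̃* ρs k₂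
∀̃*-subFm [] {s} R = R s idR idR (λ v → sym (renTm-id (s v))) []ₜ
∀̃*-subFm (ρ ∷ ρs) {s} {k} {k₂} R = cong (λ z → ∀' ((v0 ⊴ v0) ⊃ z)) (∀̃*-subFm ρs (Commutes-shift {k = k} {k₂ = k₂} R))

∃̃*-subFm : ∀ {Δ₁ Δ₂} ρs {s : Sub Δ₁ Δ₂} {k : KF Δ₁ ρs} {k₂ : KF Δ₂ ρs} → Commutes s k k₂ →
  subFm s (∃̃* ρs k) ≡ ∃̃* ρs k₂
∃̃*-subFm [] {s} R = R s idR idR (λ v → sym (renTm-id (s v))) []ₜ
∃̃*-subFm (ρ ∷ ρs) {s} {k} {k₂} R = cong (λ z → ∃' ((v0 ⊴ v0) ∧' z)) (∃̃*-subFm ρs (Commutes-shift {k = k} {k₂ = k₂} R))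

∀̃⊴*-cong : ∀ {Δ} ρs (ts : Tms Δ ρs) {k k' : KF Δ ρs} → (∀ {Θ} (r : Ren Δ Θ) us → k r us ≡ k' r us) →
  ∀̃⊴* ρs ts k ≡ ∀̃⊴* ρs ts k'
∀̃⊴*-cong [] []ₜ e = e idR []ₜ
∀̃⊴*-cong (ρ ∷ ρs) (t ∷ₜ ts) e = cong (λ z → ∀⊴ t ((v0 ⊴ v0) ⊃ z)) (∀̃⊴*-cong ρs (renTms there ts) (λ r us → e (r ∘R there) _))

∃̃⊴*-cong : ∀ {Δ} ρs (ts : Tms Δ ρs) {k k' : KF Δ ρs} → (∀ {Θ} (r : Ren Δ Θ) us → k r us ≡ k' r us) →
  ∃̃⊴* ρs ts k ≡ ∃̃⊴* ρs ts k'
∃̃⊴*-cong [] []ₜ e = e idR []ₜ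
∃̃⊴*-cong (ρ ∷ ρs) (t ∷ₜ ts) e = cong (λ z → ∃⊴ t ((v0 ⊴ v0) ∧' z)) (∃̃⊴*-cong ρs (renTms there ts) (λ r us → e (r ∘R there) _))

∀̃*-cong : ∀ {Δ} ρs {k k' : KF Δ ρs} → (∀ {Θ} (r : Ren Δ Θ) us → k r us ≡ k' r us) → ∀̃* ρs k ≡ ∀̃* ρs k'
∀̃*-cong [] e = e idR []ₜ
∀̃*-cong (ρ ∷ ρs) e = cong (λ z → ∀' ((v0 ⊴ v0) ⊃ z)) (∀̃*-cong ρs (λ r us → e (r ∘R there) _))

∃̃*-cong : ∀ {Δ} ρs {k k' : KF Δ ρs} → (∀ {Θ} (r : Ren Δ Θ) us → k r us ≡ k' r us) → ∃̃* ρs k ≡ ∃̃* ρs k'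
∃̃*-cong [] e = e idR []ₜ
∃̃*-cong (ρ ∷ ρs) e = cong (λ z → ∃' ((v0 ⊴ v0) ∧' z)) (∃̃*-cong ρs (λ r us → e (r ∘R there) _))

NaturalInterp : ∀ {Γ} → Interp Γ → Set
NaturalInterp {Γ} I = ∀ {Δ Δ'} (s : Sub Δ Δ') (r : Ren Γ Δ) (r' : Ren Γ Δ') → (∀ {σ} (v : Var Γ σ) → s (r v) ≡ var (r' v)) →
  ∀ x y → subFm s (Interp.mat I r x y) ≡ Interp.mat I r' (subTms s x) (subTms s y)

matBody : ∀ {Γ Δ} (I : Interp Γ) → Ren Γ Δ → Tms Δ (Interp.xs I) → KF Δ (Interp.ys I)
matBody I r x = λ r₂ ỹ → Interp.mat I (r₂ ∘R r) (renTms r₂ x) ỹ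

matBody-commutes : ∀ {Γ Δ Δ'} (I : Interp Γ) → NaturalInterp I → (s : Sub Δ Δ') (r : Ren Γ Δ) (r' : Ren Γ Δ') →
  (∀ {σ} (v : Var Γ σ) → s (r v) ≡ var (r' v)) → ∀ x → Commutes s (matBody I r x) (matBody I r' (subTms s x))
matBody-commutes I N s r r' e x s' r₁ r₂ c us =
  trans (N s' (r₁ ∘R r) (r₂ ∘R r') (λ v → trans (c (r v)) (cong (renTm r₂) (e v))) (renTms r₁ x) us)
        (cong (λ z → Interp.mat I (r₂ ∘R r') z (subTms s' us))
              (trans (subTms-renTms s' r₁ c x) (sym (renTms-subTms r₂ s (λ v → refl) x))))

liftS-liftR-var : ∀ {Γ Δ Δ' σ} {s : Sub Δ Δ'} {r : Ren Γ Δ} {r' : Ren Γ Δ'} →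
  (∀ {τ} (v : Var Γ τ) → s (r v) ≡ var (r' v)) → ∀ {τ} (v : Var (σ ∷ Γ) τ) → liftS s (liftR r v) ≡ var (liftR r' v)
liftS-liftR-var e here = refl
liftS-liftR-var e (there v) = cong (renTm there) (e v)

natural-atomI : ∀ {Γ} (φ : Fm Γ) → NaturalInterp (atomI φ)
natural-atomI φ s r r' e x y = trans (subFm-renFm s r e φ) (sym (renFm-as-subFm r' φ))

natural-andI : ∀ {Γ} (I J : Interp Γ) → NaturalInterp I → NaturalInterp J → NaturalInterp (andI I J)
natural-andI I J NI NJ s r r' e x y =
  cong₂ _∧'_ (trans (NI s r r' e _ _) (sym
      (cong₂ (Interp.mat I r') (splitTms-subTms₁ (Interp.xs I) s x) (splitTms-subTms₁ (Interp.ys I) s y))))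
             (trans (NJ s r r' e _ _) (sym (cong₂ (Interp.mat J r') (splitTms-subTms₂ (Interp.xs I) s x)
                 (splitTms-subTms₂ (Interp.ys I) s y))))

natural-orB : ∀ {Γ} (I J : Interp Γ) → NaturalInterp I → NaturalInterp J → NaturalInterp (orB I J)
natural-orB I J NI NJ s r r' e x y =
  cong₂ _∨'_ (trans (∀̃⊴*-subFm (Interp.ys I) _ (matBody-commutes I NI s r r' e _))
                    (sym (cong₂ (λ a b → ∀̃⊴* (Interp.ys I) b (matBody I r' a)) (splitTms-subTms₁ (Interp.xs I) s x)
                        (splitTms-subTms₁ (Interp.ys I) s y))))
             (trans (∀̃⊴*-subFm (Interp.ys J) _ (matBody-commutes J NJ s r r' e _))
                    (sym (cong₂ (λ a b → ∀̃⊴* (Interp.ys J) b (matBody J r' a)) (splitTms-subTms₂ (Interp.xs I) s x)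
                        (splitTms-subTms₂ (Interp.ys I) s y))))

natural-impB : ∀ {Γ} (I J : Interp Γ) → NaturalInterp I → NaturalInterp J → NaturalInterp (impB I J)
natural-impB I J NI NJ s r r' e XY xy =
  cong₂ _⊃_ (trans (∀̃⊴*-subFm (Interp.ys I) _ (matBody-commutes I NI s r r' e _))
                   (sym (cong₂ (λ a b → ∀̃⊴* (Interp.ys I) b (matBody I r' a)) (splitTms-subTms₁ (Interp.xs I) s xy)
                          (trans (cong (λ z → appTms (Interp.ys I) z (subTms s xy))
                              (splitTms-subTms₂ (map (Interp.xs I ⇒*_) (Interp.xs J)) s XY))
                                 (sym (appTms-sub (Interp.ys I) s _ xy))))))
            (trans (NJ s r r' e _ _)
                   (sym (cong₂ (Interp.mat J r')
                     (trans (cong₂ (appTms (Interp.xs J)) (splitTms-subTms₁ (map (Interp.xs I ⇒*_) (Interp.xs J)) s XY)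
                         (splitTms-subTms₁ (Interp.xs I) s xy))
                            (sym (appTms-sub (Interp.xs J) s _ _)))
                     (splitTms-subTms₂ (Interp.xs I) s xy))))

natural-allBI : ∀ {Γ ρ} (t : Tm Γ ρ) (I : Interp (ρ ∷ Γ)) → NaturalInterp I → NaturalInterp (allBI t I)
natural-allBI t I NI s r r' e x y =
  cong₂ ∀⊴ (trans (subTm-renTm s r e t) (renTm-as-subTm r' t))
    (trans (NI (liftS s) (liftR r) (liftR r') (liftS-liftR-var e) _ _)
        (cong₂ (Interp.mat I (liftR r')) (liftS-wkTms s x) (liftS-wkTms s y)))

exBody : ∀ {Γ Δ ρ} (I : Interp (ρ ∷ Γ)) → Ren Γ Δ → Tms Δ (Interp.xs I) → KF (ρ ∷ Δ) (Interp.ys I)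
exBody I r x = λ r₂ ỹ → Interp.mat I (r₂ ∘R liftR r) (renTms (r₂ ∘R there) x) ỹ

exBody≡matBody : ∀ {Γ Δ ρ} (I : Interp (ρ ∷ Γ)) (r : Ren Γ Δ) x → ∀ {Θ} (r₂ : Ren (ρ ∷ Δ) Θ) us →
  exBody I r x r₂ us ≡ matBody I (liftR r) (renTms there x) r₂ us
exBody≡matBody I r x r₂ us = cong (λ z → Interp.mat I (r₂ ∘R liftR r) z us) (sym (renTms-renTms r₂ there (λ v → refl) x))

exBody-commutes : ∀ {Γ Δ Δ' ρ} (I : Interp (ρ ∷ Γ)) → NaturalInterp I → (s : Sub Δ Δ') (r : Ren Γ Δ) (r' : Ren Γ Δ') →
  (∀ {σ} (v : Var Γ σ) → s (r v) ≡ var (r' v)) → ∀ x → Commutes (liftS s) (exBody I r x) (exBody I r' (subTms s x))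
exBody-commutes I NI s r r' e x = Commutes-cong (λ r₂ us → sym (exBody≡matBody I r x r₂ us))
    (λ r₂ us → sym (exBody≡matBody I r' (subTms s x) r₂ us))
  (subst (λ z → Commutes (liftS s) (matBody I (liftR r) (renTms there x)) (matBody I (liftR r') z)) (liftS-wkTms s x)
    (matBody-commutes I NI (liftS s) (liftR r) (liftR r') (liftS-liftR-var e) (renTms there x)))

natural-exBB : ∀ {Γ ρ} (t : Tm Γ ρ) (I : Interp (ρ ∷ Γ)) → NaturalInterp I → NaturalInterp (exBB t I)
natural-exBB t I NI s r r' e x y =
  cong₂ ∃⊴ (trans (subTm-renTm s r e t) (renTm-as-subTm r' t))
    (trans (∀̃⊴*-subFm (Interp.ys I) _ (exBody-commutes I NI s r r' e x))
        (cong (λ z → ∀̃⊴* (Interp.ys I) z (exBody I r' (subTms s x))) (liftS-wkTms s y)))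

natural-allB : ∀ {Γ ρ} (I : Interp (ρ ∷ Γ)) → NaturalInterp I → NaturalInterp (allB I)
natural-allB I NI s r r' e X (w ∷ₜ y) =
  cong (∀⊴ (subTm s w))
    (trans (NI (liftS s) (liftR r) (liftR r') (liftS-liftR-var e) _ _)
           (cong₂ (Interp.mat I (liftR r'))
             (trans (appEach-sub (Interp.xs I) (liftS s) _ v0) (cong (λ z → appEach (Interp.xs I) z v0) (liftS-wkTms s X)))
             (liftS-wkTms s y)))

natural-exB : ∀ {Γ ρ} (I : Interp (ρ ∷ Γ)) → NaturalInterp I → NaturalInterp (exB I)
natural-exB I NI s r r' e (w ∷ₜ x) y =
  cong (∃⊴ (subTm s w))
    (trans (∀̃⊴*-subFm (Interp.ys I) _ (exBody-commutes I NI s r r' e x))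
        (cong (λ z → ∀̃⊴* (Interp.ys I) z (exBody I r' (subTms s x))) (liftS-wkTms s y)))

natural-B : ∀ {Γ} (A : Fm Γ) → NaturalInterp (B A)
natural-B (t ≐ s) = natural-atomI (t ≐ s)
natural-B (t ⊴ s) = natural-atomI (t ⊴ s)
natural-B ⊥' = natural-atomI ⊥'
natural-B (A ∧' C) = natural-andI (B A) (B C) (natural-B A) (natural-B C)
natural-B (A ∨' C) = natural-orB (B A) (B C) (natural-B A) (natural-B C)
natural-B (A ⊃ C) = natural-impB (B A) (B C) (natural-B A) (natural-B C)
natural-B (∀⊴ t A) = natural-allBI t (B A) (natural-B A)
natural-B (∃⊴ t A) = natural-exBB t (B A) (natural-B A)
natural-B (∀' A) = natural-allB (B A) (natural-B A)
natural-B (∃' A) = natural-exB (B A) (natural-B A)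

negBody : ∀ {Γ Δ} (I : Interp Γ) → Ren Γ Δ → Tms Δ (map (Interp.xs I ⇒*_) (Interp.ys I)) → KF Δ (Interp.xs I)
negBody I r Y = λ r₂ x̃ → ¬' (Interp.mat I (r₂ ∘R r) x̃ (appTms (Interp.ys I) (renTms r₂ Y) x̃))

negBody-commutes : ∀ {Γ Δ Δ'} (I : Interp Γ) → NaturalInterp I → (s : Sub Δ Δ') (r : Ren Γ Δ) (r' : Ren Γ Δ') →
  (∀ {σ} (v : Var Γ σ) → s (r v) ≡ var (r' v)) → ∀ Y → Commutes s (negBody I r Y) (negBody I r' (subTms s Y))
negBody-commutes I N s r r' e Y s' r₁ r₂ c us =
  cong ¬' (trans (N s' (r₁ ∘R r) (r₂ ∘R r') (λ v → trans (c (r v)) (cong (renTm r₂) (e v))) us _)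
    (cong (Interp.mat I (r₂ ∘R r') (subTms s' us))
      (trans (appTms-sub (Interp.ys I) s' _ us)
        (cong (λ z → appTms (Interp.ys I) z (subTms s' us))
            (trans (subTms-renTms s' r₁ c Y) (sym (renTms-subTms r₂ s (λ v → refl) Y)))))))

natural-negU : ∀ {Γ} (I : Interp Γ) → NaturalInterp I → NaturalInterp (negU I)
natural-negU I N s r r' e Y x = ∃̃⊴*-subFm (Interp.xs I) x (negBody-commutes I N s r r' e Y)

natural-orU : ∀ {Γ} (I J : Interp Γ) → NaturalInterp I → NaturalInterp J → NaturalInterp (orU I J)
natural-orU I J NI NJ s r r' e x y =
  cong₂ _∨'_ (trans (NI s r r' e _ _) (sym
      (cong₂ (Interp.mat I r') (splitTms-subTms₁ (Interp.xs I) s x) (splitTms-subTms₁ (Interp.ys I) s y))))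
             (trans (NJ s r r' e _ _) (sym (cong₂ (Interp.mat J r') (splitTms-subTms₂ (Interp.xs I) s x)
                 (splitTms-subTms₂ (Interp.ys I) s y))))

natural-allU : ∀ {Γ ρ} (I : Interp (ρ ∷ Γ)) → NaturalInterp I → NaturalInterp (allU I)
natural-allU I NI s r r' e (w ∷ₜ x) y =
  cong (∀⊴ (subTm s w))
    (trans (NI (liftS s) (liftR r) (liftR r') (liftS-liftR-var e) _ _)
        (cong₂ (Interp.mat I (liftR r')) (liftS-wkTms s x) (liftS-wkTms s y)))

natural-U : ∀ {Γ} (A : KFm Γ) → NaturalInterp (U A)
natural-U (k≐ t s) = natural-atomI (t ≐ s)
natural-U (k⊴ t s) = natural-atomI (t ⊴ s)
natural-U (k¬ A) = natural-negU (U A) (natural-U A)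
natural-U (k∨ A C) = natural-orU (U A) (U C) (natural-U A) (natural-U C)
natural-U (k∧ A C) = natural-andI (U A) (U C) (natural-U A) (natural-U C)
natural-U (k∀⊴ t A) = natural-allBI t (U A) (natural-U A)
natural-U (k∀ A) = natural-allU (U A) (natural-U A)

BoundedInterp : ∀ {Γ} → Interp Γ → Set
BoundedInterp {Γ} I = ∀ {Δ} (r : Ren Γ Δ) x y → Bounded (Interp.mat I r x y)

∀̃⊴*-Bounded : ∀ {Δ} ρs (ts : Tms Δ ρs) (k : KF Δ ρs) → (∀ {Θ} (r : Ren Δ Θ) us → Bounded (k r us)) →
  Bounded (∀̃⊴* ρs ts k)
∀̃⊴*-Bounded [] []ₜ k b = b idR []ₜ
∀̃⊴*-Bounded (ρ ∷ ρs) (t ∷ₜ ts) k b = b∀ (b⊃ b⊴ (∀̃⊴*-Bounded ρs (renTms there ts) _ (λ r us → b (r ∘R there) _)))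

∃̃⊴*-Bounded : ∀ {Δ} ρs (ts : Tms Δ ρs) (k : KF Δ ρs) → (∀ {Θ} (r : Ren Δ Θ) us → Bounded (k r us)) →
  Bounded (∃̃⊴* ρs ts k)
∃̃⊴*-Bounded [] []ₜ k b = b idR []ₜ
∃̃⊴*-Bounded (ρ ∷ ρs) (t ∷ₜ ts) k b = b∃ (b∧ b⊴ (∃̃⊴*-Bounded ρs (renTms there ts) _ (λ r us → b (r ∘R there) _)))

B-Bounded : ∀ {Γ} (A : Fm Γ) → BoundedInterp (B A)
B-Bounded (t ≐ s) r x y = b≐
B-Bounded (t ⊴ s) r x y = b⊴
B-Bounded ⊥' r x y = b⊥
B-Bounded (A ∧' C) r x y = b∧ (B-Bounded A r _ _) (B-Bounded C r _ _)
B-Bounded (A ∨' C) r x y = b∨ (∀̃⊴*-Bounded (Interp.ys (B A)) _ _ (λ r₂ us → B-Bounded A _ _ _))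
    (∀̃⊴*-Bounded (Interp.ys (B C)) _ _ (λ r₂ us → B-Bounded C _ _ _))
B-Bounded (A ⊃ C) r x y = b⊃ (∀̃⊴*-Bounded (Interp.ys (B A)) _ _ (λ r₂ us → B-Bounded A _ _ _)) (B-Bounded C r _ _)
B-Bounded (∀⊴ t A) r x y = b∀ (B-Bounded A _ _ _)
B-Bounded (∃⊴ t A) r x y = b∃ (∀̃⊴*-Bounded (Interp.ys (B A)) _ _ (λ r₂ us → B-Bounded A _ _ _))
B-Bounded (∀' A) r x (w ∷ₜ y) = b∀ (B-Bounded A _ _ _)
B-Bounded (∃' A) r (w ∷ₜ x) y = b∃ (∀̃⊴*-Bounded (Interp.ys (B A)) _ _ (λ r₂ us → B-Bounded A _ _ _))

U-Bounded : ∀ {Γ} (A : KFm Γ) → BoundedInterp (U A)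
U-Bounded (k≐ t s) r x y = b≐
U-Bounded (k⊴ t s) r x y = b⊴
U-Bounded (k¬ A) r x y = ∃̃⊴*-Bounded (Interp.xs (U A)) _ _ (λ r₂ us → b⊃ (U-Bounded A _ _ _) b⊥)
U-Bounded (k∨ A C) r x y = b∨ (U-Bounded A r _ _) (U-Bounded C r _ _)
U-Bounded (k∧ A C) r x y = b∧ (U-Bounded A r _ _) (U-Bounded C r _ _)
U-Bounded (k∀⊴ t A) r x y = b∀ (U-Bounded A _ _ _)
U-Bounded (k∀ A) r (w ∷ₜ x) y = b∀ (U-Bounded A _ _ _)

renBody : ∀ {Δ Δ' ρs} → Ren Δ Δ' → KF Δ ρs → KF Δ' ρs
renBody r₂ k = λ r' us → k (r' ∘R r₂) us

renBody-natural : ∀ {Δ Δ' ρs} (r₂ : Ren Δ Δ') {k : KF Δ ρs} → Natural k → Natural (renBody r₂ k)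
renBody-natural r₂ N s' r₁ r₂' c us = N s' (r₁ ∘R r₂) (r₂' ∘R r₂) (λ v → c (r₂ v)) us

renBody-commutes : ∀ {Δ Δ' ρs} (r₂ : Ren Δ Δ') {k : KF Δ ρs} → Natural k → Commutes (λ v → var (r₂ v)) k (renBody r₂ k)
renBody-commutes r₂ N s' r₁ r₂' c us = N s' r₁ (r₂' ∘R r₂) c us

renFm-∀̃⊴* : ∀ {Δ Δ'} ρs (r₂ : Ren Δ Δ') (ts : Tms Δ ρs) {k : KF Δ ρs} → Natural k →
  renFm r₂ (∀̃⊴* ρs ts k) ≡ ∀̃⊴* ρs (renTms r₂ ts) (renBody r₂ k)
renFm-∀̃⊴* ρs r₂ ts N = trans (renFm-as-subFm r₂ _)
    (trans (∀̃⊴*-subFm ρs ts (renBody-commutes r₂ N)) (cong (λ z → ∀̃⊴* ρs z _) (sym (renTms-as-subTms r₂ ts))))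

renFm-∃̃⊴* : ∀ {Δ Δ'} ρs (r₂ : Ren Δ Δ') (ts : Tms Δ ρs) {k : KF Δ ρs} → Natural k →
  renFm r₂ (∃̃⊴* ρs ts k) ≡ ∃̃⊴* ρs (renTms r₂ ts) (renBody r₂ k)
renFm-∃̃⊴* ρs r₂ ts N = trans (renFm-as-subFm r₂ _)
    (trans (∃̃⊴*-subFm ρs ts (renBody-commutes r₂ N)) (cong (λ z → ∃̃⊴* ρs z _) (sym (renTms-as-subTms r₂ ts))))

mat-cong : ∀ {Γ Δ} (I : Interp Γ) → NaturalInterp I → {r r' : Ren Γ Δ} → (∀ {σ} (v : Var Γ σ) → r v ≡ r' v) → ∀ x y →
  Interp.mat I r x y ≡ Interp.mat I r' x y
mat-cong I N {r} {r'} e x y = trans (sym (subFm-id (λ v → refl) _))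
  (trans (N var r r' (λ v → cong var (e v)) x y) (cong₂ (Interp.mat I r') (subTms-id (λ v → refl) x) (subTms-id (λ v → refl) y)))

matBody-natural : ∀ {Γ Δ} (I : Interp Γ) → NaturalInterp I → (r : Ren Γ Δ) → ∀ x → Natural (matBody I r x)
matBody-natural I N r x = subst (λ z → Commutes var (matBody I r x) (matBody I r z)) (subTms-id (λ v → refl) x)
    (matBody-commutes I N var r r (λ v → refl) x)

negBody-natural : ∀ {Γ Δ} (I : Interp Γ) → NaturalInterp I → (r : Ren Γ Δ) → ∀ Y → Natural (negBody I r Y)
negBody-natural I N r Y = subst (λ z → Commutes var (negBody I r Y) (negBody I r z)) (subTms-id (λ v → refl) Y)
    (negBody-commutes I N var r r (λ v → refl) Y)

sub1-v0-lift : ∀ {Γ ρ} (M : Fm (ρ ∷ Γ)) → subFm (sub1 v0) (renFm (liftR there) M) ≡ M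
sub1-v0-lift M = trans (subFm-renFm (sub1 v0) (liftR there) e M) (subFm-id (λ v → refl) M)
  where e : ∀ {τ} (v : Var _ τ) → sub1 v0 (liftR there v) ≡ var v
        e here = refl
        e (there v) = refl

∀̃*matBody-natural : ∀ {Γ} (I : Interp Γ) → NaturalInterp I →
  Natural {Γ} {Interp.xs I} (λ r X → ∀̃* (Interp.ys I) (matBody I r X))
∀̃*matBody-natural I N s' r₁ r₂ c us = ∀̃*-subFm (Interp.ys I) (matBody-commutes I N s' r₁ r₂ c us)

∃̃*matBody-natural : ∀ {Γ} (I : Interp Γ) → NaturalInterp I →
  Natural {Γ} {Interp.xs I} (λ r X → ∃̃* (Interp.ys I) (matBody I r X))
∃̃*matBody-natural I N s' r₁ r₂ c us = ∃̃*-subFm (Interp.ys I) (matBody-commutes I N s' r₁ r₂ c us)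

renFm-∀̃* : ∀ {Δ Δ'} ρs (r₂ : Ren Δ Δ') {k : KF Δ ρs} → Natural k → renFm r₂ (∀̃* ρs k) ≡ ∀̃* ρs (renBody r₂ k)
renFm-∀̃* ρs r₂ N = trans (renFm-as-subFm r₂ _) (∀̃*-subFm ρs (renBody-commutes r₂ N))

renFm-∃̃* : ∀ {Δ Δ'} ρs (r₂ : Ren Δ Δ') {k : KF Δ ρs} → Natural k → renFm r₂ (∃̃* ρs k) ≡ ∃̃* ρs (renBody r₂ k)
renFm-∃̃* ρs r₂ N = trans (renFm-as-subFm r₂ _) (∃̃*-subFm ρs (renBody-commutes r₂ N))

module Deduction (T : Theory) (T-ren : RenClosed T) where

  infix 2 _⊢_
  _⊢_ : ∀ {Γ} → List (Fm Γ) → Fm Γ → Set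
  _⊢_ {Γ} Hs A = Der T Γ Hs A

  Entails : ∀ {Δ Δ'} → Ren Δ Δ' → List (Fm Δ) → List (Fm Δ') → Set
  Entails r Hs Hs' = ∀ {B} → B ∈ Hs → Hs' ⊢ renFm r B

  transport : ∀ {Δ Δ'} {r : Ren Δ Δ'} {Hs Hs'} {A} → Entails r Hs Hs' → Hs ⊢ A → Hs' ⊢ renFm r A
  transport {r = r} e d = Der-cut T-ren f (Der-rename T-ren r d)
    where f : ∀ {B} → B ∈ map (renFm r) _ → _ ⊢ B
          f m with ∈-map⁻ (renFm r) m
          ... | B , m' , refl = e m'

  Entails-id : ∀ {Δ} {Hs : List (Fm Δ)} → Entails idR Hs Hs
  Entails-id {B = B} m = substDer (sym (renFm-id B)) (hyp m)

  Entails-∘ : ∀ {Δ Δ' Δ''} {r : Ren Δ Δ'} {r' : Ren Δ' Δ''} {Hs Hs' Hs''} → Entails r Hs Hs' → Entails r' Hs' Hs'' →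
    Entails (r' ∘R r) Hs Hs''
  Entails-∘ {r = r} {r'} e e' {B} m = substDer (renFm-renFm r' r (λ v → refl) B) (transport e' (e m))

  Entails-there : ∀ {Γ ρ} {Hs : List (Fm Γ)} {Hs' : List (Fm (ρ ∷ Γ))} → map wkFm Hs ⊆ Hs' → Entails there Hs Hs'
  Entails-there s m = hyp (s (∈-map⁺ wkFm m))

  weaken₁ : ∀ {Γ} {Hs : List (Fm Γ)} {A C} → Hs ⊢ C → (A ∷ Hs) ⊢ C
  weaken₁ = Der-weaken there

  hyp₀ : ∀ {Γ} {Hs : List (Fm Γ)} {A} → (A ∷ Hs) ⊢ A
  hyp₀ = hyp (here refl)

  hyp₁ : ∀ {Γ} {Hs : List (Fm Γ)} {A B} → (A ∷ B ∷ Hs) ⊢ B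
  hyp₁ = hyp (there (here refl))

  ⇔-intro : ∀ {Γ} {Hs : List (Fm Γ)} {A C : Fm Γ} → (A ∷ Hs) ⊢ C → (C ∷ Hs) ⊢ A → Hs ⊢ A ⇔ C
  ⇔-intro d e = ∧I (⊃I d) (⊃I e)

  ⇔-to : ∀ {Γ} {Hs : List (Fm Γ)} {A C : Fm Γ} → Hs ⊢ A ⇔ C → Hs ⊢ A → Hs ⊢ C
  ⇔-to d a = ⊃E (∧E₁ d) a

  ⇔-from : ∀ {Γ} {Hs : List (Fm Γ)} {A C : Fm Γ} → Hs ⊢ A ⇔ C → Hs ⊢ C → Hs ⊢ A
  ⇔-from d c = ⊃E (∧E₂ d) c

  ∀⊴-elim : ∀ {Γ ρ} {Hs : List (Fm Γ)} {t : Tm Γ ρ} {A} → Hs ⊢ ∀⊴ t A → (u : Tm Γ ρ) → Hs ⊢ u ⊴ t → Hs ⊢ A [ u ]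
  ∀⊴-elim {t = t} {A} d u hu = ⊃E (subst (λ z → _ ⊢ (u ⊴ z) ⊃ A [ u ]) (sub1-wkTm u t) (∀E (⊃E (∧E₁ (∀⊴ax t A)) d) u)) hu

  ∀⊴-intro : ∀ {Γ ρ} {Hs : List (Fm Γ)} {t : Tm Γ ρ} {A} → ((v0 ⊴ wkTm t) ∷ map wkFm Hs) ⊢ A → Hs ⊢ ∀⊴ t A
  ∀⊴-intro {t = t} {A} d = ⊃E (∧E₂ (∀⊴ax t A)) (∀I (⊃I d))

  ∃⊴-intro : ∀ {Γ ρ} {Hs : List (Fm Γ)} {t : Tm Γ ρ} {A} → (u : Tm Γ ρ) → Hs ⊢ u ⊴ t → Hs ⊢ A [ u ] → Hs ⊢ ∃⊴ t A
  ∃⊴-intro {t = t} {A} u hu d = ⊃E (∧E₂ (∃⊴ax t A)) (∃I u (∧I (subst (λ z → _ ⊢ u ⊴ z) (sym (sub1-wkTm u t)) hu) d))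

  ∃⊴-elim : ∀ {Γ ρ} {Hs : List (Fm Γ)} {t : Tm Γ ρ} {A C} → Hs ⊢ ∃⊴ t A →
    (((v0 ⊴ wkTm t) ∧' A) ∷ map wkFm Hs) ⊢ wkFm C → Hs ⊢ C
  ∃⊴-elim {t = t} {A} d e = ∃E (⊃E (∧E₁ (∃⊴ax t A)) d) e

  Majorized : ∀ {Δ} → List (Fm Δ) → ∀ {ρs} → Tms Δ ρs → Tms Δ ρs → Set
  Majorized Hs []ₜ []ₜ = ⊤
  Majorized Hs (u ∷ₜ us) (t ∷ₜ ts) = (Hs ⊢ u ⊴ t) × Majorized Hs us ts

  Majorized-rename : ∀ {Δ Δ'} {r : Ren Δ Δ'} {Hs Hs'} → Entails r Hs Hs' → ∀ {ρs} (us ts : Tms Δ ρs) →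
    Majorized Hs us ts → Majorized Hs' (renTms r us) (renTms r ts)
  Majorized-rename e []ₜ []ₜ tt = tt
  Majorized-rename e (u ∷ₜ us) (t ∷ₜ ts) (d , ds) = transport e d , Majorized-rename e us ts ds

  Majorized-weaken : ∀ {Δ} {Hs Hs' : List (Fm Δ)} → Hs ⊆ Hs' → ∀ {ρs} (us ts : Tms Δ ρs) → Majorized Hs us ts →
    Majorized Hs' us ts
  Majorized-weaken s []ₜ []ₜ tt = tt
  Majorized-weaken s (u ∷ₜ us) (t ∷ₜ ts) (d , ds) = Der-weaken s d , Majorized-weaken s us ts ds

  Majorized-subst : ∀ {Δ} {Hs : List (Fm Δ)} {ρs} {us us' ts ts' : Tms Δ ρs} → us ≡ us' → ts ≡ ts' →
    Majorized Hs us ts → Majorized Hs us' ts'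
  Majorized-subst refl refl d = d

  shiftBody : ∀ {Δ ρ ρs} → KF Δ (ρ ∷ ρs) → KF (ρ ∷ Δ) ρs
  shiftBody k = λ r us → k (r ∘R there) (var (r here) ∷ₜ us)

  instBody : ∀ {Δ ρ ρs} → KF Δ (ρ ∷ ρs) → Tm Δ ρ → KF Δ ρs
  instBody k u = λ r us → k r (renTm r u ∷ₜ us)

  shiftBody-natural : ∀ {Δ ρ ρs} {k : KF Δ (ρ ∷ ρs)} → Natural k → Natural (shiftBody k)
  shiftBody-natural {k = k} N s' r₁ r₂ c us = trans (N s' (r₁ ∘R there) (r₂ ∘R there) (λ v → c (there v)) (var (r₁ here) ∷ₜ us))
    (cong (λ z → k (r₂ ∘R there) (z ∷ₜ subTms s' us)) (c here))

  instBody-commutes : ∀ {Δ ρ ρs} {k : KF Δ (ρ ∷ ρs)} → Natural k → (u : Tm Δ ρ) →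
    Commutes (sub1 u) (shiftBody k) (instBody k u)
  instBody-commutes {k = k} N u s' r₁ r₂ c us = trans (N s' (r₁ ∘R there) r₂ (λ v → c (there v)) (var (r₁ here) ∷ₜ us))
    (cong (λ z → k r₂ (z ∷ₜ subTms s' us)) (c here))

  instBody-natural : ∀ {Δ ρ ρs} {k : KF Δ (ρ ∷ ρs)} → Natural k → (u : Tm Δ ρ) → Natural (instBody k u)
  instBody-natural {k = k} N u s' r₁ r₂ c us = trans (N s' r₁ r₂ c (renTm r₁ u ∷ₜ us))
    (cong (λ z → k r₂ (z ∷ₜ subTms s' us)) (trans (subTm-renTm s' r₁ c u) (renTm-as-subTm r₂ u)))

  instBody-idR : ∀ {Δ ρ ρs} (k : KF Δ (ρ ∷ ρs)) (u : Tm Δ ρ) us → instBody k u idR us ≡ k idR (u ∷ₜ us)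
  instBody-idR k u us = cong (λ z → k idR (z ∷ₜ us)) (renTm-id u)

  ∀̃⊴*-elim : ∀ {Δ} ρs {ts : Tms Δ ρs} {k : KF Δ ρs} {Hs} → Natural k → Hs ⊢ ∀̃⊴* ρs ts k → (us : Tms Δ ρs) →
    Majorized Hs us ts → Majorized Hs us us → Hs ⊢ k idR us
  ∀̃⊴*-elim [] {[]ₜ} N d []ₜ _ _ = d
  ∀̃⊴*-elim (ρ ∷ ρs) {t ∷ₜ ts} {k} N d (u ∷ₜ us) (l , ls) (rf , rfs) =
    substDer (instBody-idR k u us)
     (∀̃⊴*-elim ρs (instBody-natural N u)
      (subst (λ z → _ ⊢ ∀̃⊴* ρs z (instBody k u)) (sub1-wkTms u ts)
        (substDer (∀̃⊴*-subFm ρs (renTms there ts) (instBody-commutes N u)) (⊃E (∀⊴-elim d u l) rf)))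
      us ls rfs)

  -- Premises of the rules for tuple quantifiers hold in every extension of the context, since
  -- they are used under the binders of the quantifiers.
  ∀̃⊴*-Premise : ∀ {Δ} ρs → Tms Δ ρs → List (Fm Δ) → KF Δ ρs → Set
  ∀̃⊴*-Premise {Δ} ρs ts Hs k = ∀ {Δ'} (r : Ren Δ Δ') {Hs'} → Entails r Hs Hs' →
    (us : Tms Δ' ρs) → Majorized Hs' us (renTms r ts) → Majorized Hs' us us → Hs' ⊢ k r us

  ∀̃⊴*-intro : ∀ {Δ} ρs {ts : Tms Δ ρs} {k : KF Δ ρs} {Hs} → Natural k → ∀̃⊴*-Premise ρs ts Hs k → Hs ⊢ ∀̃⊴* ρs ts k
  ∀̃⊴*-intro [] {[]ₜ} N p = p idR Entails-id []ₜ tt tt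
  ∀̃⊴*-intro (ρ ∷ ρs) {t ∷ₜ ts} {k} {Hs} N p = ∀⊴-intro (⊃I (∀̃⊴*-intro ρs (shiftBody-natural N) q))
    where
    q : ∀̃⊴*-Premise ρs (renTms there ts) ((v0 ⊴ v0) ∷ (v0 ⊴ wkTm t) ∷ map wkFm Hs) (shiftBody k)
    q r' {Hs'} e us l rf = p (r' ∘R there) (λ {B} m → substDer (renFm-renFm r' there (λ v → refl) B)
        (e (there (there (∈-map⁺ wkFm m)))))
       (var (r' here) ∷ₜ us)
       (subst (λ z → Hs' ⊢ var (r' here) ⊴ z) (renTm-renTm r' there (λ v → refl) t) (e (there (here refl))) ,
        Majorized-subst refl (renTms-renTms r' there (λ v → refl) ts) l)
       (e (here refl) , rf)

  ∃̃⊴*-intro : ∀ {Δ} ρs {ts : Tms Δ ρs} {k : KF Δ ρs} {Hs} → Natural k → (us : Tms Δ ρs) → Majorized Hs us ts →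
    Majorized Hs us us → Hs ⊢ k idR us → Hs ⊢ ∃̃⊴* ρs ts k
  ∃̃⊴*-intro [] {[]ₜ} N []ₜ _ _ d = d
  ∃̃⊴*-intro (ρ ∷ ρs) {t ∷ₜ ts} {k} N (u ∷ₜ us) (l , ls) (rf , rfs) d =
    ∃⊴-intro u l (∧I rf (substDer (sym (∃̃⊴*-subFm ρs (renTms there ts) (instBody-commutes N u)))
      (subst (λ z → _ ⊢ ∃̃⊴* ρs z (instBody k u)) (sym (sub1-wkTms u ts))
        (∃̃⊴*-intro ρs (instBody-natural N u) us ls rfs (substDer (sym (instBody-idR k u us)) d)))))

  ∃̃⊴*-Premise : ∀ {Δ} ρs → Tms Δ ρs → List (Fm Δ) → KF Δ ρs → Fm Δ → Set
  ∃̃⊴*-Premise {Δ} ρs ts Hs k C = ∀ {Δ'} (r : Ren Δ Δ') {Hs'} → Entails r Hs Hs' →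
    (us : Tms Δ' ρs) → Majorized Hs' us (renTms r ts) → Majorized Hs' us us → Hs' ⊢ k r us → Hs' ⊢ renFm r C

  ∃̃⊴*-elim : ∀ {Δ} ρs {ts : Tms Δ ρs} {k : KF Δ ρs} {Hs} {C} → Natural k → Hs ⊢ ∃̃⊴* ρs ts k →
    ∃̃⊴*-Premise ρs ts Hs k C → Hs ⊢ C
  ∃̃⊴*-elim [] {[]ₜ} {C = C} N d p = substDer (renFm-id C) (p idR Entails-id []ₜ tt tt d)
  ∃̃⊴*-elim (ρ ∷ ρs) {t ∷ₜ ts} {k} {Hs} {C} N d p = ∃⊴-elim d (∃̃⊴*-elim ρs (shiftBody-natural N) (∧E₂ (∧E₂ hyp₀)) q)
    where
    q : ∃̃⊴*-Premise ρs (renTms there ts) (((v0 ⊴ wkTm t) ∧'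
        ((v0 ⊴ v0) ∧' ∃̃⊴* ρs (renTms there ts) (shiftBody k))) ∷ map wkFm Hs) (shiftBody k) (wkFm C)
    q r' {Hs'} e us l rf dk = substDer (sym (renFm-renFm r' there (λ v → refl) C))
      (p (r' ∘R there) (λ {B} m → substDer (renFm-renFm r' there (λ v → refl) B) (e (there (∈-map⁺ wkFm m))))
       (var (r' here) ∷ₜ us)
       (subst (λ z → Hs' ⊢ var (r' here) ⊴ z) (renTm-renTm r' there (λ v → refl) t) (∧E₁ (e (here refl))) ,
        Majorized-subst refl (renTms-renTms r' there (λ v → refl) ts) l)
       (∧E₁ (∧E₂ (e (here refl))) , rf) dk)

  ∀̃*-Premise : ∀ {Δ} ρs → List (Fm Δ) → KF Δ ρs → Set
  ∀̃*-Premise {Δ} ρs Hs k = ∀ {Δ'} (r : Ren Δ Δ') {Hs'} → Entails r Hs Hs' → (us : Tms Δ' ρs) → Majorized Hs' us us → Hs' ⊢ k r us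

  ∀̃*-intro : ∀ {Δ} ρs {k : KF Δ ρs} {Hs} → Natural k → ∀̃*-Premise ρs Hs k → Hs ⊢ ∀̃* ρs k
  ∀̃*-intro [] N p = p idR Entails-id []ₜ tt
  ∀̃*-intro (ρ ∷ ρs) {k} {Hs} N p = ∀I (⊃I (∀̃*-intro ρs (shiftBody-natural N) q))
    where
    q : ∀̃*-Premise ρs ((v0 ⊴ v0) ∷ map wkFm Hs) (shiftBody k)
    q r' {Hs'} e us rf = p (r' ∘R there) (λ {B} m → substDer (renFm-renFm r' there (λ v → refl) B) (e (there (∈-map⁺ wkFm m))))
       (var (r' here) ∷ₜ us) (e (here refl) , rf)

  ∀̃*-elim : ∀ {Δ} ρs {k : KF Δ ρs} {Hs} → Natural k → Hs ⊢ ∀̃* ρs k → (us : Tms Δ ρs) → Majorized Hs us us →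
    Hs ⊢ k idR us
  ∀̃*-elim [] N d []ₜ _ = d
  ∀̃*-elim (ρ ∷ ρs) {k} N d (u ∷ₜ us) (rf , rfs) =
    substDer (instBody-idR k u us) (∀̃*-elim ρs (instBody-natural N u)
        (substDer (∀̃*-subFm ρs (instBody-commutes N u)) (⊃E (∀E d u) rf)) us rfs)

  ∃̃*-intro : ∀ {Δ} ρs {k : KF Δ ρs} {Hs} → Natural k → (us : Tms Δ ρs) → Majorized Hs us us → Hs ⊢ k idR us →
    Hs ⊢ ∃̃* ρs k
  ∃̃*-intro [] N []ₜ _ d = d
  ∃̃*-intro (ρ ∷ ρs) {k} N (u ∷ₜ us) (rf , rfs) d =
    ∃I u (∧I rf (substDer (sym (∃̃*-subFm ρs (instBody-commutes N u)))
        (∃̃*-intro ρs (instBody-natural N u) us rfs (substDer (sym (instBody-idR k u us)) d))))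

  ∃̃*-Premise : ∀ {Δ} ρs → List (Fm Δ) → KF Δ ρs → Fm Δ → Set
  ∃̃*-Premise {Δ} ρs Hs k C = ∀ {Δ'} (r : Ren Δ Δ') {Hs'} → Entails r Hs Hs' →
    (us : Tms Δ' ρs) → Majorized Hs' us us → Hs' ⊢ k r us → Hs' ⊢ renFm r C

  ∃̃*-elim : ∀ {Δ} ρs {k : KF Δ ρs} {Hs} {C} → Natural k → Hs ⊢ ∃̃* ρs k → ∃̃*-Premise ρs Hs k C → Hs ⊢ C
  ∃̃*-elim [] {C = C} N d p = substDer (renFm-id C) (p idR Entails-id []ₜ tt d)
  ∃̃*-elim (ρ ∷ ρs) {k} {Hs} {C} N d p = ∃E d (∃̃*-elim ρs (shiftBody-natural N) (∧E₂ hyp₀) q)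
    where
    q : ∃̃*-Premise ρs (((v0 ⊴ v0) ∧' ∃̃* ρs (shiftBody k)) ∷ map wkFm Hs) (shiftBody k) (wkFm C)
    q r' {Hs'} e us rf dk = substDer (sym (renFm-renFm r' there (λ v → refl) C))
      (p (r' ∘R there) (λ {B} m → substDer (renFm-renFm r' there (λ v → refl) B) (e (there (∈-map⁺ wkFm m))))
       (var (r' here) ∷ₜ us) (∧E₁ (e (here refl)) , rf) dk)

  ∀̃⊴*-elim-transport : ∀ {Δ Δ'} ρs {ts : Tms Δ ρs} {k : KF Δ ρs} {Hs Hs'} {r : Ren Δ Δ'} → Natural k →
    Entails r Hs Hs' → Hs ⊢ ∀̃⊴* ρs ts k → (us : Tms Δ' ρs) → Majorized Hs' us (renTms r ts) → Majorized Hs' us us →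
    Hs' ⊢ k r us
  ∀̃⊴*-elim-transport ρs {ts} {k} {r = r} N e d us l rf = ∀̃⊴*-elim ρs (renBody-natural r N)
      (substDer (renFm-∀̃⊴* ρs r ts N) (transport e d)) us l rf

  Majorized-cast : ∀ {Δ} {Hs : List (Fm Δ)} {as bs : List Ty} (p : as ≡ bs) (u t : Tms Δ as) → Majorized Hs u t →
    Majorized Hs (cast p u) (cast p t)
  Majorized-cast refl u t d = d

  Majorized-++ₜ : ∀ {Δ} {Hs : List (Fm Δ)} {as bs} (u t : Tms Δ as) (u' t' : Tms Δ bs) → Majorized Hs u t →
    Majorized Hs u' t' → Majorized Hs (u ++ₜ u') (t ++ₜ t')
  Majorized-++ₜ []ₜ []ₜ u' t' _ d = d
  Majorized-++ₜ (u ∷ₜ us) (t ∷ₜ ts) u' t' (d , ds) e = d , Majorized-++ₜ us ts u' t' ds e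

  Majorized-split₁ : ∀ {Δ} {Hs : List (Fm Δ)} (as : List Ty) {bs} (u t : Tms Δ (as ++ bs)) → Majorized Hs u t →
    Majorized Hs (proj₁ (splitTms as u)) (proj₁ (splitTms as t))
  Majorized-split₁ [] u t d = tt
  Majorized-split₁ (a ∷ as) (u ∷ₜ us) (t ∷ₜ ts) (d , ds) = d , Majorized-split₁ as us ts ds

  Majorized-split₂ : ∀ {Δ} {Hs : List (Fm Δ)} (as : List Ty) {bs} (u t : Tms Δ (as ++ bs)) → Majorized Hs u t →
    Majorized Hs (proj₂ (splitTms as u)) (proj₂ (splitTms as t))
  Majorized-split₂ [] u t d = d
  Majorized-split₂ (a ∷ as) (u ∷ₜ us) (t ∷ₜ ts) (d , ds) = Majorized-split₂ as us ts ds

  ∀̃*-elim-transport : ∀ {Δ Δ'} ρs {k : KF Δ ρs} {Hs Hs'} {r : Ren Δ Δ'} → Natural k → Entails r Hs Hs' →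
    Hs ⊢ ∀̃* ρs k → (us : Tms Δ' ρs) → Majorized Hs' us us → Hs' ⊢ k r us
  ∀̃*-elim-transport ρs {k} {r = r} N e d us rf = ∀̃*-elim ρs (renBody-natural r N)
      (substDer (renFm-∀̃* ρs r N) (transport e d)) us rf

module Majorizability (T : Theory) (T-ren : RenClosed T) where

  open Deduction T T-ren

  private

    x0 : ∀ {Γ ρ} → Tm (ρ ∷ Γ) ρ
    x0 = var here
    x1 : ∀ {Γ ρ σ} → Tm (σ ∷ ρ ∷ Γ) ρ
    x1 = var (there here)
    x2 : ∀ {Γ ρ σ τ} → Tm (τ ∷ σ ∷ ρ ∷ Γ) ρ
    x2 = var (there (there here))

    Z : ∀ {Γ} → Tm Γ ι
    Z = zero'
    S : ∀ {Γ} → Tm Γ ι → Tm Γ ι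
    S t = suc' · t
    pd : ∀ {Γ} → Tm Γ ι → Tm Γ ι
    pd u = Rc · u · zero' · (Πc · Ic)

    module _ {Γ : Ctx} {Hs : List (Fm Γ)} where
      ≐sym : {t s : Tm Γ ι} → Hs ⊢ t ≐ s → Hs ⊢ s ≐ t
      ≐sym {t} {s} d = subst (λ z → Hs ⊢ s ≐ z) (sub1-wkTm s t)
          (≐sub (v0 ≐ wkTm t) d (subst (λ z → Hs ⊢ t ≐ z) (sym (sub1-wkTm t t)) (≐refl t)))

      infixr 4 _∙_
      _∙_ : {t s u : Tm Γ ι} → Hs ⊢ t ≐ s → Hs ⊢ s ≐ u → Hs ⊢ t ≐ u
      _∙_ {t} {s} {u} d e = subst (λ z → Hs ⊢ z ≐ u) (sub1-wkTm u t)
          (≐sub (wkTm t ≐ v0) e (subst (λ z → Hs ⊢ z ≐ s) (sym (sub1-wkTm s t)) d))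

      ▷⇒≐ : {t s : Tm Γ ι} → t ▷ s → Hs ⊢ t ≐ s
      ▷⇒≐ {t} {s} r = subst (λ z → Hs ⊢ t ≐ z) (sub1-wkTm t s)
        (conv← (v0 ≐ wkTm s) r (subst (λ z → Hs ⊢ s ≐ z) (sym (sub1-wkTm s s)) (≐refl s)))

      ▷⇒≐-under : ∀ {ρ} (C : Tm (ρ ∷ Γ) ι) {t s : Tm Γ ρ} → t ▷ s → Hs ⊢ subTm (sub1 t) C ≐ subTm (sub1 s) C
      ▷⇒≐-under C {t} {s} r = subst (λ z → Hs ⊢ subTm (sub1 t) C ≐ z) (sub1-wkTm t (subTm (sub1 s) C))
        (conv← (C ≐ wkTm (subTm (sub1 s) C)) r (subst (λ z → Hs ⊢ subTm (sub1 s) C ≐ z) (sym (sub1-wkTm s _)) (≐refl _)))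

      ≐cong : (C : Tm (ι ∷ Γ) ι) {t s : Tm Γ ι} → Hs ⊢ t ≐ s → Hs ⊢ subTm (sub1 t) C ≐ subTm (sub1 s) C
      ≐cong C {t} {s} d = subst (λ z → Hs ⊢ z ≐ subTm (sub1 s) C) (sub1-wkTm s (subTm (sub1 t) C))
        (≐sub (wkTm (subTm (sub1 t) C) ≐ C) d (subst (λ z → Hs ⊢ z ≐ subTm (sub1 t) C) (sym (sub1-wkTm t _)) (≐refl _)))

      ∀E2 : ∀ {ρ σ} {Φ : Fm (σ ∷ ρ ∷ Γ)} → Hs ⊢ ∀' (∀' Φ) → (a : Tm Γ ρ) (b : Tm Γ σ) →
        Hs ⊢ subFm ((b ∷ₜ a ∷ₜ []ₜ) ++ˢ var) Φ
      ∀E2 {Φ = Φ} d a b = substDer (subFm-subFm (sub1 b) (liftS (sub1 a)) e Φ) (∀E (∀E d a) b)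
        where e : ∀ {τ} (v : Var _ τ) → subTm (sub1 b) (liftS (sub1 a) v) ≡ ((b ∷ₜ a ∷ₜ []ₜ) ++ˢ var) v
              e here = refl
              e (there here) = sub1-wkTm b a
              e (there (there v)) = refl

      ∀E3 : ∀ {ρ σ τ} {Φ : Fm (τ ∷ σ ∷ ρ ∷ Γ)} → Hs ⊢ ∀' (∀' (∀' Φ)) → (a : Tm Γ ρ) (b : Tm Γ σ) (c : Tm Γ τ) →
        Hs ⊢ subFm ((c ∷ₜ b ∷ₜ a ∷ₜ []ₜ) ++ˢ var) Φ
      ∀E3 {Φ = Φ} d a b c = substDer (subFm-subFm ((c ∷ₜ b ∷ₜ []ₜ) ++ˢ var) (liftS (liftS (sub1 a))) e Φ) (∀E2 (∀E d a) b c)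
        where e : ∀ {τ} (v : Var _ τ) → subTm ((c ∷ₜ b ∷ₜ []ₜ) ++ˢ var) (liftS (liftS (sub1 a)) v) ≡
                ((c ∷ₜ b ∷ₜ a ∷ₜ []ₜ) ++ˢ var) v
              e here = refl
              e (there here) = refl
              e (there (there here)) = trans (cong (subTm _) (renTm-renTm there there (λ v → refl) a))
                  (trans (subTm-renTm _ (λ v → there (there v)) (λ v → refl) a) (subTm-var a))
              e (there (there (there v))) = refl

    predc-unfold : ∀ {Γ} {Hs : List (Fm Γ)} → Hs ⊢ ∀' (predc · x0 ≐ pd x0)
    predc-unfold = ∀I (▷⇒≐ βΣ ∙ ▷⇒≐-under (v0 · wkTm (Πc · (Πc · Ic) · x0)) βΣ ∙ ▷⇒≐-under
        (Rc · wkTm x0 · v0 · wkTm (Πc · (Πc · Ic) · x0)) βΠ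
                ∙ ▷⇒≐-under (Rc · wkTm x0 · zero' · v0) βΠ)

    monus-suc-∀ : ∀ {Γ} {Hs : List (Fm Γ)} → Hs ⊢ ∀' (∀' (monus x1 (S x0) ≐ pd (monus x1 x0)))
    monus-suc-∀ = ∀I (∀I (▷⇒≐ βRS ∙ ▷⇒≐-under (v0 · wkTm x0) βΣ ∙ ▷⇒≐-under
        (v0 · wkTm (predc · monus x1 x0) · wkTm x0) βΠ ∙ ▷⇒≐ βΠ
                ∙ ∀E predc-unfold (monus x1 x0)))

    pred-suc-∀ : ∀ {Γ} {Hs : List (Fm Γ)} → Hs ⊢ ∀' (pd (S x0) ≐ x0)
    pred-suc-∀ = ∀I (▷⇒≐ βRS ∙ ▷⇒≐-under (v0 · wkTm x0) βΠ ∙ ▷⇒≐ βΣ ∙ ▷⇒≐ βΠ)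

    monus-zero : ∀ {Γ} {Hs : List (Fm Γ)} (a : Tm Γ ι) → Hs ⊢ monus a Z ≐ a
    monus-zero a = ▷⇒≐ βR0

    monus-suc : ∀ {Γ} {Hs : List (Fm Γ)} → (a b : Tm Γ ι) → Hs ⊢ monus a (S b) ≐ pd (monus a b)
    monus-suc a b = ∀E2 monus-suc-∀ a b

    pred-zero : ∀ {Γ} {Hs : List (Fm Γ)} → Hs ⊢ pd Z ≐ Z
    pred-zero = ▷⇒≐ βR0

    pred-suc : ∀ {Γ} {Hs : List (Fm Γ)} (a : Tm Γ ι) → Hs ⊢ pd (S a) ≐ a
    pred-suc a = ∀E pred-suc-∀ a

    pred-cong : ∀ {Γ} {Hs : List (Fm Γ)} → {a b : Tm Γ ι} → Hs ⊢ a ≐ b → Hs ⊢ pd a ≐ pd b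
    pred-cong d = ≐cong (Rc · v0 · zero' · (Πc · Ic)) d

    zero-monus : ∀ {Γ} {Hs : List (Fm Γ)} → Hs ⊢ ∀' (monus Z x0 ≐ Z)
    zero-monus = ind (monus Z x0 ≐ Z) (monus-zero Z) (∀I (⊃I (monus-suc Z x0 ∙ pred-cong hyp₀ ∙ pred-zero)))

    suc-monus-suc-∀ : ∀ {Γ} {Hs : List (Fm Γ)} → Hs ⊢ ∀' (∀' (monus (S x0) (S x1) ≐ monus x0 x1))
    suc-monus-suc-∀ = ind (∀' (monus (S x0) (S x1) ≐ monus x0 x1))
             (∀I (monus-suc (S x0) Z ∙ pred-cong (monus-zero (S x0)) ∙ pred-suc x0 ∙ ≐sym (monus-zero x0)))
             (∀I (⊃I (∀I (monus-suc (S x0) (S x1) ∙ pred-cong (∀E hyp₀ x0) ∙ ≐sym (monus-suc x0 x1)))))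

    suc-monus-suc : ∀ {Γ} {Hs : List (Fm Γ)} → (y x : Tm Γ ι) → Hs ⊢ monus (S x) (S y) ≐ monus x y
    suc-monus-suc y x = ∀E2 suc-monus-suc-∀ y x

    monus-self : ∀ {Γ} {Hs : List (Fm Γ)} → Hs ⊢ ∀' (monus x0 x0 ≐ Z)
    monus-self = ind (monus x0 x0 ≐ Z) (monus-zero Z) (∀I (⊃I (suc-monus-suc x0 x0 ∙ hyp₀)))

    zero-or-suc : ∀ {Γ} {Hs : List (Fm Γ)} → Hs ⊢ ∀' ((x0 ≐ Z) ∨' ∃' (x1 ≐ S x0))
    zero-or-suc = ind ((x0 ≐ Z) ∨' ∃' (x1 ≐ S x0)) (∨I₁ (≐refl Z)) (∀I (⊃I (∨I₂ (∃I x0 (≐refl (S x0))))))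

    x3 : ∀ {Γ ρ σ τ υ} → Tm (υ ∷ τ ∷ σ ∷ ρ ∷ Γ) ρ
    x3 = var (there (there (there here)))
    x4 : ∀ {Γ ρ σ τ υ φ} → Tm (φ ∷ υ ∷ τ ∷ σ ∷ ρ ∷ Γ) ρ
    x4 = var (there (there (there (there here))))
    x5 : ∀ {Γ ρ σ τ υ φ χ} → Tm (χ ∷ φ ∷ υ ∷ τ ∷ σ ∷ ρ ∷ Γ) ρ
    x5 = var (there (there (there (there (there here)))))

    Leq-trans-∀ : ∀ {Γ} {Hs : List (Fm Γ)} → Hs ⊢ ∀' (∀' (∀' (Leq x1 x0 ⊃ Leq x0 x2 ⊃ Leq x1 x2)))
    Leq-trans-∀ = ind (∀' (∀' (Leq x1 x0 ⊃ Leq x0 x2 ⊃ Leq x1 x2)))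
      (∀I (∀I (⊃I (⊃I (≐sub (monus x2 v0 ≐ zero') (≐sym (monus-zero x0) ∙ hyp₀) (hyp (there (here refl))))))))
      (∀I (⊃I (∀I (∀I (⊃I (⊃I (∨E (∀E zero-or-suc x0) caseZ caseS)))))))
      where
      caseZ = ≐sub (monus v0 (S x3) ≐ zero')
                (≐sym (≐sym (monus-zero x1) ∙ ≐sub (monus x2 v0 ≐ zero') hyp₀ (hyp (there (there (here refl))))))
                (∀E zero-monus (S x2))
      caseS = ∃E hyp₀
        (∨E (∀E zero-or-suc x2)
           (≐sub (monus v0 (S x4) ≐ zero') (≐sym hyp₀) (∀E zero-monus (S x3)))
           (∃E hyp₀
             (≐sub (monus v0 (S x5) ≐ zero') (≐sym hyp₀)
               (suc-monus-suc x4 x0 ∙ ⊃E (⊃E (∀E2 (hyp (there (there (there (there (there (there (here refl)))))))) x0 x1)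
                      (≐sym (suc-monus-suc x1 x0) ∙ ≐sub (monus (S x1) v0 ≐ zero') (hyp (there (there (here refl))))
                                (≐sub (monus v0 x3 ≐ zero') hyp₀ (hyp (there (there (there (there (there (here refl))))))))))
                    (≐sym (suc-monus-suc x4 x1) ∙ ≐sub (monus v0 (S x5) ≐ zero') (hyp (there (there (here refl))))
                        (hyp (there (there (there (there (here refl)))))))))))

  Leq-trans : ∀ {Γ} {Hs : List (Fm Γ)} {a b c : Tm Γ ι} → Hs ⊢ Leq a b → Hs ⊢ Leq b c → Hs ⊢ Leq a c
  Leq-trans {a = a} {b} {c} d e = ⊃E (⊃E (∀E3 Leq-trans-∀ c a b) d) e

  Leq-reflʳ : ∀ {Γ} {Hs : List (Fm Γ)} {a b : Tm Γ ι} → Hs ⊢ Leq a b → Hs ⊢ Leq b b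
  Leq-reflʳ {b = b} d = ∀E monus-self b

  ⊴-app : ∀ {Γ ρ σ} {Hs : List (Fm Γ)} {f g : Tm Γ (ρ ⇒ σ)} {u v : Tm Γ ρ} → Hs ⊢ f ⊴ g → Hs ⊢ u ⊴ v →
    Hs ⊢ (f · u ⊴ g · v) ∧' (g · u ⊴ g · v)
  ⊴-app {Hs = Hs} {f} {g} {u} {v} d e =
    subst₃ (λ a b c → Hs ⊢ (a · u ⊴ b · c) ∧' (b · u ⊴ b · c)) (sub1-wkTm u f) (sub1-wkTm u g) (sub1-wkTm u v)
        (∀⊴-elim (⊃E (⊴app f g v) d) u e)

  ⊴-reflʳ : ∀ ρ {Γ} {Hs : List (Fm Γ)} {a b : Tm Γ ρ} → Hs ⊢ a ⊴ b → Hs ⊢ b ⊴ b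
  ⊴-reflʳ ι {a = a} {b} d = ⊃E (∧E₂ (⊴₀ b b)) (Leq-reflʳ (⊃E (∧E₁ (⊴₀ a b)) d))
  ⊴-reflʳ (ρ ⇒ σ) {a = a} {b} d = ⊃E (⊴rule (a ⊴ b) b⊴ b b (⊃I (∧I p p))) d
    where p = ∧E₂ (⊴-app (∧E₁ hyp₀) (∧E₂ hyp₀))

  ⊴-trans : ∀ ρ {Γ} {Hs : List (Fm Γ)} {a b c : Tm Γ ρ} → Hs ⊢ a ⊴ b → Hs ⊢ b ⊴ c → Hs ⊢ a ⊴ c
  ⊴-trans ι {a = a} {b} {c} d e = ⊃E (∧E₂ (⊴₀ a c)) (Leq-trans (⊃E (∧E₁ (⊴₀ a b)) d) (⊃E (∧E₁ (⊴₀ b c)) e))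
  ⊴-trans (ρ ⇒ σ) {a = a} {b} {c} d e = ⊃E (⊴rule ((a ⊴ b) ∧' (b ⊴ c)) (b∧ b⊴ b⊴) a c (⊃I (∧I
      (⊴-trans σ (∧E₁ (⊴-app (∧E₁ (∧E₁ hyp₀)) (∧E₂ hyp₀))) (∧E₁ (⊴-app (∧E₂ (∧E₁ hyp₀)) (⊴-reflʳ ρ (∧E₂ hyp₀)))))
      (∧E₂ (⊴-app (∧E₂ (∧E₁ hyp₀)) (∧E₂ hyp₀)))))) (∧I d e)

  Majorized-trans : ∀ {Γ} {Hs : List (Fm Γ)} {ρs} (us ts ws : Tms Γ ρs) → Majorized Hs us ts → Majorized Hs ts ws →
    Majorized Hs us ws
  Majorized-trans []ₜ []ₜ []ₜ _ _ = tt
  Majorized-trans (_∷ₜ_ {ρ} u us) (t ∷ₜ ts) (w ∷ₜ ws) (d , ds) (e , es) = ⊴-trans ρ d e , Majorized-trans us ts ws ds es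

  Majorized-reflʳ : ∀ {Γ} {Hs : List (Fm Γ)} {ρs} (us ts : Tms Γ ρs) → Majorized Hs us ts → Majorized Hs ts ts
  Majorized-reflʳ []ₜ []ₜ _ = tt
  Majorized-reflʳ (_∷ₜ_ {ρ} u us) (t ∷ₜ ts) (d , ds) = ⊴-reflʳ ρ d , Majorized-reflʳ us ts ds

  app*-⊴-refl : ∀ {Γ} {Hs : List (Fm Γ)} {ρs σ} (f : Tm Γ (ρs ⇒* σ)) (xs : Tms Γ ρs) → Hs ⊢ f ⊴ f → Majorized Hs xs xs →
    Hs ⊢ app* f xs ⊴ app* f xs
  app*-⊴-refl f []ₜ d _ = d
  app*-⊴-refl f (x ∷ₜ xs) d (e , es) = app*-⊴-refl (f · x) xs (∧E₁ (⊴-app d e)) es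

  appTms-⊴-refl : ∀ {Γ} {Hs : List (Fm Γ)} {ρs} (σs : List Ty) (fs : Tms Γ (map (ρs ⇒*_) σs)) (xs : Tms Γ ρs) →
    Majorized Hs fs fs → Majorized Hs xs xs → Majorized Hs (appTms σs fs xs) (appTms σs fs xs)
  appTms-⊴-refl [] []ₜ xs _ _ = tt
  appTms-⊴-refl (σ ∷ σs) (f ∷ₜ fs) xs (d , ds) es = app*-⊴-refl f xs d es , appTms-⊴-refl σs fs xs ds es

  ∀̃⊴*-antitone : ∀ {Δ Δ'} ρs {ts : Tms Δ ρs} {k : KF Δ ρs} {Hs Hs'} {r : Ren Δ Δ'} → Natural k → Entails r Hs Hs' →
    Hs ⊢ ∀̃⊴* ρs ts k → (us : Tms Δ' ρs) → Majorized Hs' us (renTms r ts) → Hs' ⊢ ∀̃⊴* ρs us (renBody r k)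
  ∀̃⊴*-antitone ρs {ts} {r = r} N e d us l = ∀̃⊴*-intro ρs (renBody-natural r N) λ r₃ e₃ ŷ l₃ rf₃ →
    ∀̃⊴*-elim-transport ρs N (Entails-∘ e e₃) d ŷ
      (Majorized-subst refl (renTms-renTms r₃ r (λ v → refl) ts) (Majorized-trans ŷ _ _ l₃ (Majorized-rename e₃ _ _ l))) rf₃

  ∀̃⊴*-matBody-antitone : ∀ {Γ Δ Δ'} (I : Interp Γ) → NaturalInterp I →
    {r : Ren Γ Δ} {x : Tms Δ (Interp.xs I)} {ts : Tms Δ (Interp.ys I)} → ∀ {Hs Hs'} {r₂ : Ren Δ Δ'} →
    Entails r₂ Hs Hs' → Hs ⊢ ∀̃⊴* (Interp.ys I) ts (matBody I r x) → (us : Tms Δ' (Interp.ys I)) →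
    Majorized Hs' us (renTms r₂ ts) → Hs' ⊢ ∀̃⊴* (Interp.ys I) us (matBody I (r₂ ∘R r) (renTms r₂ x))
  ∀̃⊴*-matBody-antitone I N {r} {x} {r₂ = r₂} e d us l =
    substDer (∀̃⊴*-cong (Interp.ys I) us (λ r₃ ŷ → cong (λ c → Interp.mat I (r₃ ∘R (r₂ ∘R r)) c ŷ)
        (sym (renTms-renTms r₃ r₂ (λ v → refl) x))))
      (∀̃⊴*-antitone (Interp.ys I) (matBody-natural I N r x) e d us l)

module Correspondence (T : Theory) (T-ren : RenClosed T) (T-blem : ∀ {Γ} (A : Fm Γ) → Bounded A → T (A ∨' ¬' A)) where

  open Deduction T T-ren
  open Majorizability T T-ren

  lem : ∀ {Γ} {Hs : List (Fm Γ)} (A : Fm Γ) → Bounded A → Hs ⊢ A ∨' ¬' A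
  lem A b = ax (T-blem A b)

  ¬¬-elim : ∀ {Γ} {Hs : List (Fm Γ)} {A : Fm Γ} → Bounded A → Hs ⊢ ¬' (¬' A) → Hs ⊢ A
  ¬¬-elim {A = A} b d = ∨E (lem A b) hyp₀ (⊥E (⊃E (weaken₁ d) hyp₀))

  BKT : ∀ {Γ} → KFm Γ → Interp Γ
  BKT A = B (KT A)

  BKTxs BKTys : ∀ {Γ} → KFm Γ → List Ty
  BKTxs A = Interp.xs (BKT A)
  BKTys A = Interp.ys (BKT A)

  natural-BKT : ∀ {Γ} (A : KFm Γ) → NaturalInterp (BKT A)
  natural-BKT A = natural-B (KT A)

  Uxs≡BKTxs : ∀ {Γ} (A : KFm Γ) → Uxs A ≡ BKTxs A
  Uys≡BKTys : ∀ {Γ} (A : KFm Γ) → Uys A ≡ BKTys A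
  Uxs≡BKTxs++[] : ∀ {Γ} (A : KFm Γ) → Uxs A ≡ BKTxs A ++ []

  Uxs≡BKTxs++[] A = trans (Uxs≡BKTxs A) (sym (++-identityʳ (BKTxs A)))
  Uxs≡BKTxs (k≐ t s) = refl
  Uxs≡BKTxs (k⊴ t s) = refl
  Uxs≡BKTxs (k¬ A) = cong₂ (λ a b → map (a ⇒*_) b) (Uxs≡BKTxs++[] A) (Uys≡BKTys A)
  Uxs≡BKTxs (k∨ A C) = cong₂ _++_ (Uxs≡BKTxs A) (Uxs≡BKTxs C)
  Uxs≡BKTxs (k∧ A C) = cong₂ _++_ (Uxs≡BKTxs A) (Uxs≡BKTxs C)
  Uxs≡BKTxs (k∀⊴ t A) = Uxs≡BKTxs A
  Uxs≡BKTxs (k∀ {ρ} A) = cong (ρ ∷_) (Uxs≡BKTxs A)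
  Uys≡BKTys (k≐ t s) = refl
  Uys≡BKTys (k⊴ t s) = refl
  Uys≡BKTys (k¬ A) = Uxs≡BKTxs++[] A
  Uys≡BKTys (k∨ A C) = cong₂ _++_ (Uys≡BKTys A) (Uys≡BKTys C)
  Uys≡BKTys (k∧ A C) = cong₂ _++_ (Uys≡BKTys A) (Uys≡BKTys C)
  Uys≡BKTys (k∀⊴ t A) = Uys≡BKTys A
  Uys≡BKTys (k∀ A) = Uys≡BKTys A

  ∀̃⊴BKT : ∀ {Γ Δ} (A : KFm Γ) → Ren Γ Δ → Tms Δ (BKTxs A) → Tms Δ (BKTys A) → Fm Δ
  ∀̃⊴BKT A r x' y' = ∀̃⊴* (BKTys A) y' (matBody (BKT A) r x')

  MatrixCorrespondence : ∀ {Γ} → KFm Γ → Set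
  MatrixCorrespondence {Γ} A = ∀ {Δ} (r : Ren Γ Δ) {Hs : List (Fm Δ)} (x : Tms Δ (Uxs A))
      (y : Tms Δ (Uys A)) → Majorized Hs x x → Majorized Hs y y →
     Hs ⊢ Interp.mat (U A) r x y ⇔ ¬' (∀̃⊴BKT A r (cast (Uxs≡BKTxs A) x) (cast (Uys≡BKTys A) y))

  ∀̃⊴BKT-Bounded : ∀ {Γ Δ} (A : KFm Γ) (r : Ren Γ Δ) x' y' → Bounded (∀̃⊴BKT A r x' y')
  ∀̃⊴BKT-Bounded A r x' y' = ∀̃⊴*-Bounded (BKTys A) y' _ (λ r₂ us → B-Bounded (KT A) _ _ _)

  ⇔¬¬ : ∀ {Δ} {Hs : List (Fm Δ)} (φ : Fm Δ) → Bounded φ → Hs ⊢ φ ⇔ ¬' (φ ⊃ ⊥')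
  ⇔¬¬ φ b = ⇔-intro (⊃I (⊃E hyp₀ hyp₁)) (¬¬-elim b hyp₀)

  -- Shared by ∀ z ⊴ t and ∀ z: in both, (A_K)_B is k = ∃ z ⊴ b ∀̃ ỹ ⊴ _ (A_K)_B, where the bound b
  -- is the term t, respectively the first component of the x-tuple.
  module ∀⊴-Case {Γ ρ} (A : KFm (ρ ∷ Γ)) (ih : MatrixCorrespondence A) {Δ} (r : Ren Γ Δ) {Hs : List (Fm Δ)}
    (b : Tm Δ ρ) (x : Tms Δ (Uxs A)) (y : Tms Δ (Uys A)) (dx : Majorized Hs x x) (dy : Majorized Hs y y)
    (k : KF Δ (BKTys A)) (k-natural : Natural k)
    (k≡ : ∀ {Θ} (r₂ : Ren Δ Θ) ỹ →
      k r₂ ỹ ≡ ∃⊴ (renTm r₂ b) (∀̃⊴* (BKTys A) (renTms there ỹ) (exBody (BKT A) (r₂ ∘R r) (renTms r₂ (cast (Uxs≡BKTxs A) x)))))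
    where

    x' : Tms Δ (BKTxs A)
    x' = cast (Uxs≡BKTxs A) x

    y' : Tms Δ (BKTys A)
    y' = cast (Uys≡BKTys A) y

    AU : Fm (ρ ∷ Δ)
    AU = Interp.mat (U A) (liftR r) (renTms there x) (renTms there y)

    AKB : Fm (ρ ∷ Δ)
    AKB = ∀̃⊴* (BKTys A) (renTms there y') (exBody (BKT A) r x')

    AKB≡∀̃⊴BKT : AKB ≡ ∀̃⊴BKT A (liftR r) (cast (Uxs≡BKTxs A) (renTms there x)) (cast (Uys≡BKTys A) (renTms there y))
    AKB≡∀̃⊴BKT = trans (∀̃⊴*-cong (BKTys A) (renTms there y') (exBody≡matBody (BKT A) r x'))
      (cong₂ (λ a c → ∀̃⊴* (BKTys A) a (matBody (BKT A) (liftR r) c))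
             (renTms-cast there (Uys≡BKTys A) y) (renTms-cast there (Uxs≡BKTxs A) x))

    exBody-natural : Natural (exBody (BKT A) r x')
    exBody-natural = Commutes-cong (λ r₂ us → sym (exBody≡matBody (BKT A) r x' r₂ us))
        (λ r₂ us → sym (exBody≡matBody (BKT A) r x' r₂ us))
      (matBody-natural (BKT A) (natural-BKT A) (liftR r) (renTms there x'))

    forward : (∀̃⊴* (BKTys A) y' k ∷ ∀⊴ b AU ∷ Hs) ⊢ ⊥'
    forward = ∃⊴-elim ∃AKB (⊃E (⇔-to ih′ AU-holds) (substDer AKB≡∀̃⊴BKT (∧E₂ hyp₀)))
      where
      dy' = Majorized-cast (Uys≡BKTys A) y y (Majorized-weaken (λ m → there (there m)) y y dy)
      ∃AKB : (∀̃⊴* (BKTys A) y' k ∷ ∀⊴ b AU ∷ Hs) ⊢ ∃⊴ b AKB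
      ∃AKB = substDer (trans (k≡ idR y') (cong₂ (λ a c → ∃⊴ a (∀̃⊴* (BKTys A) (renTms there y') (exBody (BKT A) r c)))
          (renTm-id b) (renTms-id x')))
        (∀̃⊴*-elim (BKTys A) k-natural hyp₀ y' dy' dy')
      Hs₃ = ((v0 ⊴ wkTm b) ∧' AKB) ∷ map wkFm (∀̃⊴* (BKTys A) y' k ∷ ∀⊴ b AU ∷ Hs)
      ent : Entails there Hs Hs₃
      ent = Entails-there (λ m → there (there (there m)))
      AU-holds : Hs₃ ⊢ AU
      AU-holds = substDer (sub1-v0-lift AU) (∀⊴-elim (hyp (there (there (here refl)))) v0 (∧E₁ hyp₀))
      ih′ = ih (liftR r) (renTms there x) (renTms there y) (Majorized-rename ent x x dx) (Majorized-rename ent y y dy)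

    Hs⁻ : List (Fm (ρ ∷ Δ))
    Hs⁻ = ¬' AU ∷ (v0 ⊴ wkTm b) ∷ map wkFm (¬' (∀̃⊴* (BKTys A) y' k) ∷ Hs)

    AKB-holds : Hs⁻ ⊢ AKB
    AKB-holds = substDer (sym AKB≡∀̃⊴BKT) (¬¬-elim (∀̃⊴BKT-Bounded A (liftR r) _ _)
      (⊃I (⊃E hyp₁ (⇔-from (ih (liftR r) (renTms there x) (renTms there y)
        (Majorized-weaken there _ _ (Majorized-rename ent x x dx))
            (Majorized-weaken there _ _ (Majorized-rename ent y y dy))) hyp₀))))
      where
      ent : Entails there Hs Hs⁻
      ent = Entails-there (λ m → there (there (there m)))

    -- the bound variable z ⊴ b of ∀⊴ b AU is the witness for ∃⊴ b in k
    witness : ∀̃⊴*-Premise (BKTys A) (renTms there y') Hs⁻ (renBody there k)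
    witness r₂ {Hs'} e ỹ l rf = substDer (sym (k≡ (r₂ ∘R there) ỹ)) (∃⊴-intro z z⊴b (substDer (sym instance≡) instance-holds))
      where
      z = var (r₂ here)
      R = (r₂ ∘R there) ∘R r
      X = renTms (r₂ ∘R there) x'
      R' : Ren (ρ ∷ Γ) _
      R' here = r₂ here
      R' (there v) = R v
      z⊴b : Hs' ⊢ z ⊴ renTm (r₂ ∘R there) b
      z⊴b = subst (λ w → Hs' ⊢ z ⊴ w) (renTm-renTm r₂ there (λ v → refl) b) (e (there (here refl)))
      instance≡ : subFm (sub1 z) (∀̃⊴* (BKTys A) (renTms there ỹ) (exBody (BKT A) R X)) ≡ ∀̃⊴* (BKTys A) ỹ (matBody (BKT A) R' X)
      instance≡ = trans (cong (subFm (sub1 z)) (∀̃⊴*-cong (BKTys A) (renTms there ỹ) (exBody≡matBody (BKT A) R X)))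
        (trans (∀̃⊴*-subFm (BKTys A) (renTms there ỹ)
                  (matBody-commutes (BKT A) (natural-BKT A) (sub1 z) (liftR R) R' (λ { here → refl ; (there v) → refl })
                      (renTms there X)))
               (cong₂ (λ a c → ∀̃⊴* (BKTys A) a (matBody (BKT A) R' c)) (sub1-wkTms z ỹ) (sub1-wkTms z X)))
      instance-holds : Hs' ⊢ ∀̃⊴* (BKTys A) ỹ (matBody (BKT A) R' X)
      instance-holds = ∀̃⊴*-intro (BKTys A) (matBody-natural (BKT A) (natural-BKT A) R' X) λ r₃ {Hs''} e₃ ŷ l₃ rf₃ →
        substDer (trans (mat-cong (BKT A) (natural-BKT A) (λ { here → refl ; (there v) → refl }) _ ŷ)
                        (cong (λ c → Interp.mat (BKT A) (r₃ ∘R R') c ŷ) (sym (renTms-renTms r₃ (r₂ ∘R there) (λ v → refl) x'))))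
          (∀̃⊴*-elim-transport (BKTys A) exBody-natural (Entails-∘ e e₃) AKB-holds ŷ
             (Majorized-subst refl (renTms-renTms r₃ r₂ (λ v → refl) (renTms there y'))
               (Majorized-trans ŷ (renTms r₃ ỹ) _ l₃ (Majorized-rename e₃ ỹ _ l)))
             rf₃)

    backward : (¬' (∀̃⊴* (BKTys A) y' k) ∷ Hs) ⊢ ∀⊴ b AU
    backward = ∀⊴-intro (∨E (lem AU (U-Bounded A _ _ _)) hyp₀
      (⊥E (⊃E (hyp (there (there (here refl))))
               (substDer (sym (renFm-∀̃⊴* (BKTys A) there y' k-natural))
                   (∀̃⊴*-intro (BKTys A) (renBody-natural there k-natural) witness)))))

    correspondence : Hs ⊢ ∀⊴ b AU ⇔ ¬' (∀̃⊴* (BKTys A) y' k)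
    correspondence = ⇔-intro (⊃I forward) backward

  matBody-BKT¬ : ∀ {Γ Δ Δ'} (A : KFm Γ) (r : Ren Γ Δ) (Y : Tms Δ (map (Uxs A ⇒*_) (Uys A))) (r₂ : Ren Δ Δ')
      (x̃ : Tms Δ' (Uxs A)) →
    matBody (BKT (k¬ A)) r (cast (Uxs≡BKTxs (k¬ A)) Y) r₂ (cast (Uxs≡BKTxs++[] A) x̃) ≡ ¬'
        (∀̃⊴BKT A (r₂ ∘R r) (cast (Uxs≡BKTxs A) x̃) (cast (Uys≡BKTys A) (appTms (Uys A) (renTms r₂ Y) x̃)))
  matBody-BKT¬ A r Y r₂ x̃ = cong₂ (λ a c → ∀̃⊴* (BKTys A) a (matBody (BKT A) (r₂ ∘R r) c) ⊃ ⊥')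
    (trans (cong (λ z → appTms (BKTys A) z (cast (Uxs≡BKTxs++[] A) x̃)) (renTms-cast r₂ (Uxs≡BKTxs (k¬ A)) Y))
        (appTms-cast (Uxs≡BKTxs++[] A) (Uys≡BKTys A) (renTms r₂ Y) x̃))
    (trans (cong (λ z → proj₁ (splitTms (BKTxs A) z)) (sym (cast-cast (Uxs≡BKTxs A) (sym (++-identityʳ (BKTxs A))) x̃)))
           (splitTms-++[] (BKTxs A) (sym (++-identityʳ (BKTxs A))) (cast (Uxs≡BKTxs A) x̃)))

  module ¬-Case {Γ} (A : KFm Γ) (ih : MatrixCorrespondence A) {Δ} (r : Ren Γ Δ) {Hs : List (Fm Δ)}
    (Y : Tms Δ (map (Uxs A ⇒*_) (Uys A))) (x : Tms Δ (Uxs A)) (dY : Majorized Hs Y Y) (dx : Majorized Hs x x)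
    where

    x≡ : Uxs A ≡ BKTxs A ++ []
    x≡ = Uxs≡BKTxs++[] A

    Y' : Tms Δ (BKTxs (k¬ A))
    Y' = cast (Uxs≡BKTxs (k¬ A)) Y

    x' : Tms Δ (BKTys (k¬ A))
    x' = cast x≡ x

    ¬AU : Fm Δ
    ¬AU = ∃̃⊴* (Uxs A) x (negBody (U A) r Y)

    ¬AU-natural : Natural (negBody (U A) r Y)
    ¬AU-natural = negBody-natural (U A) (natural-U A) r Y

    AKB-natural : Natural (matBody (BKT (k¬ A)) r Y')
    AKB-natural = matBody-natural (BKT (k¬ A)) (natural-BKT (k¬ A)) r Y'

    Yx-majorized : ∀ {Δ'} {r₂ : Ren Δ Δ'} {Hs₀ Hs'} {x̃ : Tms Δ' (Uxs A)} → Hs ⊆ Hs₀ → Entails r₂ Hs₀ Hs' →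
      Majorized Hs' x̃ x̃ → Majorized Hs' (appTms (Uys A) (renTms r₂ Y) x̃) (appTms (Uys A) (renTms r₂ Y) x̃)
    Yx-majorized {r₂ = r₂} {x̃ = x̃} s e rx =
      appTms-⊴-refl (Uys A) (renTms r₂ Y) x̃ (Majorized-rename e Y Y (Majorized-weaken s Y Y dY)) rx

    forward : (∀̃⊴BKT (k¬ A) r Y' x' ∷ ¬AU ∷ Hs) ⊢ ⊥'
    forward = ∃̃⊴*-elim (Uxs A) ¬AU-natural hyp₁ λ r₂ {Hs'} e x̃ l rf ¬AU-at-x̃ →
      ⊃E ¬AU-at-x̃ (⇔-from (ih (r₂ ∘R r) x̃ _ rf (Yx-majorized (λ m → there (there m)) e rf))
        (substDer (matBody-BKT¬ A r Y r₂ x̃)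
          (∀̃⊴*-elim-transport (BKTxs A ++ []) AKB-natural e hyp₀ (cast x≡ x̃)
            (Majorized-subst refl (sym (renTms-cast r₂ x≡ x)) (Majorized-cast x≡ x̃ _ l)) (Majorized-cast x≡ x̃ x̃ rf))))

    Hs⁻ : List (Fm Δ)
    Hs⁻ = ¬' ¬AU ∷ ¬' (∀̃⊴BKT (k¬ A) r Y' x') ∷ Hs

    AKB-premise : ∀̃⊴*-Premise (BKTxs A ++ []) x' Hs⁻ (matBody (BKT (k¬ A)) r Y')
    AKB-premise r₂ {Hs'} e ỹ l rf =
      substDer (cong (matBody (BKT (k¬ A)) r Y' r₂) (cast-cast-sym x≡ ỹ))
        (substDer (sym (matBody-BKT¬ A r Y r₂ x̃))
            (⇔-to (ih (r₂ ∘R r) x̃ ŷ rfx (Yx-majorized (λ m → there (there m)) e rfx)) AU-holds))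
      where
      x̃ = cast (sym x≡) ỹ
      ŷ = appTms (Uys A) (renTms r₂ Y) x̃
      rfx : Majorized Hs' x̃ x̃
      rfx = Majorized-cast (sym x≡) ỹ ỹ rf
      lx : Majorized Hs' x̃ (renTms r₂ x)
      lx = Majorized-subst refl (trans (cong (cast (sym x≡)) (renTms-cast r₂ x≡ x)) (cast-sym-cast x≡ (renTms r₂ x)))
        (Majorized-cast (sym x≡) ỹ _ l)
      ¬¬AU : Hs' ⊢ ¬' (∃̃⊴* (Uxs A) (renTms r₂ x) (renBody r₂ (negBody (U A) r Y)))
      ¬¬AU = substDer (cong ¬' (renFm-∃̃⊴* (Uxs A) r₂ x ¬AU-natural)) (e (here refl))
      AU-holds : Hs' ⊢ Interp.mat (U A) (r₂ ∘R r) x̃ ŷ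
      AU-holds = ¬¬-elim (U-Bounded A _ _ _) (⊃I (⊃E (weaken₁ ¬¬AU)
        (∃̃⊴*-intro (Uxs A) (renBody-natural r₂ ¬AU-natural) x̃ (Majorized-weaken there _ _ lx)
            (Majorized-weaken there _ _ rfx) hyp₀)))

    backward : (¬' (∀̃⊴BKT (k¬ A) r Y' x') ∷ Hs) ⊢ ¬AU
    backward = ∨E (lem ¬AU (U-Bounded (k¬ A) r Y x)) hyp₀ (⊥E (⊃E hyp₁ (∀̃⊴*-intro (BKTxs A ++ []) AKB-natural AKB-premise)))

    correspondence : Hs ⊢ ¬AU ⇔ ¬' (∀̃⊴BKT (k¬ A) r Y' x')
    correspondence = ⇔-intro (⊃I forward) backward

  module Split {Γ} (A C : KFm Γ) {Δ} (r : Ren Γ Δ) {Hs : List (Fm Δ)}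
    (x : Tms Δ (Uxs A ++ Uxs C)) (y : Tms Δ (Uys A ++ Uys C)) (dx : Majorized Hs x x) (dy : Majorized Hs y y)
    where

    x₁ : Tms Δ (Uxs A)
    x₁ = proj₁ (splitTms (Uxs A) x)

    x₂ : Tms Δ (Uxs C)
    x₂ = proj₂ (splitTms (Uxs A) x)

    y₁ : Tms Δ (Uys A)
    y₁ = proj₁ (splitTms (Uys A) y)

    y₂ : Tms Δ (Uys C)
    y₂ = proj₂ (splitTms (Uys A) y)

    x' : Tms Δ (BKTxs A ++ BKTxs C)
    x' = cast (cong₂ _++_ (Uxs≡BKTxs A) (Uxs≡BKTxs C)) x

    y' : Tms Δ (BKTys A ++ BKTys C)
    y' = cast (cong₂ _++_ (Uys≡BKTys A) (Uys≡BKTys C)) y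

    AU CU AKB CKB : Fm Δ
    AU = Interp.mat (U A) r x₁ y₁
    CU = Interp.mat (U C) r x₂ y₂
    AKB = ∀̃⊴BKT A r (cast (Uxs≡BKTxs A) x₁) (cast (Uys≡BKTys A) y₁)
    CKB = ∀̃⊴BKT C r (cast (Uxs≡BKTxs C) x₂) (cast (Uys≡BKTys C) y₂)

    y'₁ : Tms Δ (BKTys A)
    y'₁ = proj₁ (splitTms (BKTys A) y')

    y'₂ : Tms Δ (BKTys C)
    y'₂ = proj₂ (splitTms (BKTys A) y')

    y'₁≡ : y'₁ ≡ cast (Uys≡BKTys A) y₁
    y'₁≡ = splitTms-cast₁ (Uys≡BKTys A) (Uys≡BKTys C) y

    y'₂≡ : y'₂ ≡ cast (Uys≡BKTys C) y₂
    y'₂≡ = splitTms-cast₂ (Uys≡BKTys A) (Uys≡BKTys C) y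

    x'₁≡ : ∀ {Θ} (r₂ : Ren Δ Θ) → proj₁ (splitTms (BKTxs A) (renTms r₂ x')) ≡ renTms r₂ (cast (Uxs≡BKTxs A) x₁)
    x'₁≡ r₂ = trans (splitTms-renTms₁ (BKTxs A) r₂ x') (cong (renTms r₂) (splitTms-cast₁ (Uxs≡BKTxs A) (Uxs≡BKTxs C) x))

    x'₂≡ : ∀ {Θ} (r₂ : Ren Δ Θ) → proj₂ (splitTms (BKTxs A) (renTms r₂ x')) ≡ renTms r₂ (cast (Uxs≡BKTxs C) x₂)
    x'₂≡ r₂ = trans (splitTms-renTms₂ (BKTxs A) r₂ x') (cong (renTms r₂) (splitTms-cast₂ (Uxs≡BKTxs A) (Uxs≡BKTxs C) x))

    renTms-y' : ∀ {Θ} (r₂ : Ren Δ Θ) → renTms r₂ y'₁ ++ₜ renTms r₂ y'₂ ≡ renTms r₂ y'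
    renTms-y' r₂ = trans (sym (renTms-++ₜ r₂ y'₁ y'₂)) (cong (renTms r₂) (splitTms-η (BKTys A) y'))

    majorized-y' : ∀ {Hs'} → Hs ⊆ Hs' → Majorized Hs' y' y'
    majorized-y' s = Majorized-cast (cong₂ _++_ (Uys≡BKTys A) (Uys≡BKTys C)) y y (Majorized-weaken s y y dy)

    A-correspondence : MatrixCorrespondence A → ∀ {Hs'} → Hs ⊆ Hs' → Hs' ⊢ AU ⇔ ¬' AKB
    A-correspondence ih s = ih r x₁ y₁ (Majorized-weaken s _ _ (Majorized-split₁ (Uxs A) x x dx))
        (Majorized-weaken s _ _ (Majorized-split₁ (Uys A) y y dy))

    C-correspondence : MatrixCorrespondence C → ∀ {Hs'} → Hs ⊆ Hs' → Hs' ⊢ CU ⇔ ¬' CKB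
    C-correspondence ih s = ih r x₂ y₂ (Majorized-weaken s _ _ (Majorized-split₂ (Uxs A) x x dx))
        (Majorized-weaken s _ _ (Majorized-split₂ (Uys A) y y dy))

    AKB-from-¬AU : MatrixCorrespondence A → ∀ {Hs'} → Hs ⊆ Hs' → Hs' ⊢ ¬' AU → Hs' ⊢ AKB
    AKB-from-¬AU ih s ¬au = ¬¬-elim (∀̃⊴BKT-Bounded A r _ _)
        (⊃I (⊃E (weaken₁ ¬au) (⇔-from (A-correspondence ih (λ m → there (s m))) hyp₀)))

    CKB-from-¬CU : MatrixCorrespondence C → ∀ {Hs'} → Hs ⊆ Hs' → Hs' ⊢ ¬' CU → Hs' ⊢ CKB
    CKB-from-¬CU ih s ¬cu = ¬¬-elim (∀̃⊴BKT-Bounded C r _ _)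
        (⊃I (⊃E (weaken₁ ¬cu) (⇔-from (C-correspondence ih (λ m → there (s m))) hyp₀)))

  module ∨-Case {Γ} (A C : KFm Γ) (ihA : MatrixCorrespondence A) (ihC : MatrixCorrespondence C) {Δ}
      (r : Ren Γ Δ) {Hs : List (Fm Δ)}
    (x : Tms Δ (Uxs A ++ Uxs C)) (y : Tms Δ (Uys A ++ Uys C)) (dx : Majorized Hs x x) (dy : Majorized Hs y y)
    where

    open Split A C r x y dx dy

    KB : Fm Δ
    KB = ∀̃⊴BKT (k∨ A C) r x' y'

    KB-natural : Natural (matBody (BKT (k∨ A C)) r x')
    KB-natural = matBody-natural (BKT (k∨ A C)) (natural-BKT (k∨ A C)) r x'

    AKB-from-KB : ∀ {Hs'} → Hs ⊆ Hs' → Hs' ⊢ KB → Hs' ⊢ AKB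
    AKB-from-KB s kb = ∀̃⊴*-intro (BKTys A) (matBody-natural (BKT A) (natural-BKT A) r _) λ r₂ e ỹ₁ l rf →
      let y'₂-maj = Majorized-subst (splitTms-renTms₂ (BKTys A) r₂ y') (splitTms-renTms₂ (BKTys A) r₂ y')
                      (Majorized-split₂ (BKTys A) _ _ (Majorized-rename e _ _ (majorized-y' s)))
      in substDer (cong₂ (Interp.mat (BKT A) (r₂ ∘R r)) (x'₁≡ r₂) (splitTms-++ₜ₁ (BKTys A) ỹ₁ _))
           (∧E₁ (∀̃⊴*-elim-transport (BKTys A ++ BKTys C) KB-natural e kb (ỹ₁ ++ₜ renTms r₂ y'₂)
             (Majorized-subst refl (renTms-y' r₂) (Majorized-++ₜ ỹ₁ _ _ _
                 (Majorized-subst refl (cong (renTms r₂) (sym y'₁≡)) l) y'₂-maj))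
             (Majorized-++ₜ ỹ₁ ỹ₁ _ _ rf y'₂-maj)))

    CKB-from-KB : ∀ {Hs'} → Hs ⊆ Hs' → Hs' ⊢ KB → Hs' ⊢ CKB
    CKB-from-KB s kb = ∀̃⊴*-intro (BKTys C) (matBody-natural (BKT C) (natural-BKT C) r _) λ r₂ e ỹ₂ l rf →
      let y'₁-maj = Majorized-subst (splitTms-renTms₁ (BKTys A) r₂ y') (splitTms-renTms₁ (BKTys A) r₂ y')
                      (Majorized-split₁ (BKTys A) _ _ (Majorized-rename e _ _ (majorized-y' s)))
      in substDer (cong₂ (Interp.mat (BKT C) (r₂ ∘R r)) (x'₂≡ r₂) (splitTms-++ₜ₂ (BKTys A) _ ỹ₂))
           (∧E₂ (∀̃⊴*-elim-transport (BKTys A ++ BKTys C) KB-natural e kb (renTms r₂ y'₁ ++ₜ ỹ₂)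
             (Majorized-subst refl (renTms-y' r₂) (Majorized-++ₜ _ _ ỹ₂ _ y'₁-maj
                 (Majorized-subst refl (cong (renTms r₂) (sym y'₂≡)) l)))
             (Majorized-++ₜ _ _ ỹ₂ ỹ₂ y'₁-maj rf)))

    KB-from-components : ∀ {Hs'} → Hs' ⊢ AKB → Hs' ⊢ CKB → Hs' ⊢ KB
    KB-from-components akb ckb = ∀̃⊴*-intro (BKTys A ++ BKTys C) KB-natural λ r₂ e ỹ l rf → ∧I
      (substDer (cong (λ c → Interp.mat (BKT A) (r₂ ∘R r) c _) (sym (x'₁≡ r₂)))
        (∀̃⊴*-elim-transport (BKTys A) (matBody-natural (BKT A) (natural-BKT A) r _) e akb _
          (Majorized-subst refl (trans (splitTms-renTms₁ (BKTys A) r₂ y') (cong (renTms r₂) y'₁≡))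
              (Majorized-split₁ (BKTys A) _ _ l))
          (Majorized-split₁ (BKTys A) _ _ rf)))
      (substDer (cong (λ c → Interp.mat (BKT C) (r₂ ∘R r) c _) (sym (x'₂≡ r₂)))
        (∀̃⊴*-elim-transport (BKTys C) (matBody-natural (BKT C) (natural-BKT C) r _) e ckb _
          (Majorized-subst refl (trans (splitTms-renTms₂ (BKTys A) r₂ y') (cong (renTms r₂) y'₂≡))
              (Majorized-split₂ (BKTys A) _ _ l))
          (Majorized-split₂ (BKTys A) _ _ rf)))

    forward : (KB ∷ (AU ∨' CU) ∷ Hs) ⊢ ⊥'
    forward = ∨E hyp₁
      (⊃E (⇔-to (A-correspondence ihA (λ m → there (there (there m)))) hyp₀) (AKB-from-KB (λ m → there (there (there m))) hyp₁))
      (⊃E (⇔-to (C-correspondence ihC (λ m → there (there (there m)))) hyp₀) (CKB-from-KB (λ m → there (there (there m))) hyp₁))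

    backward : (¬' KB ∷ Hs) ⊢ AU ∨' CU
    backward = ∨E (lem AU (U-Bounded A r _ _)) (∨I₁ hyp₀) (∨E (lem CU (U-Bounded C r _ _)) (∨I₂ hyp₀)
      (⊥E (⊃E (hyp (there (there (here refl))))
        (KB-from-components (AKB-from-¬AU ihA (λ m → there (there (there m))) hyp₁)
            (CKB-from-¬CU ihC (λ m → there (there (there m))) hyp₀)))))

    correspondence : Hs ⊢ AU ∨' CU ⇔ ¬' KB
    correspondence = ⇔-intro (⊃I forward) backward

  module ∧-Case {Γ} (A C : KFm Γ) (ihA : MatrixCorrespondence A) (ihC : MatrixCorrespondence C) {Δ}
      (r : Ren Γ Δ) {Hs : List (Fm Δ)}
    (x : Tms Δ (Uxs A ++ Uxs C)) (y : Tms Δ (Uys A ++ Uys C)) (dx : Majorized Hs x x) (dy : Majorized Hs y y)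
    where

    open Split A C r x y dx dy

    KB : Fm Δ
    KB = ∀̃⊴BKT (k∧ A C) r x' y'

    KB-natural : Natural (matBody (BKT (k∧ A C)) r x')
    KB-natural = matBody-natural (BKT (k∧ A C)) (natural-BKT (k∧ A C)) r x'

    AKB∨CKB-from-KB : ∀ {Hs'} → Hs ⊆ Hs' → Hs' ⊢ KB → Hs' ⊢ AKB ∨' CKB
    AKB∨CKB-from-KB s kb = substDer
      (cong₂ _∨'_ (cong₂ (λ a c → ∀̃⊴* (BKTys A) a (matBody (BKT A) r c)) y'₁≡ (trans (x'₁≡ idR) (renTms-id _)))
                  (cong₂ (λ a c → ∀̃⊴* (BKTys C) a (matBody (BKT C) r c)) y'₂≡ (trans (x'₂≡ idR) (renTms-id _))))
      (∀̃⊴*-elim (BKTys A ++ BKTys C) KB-natural kb y' (majorized-y' s) (majorized-y' s))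

    KB-from-AKB : ∀ {Hs'} → Hs' ⊢ AKB → Hs' ⊢ KB
    KB-from-AKB akb = ∀̃⊴*-intro (BKTys A ++ BKTys C) KB-natural λ r₂ e ỹ l rf →
      ∨I₁ (substDer (cong (λ c → ∀̃⊴* (BKTys A) _ (matBody (BKT A) (r₂ ∘R r) c)) (sym (x'₁≡ r₂)))
        (∀̃⊴*-matBody-antitone (BKT A) (natural-BKT A) e akb _
          (Majorized-subst refl (trans (splitTms-renTms₁ (BKTys A) r₂ y') (cong (renTms r₂) y'₁≡))
              (Majorized-split₁ (BKTys A) _ _ l))))

    KB-from-CKB : ∀ {Hs'} → Hs' ⊢ CKB → Hs' ⊢ KB
    KB-from-CKB ckb = ∀̃⊴*-intro (BKTys A ++ BKTys C) KB-natural λ r₂ e ỹ l rf →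
      ∨I₂ (substDer (cong (λ c → ∀̃⊴* (BKTys C) _ (matBody (BKT C) (r₂ ∘R r) c)) (sym (x'₂≡ r₂)))
        (∀̃⊴*-matBody-antitone (BKT C) (natural-BKT C) e ckb _
          (Majorized-subst refl (trans (splitTms-renTms₂ (BKTys A) r₂ y') (cong (renTms r₂) y'₂≡))
              (Majorized-split₂ (BKTys A) _ _ l))))

    forward : (KB ∷ (AU ∧' CU) ∷ Hs) ⊢ ⊥'
    forward = ∨E (AKB∨CKB-from-KB (λ m → there (there m)) hyp₀)
      (⊃E (⇔-to (A-correspondence ihA (λ m → there (there (there m)))) (∧E₁ (hyp (there (there (here refl)))))) hyp₀)
      (⊃E (⇔-to (C-correspondence ihC (λ m → there (there (there m)))) (∧E₂ (hyp (there (there (here refl)))))) hyp₀)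

    backward : (¬' KB ∷ Hs) ⊢ AU ∧' CU
    backward = ∧I
      (∨E (lem AU (U-Bounded A r _ _)) hyp₀ (⊥E (⊃E hyp₁ (KB-from-AKB (AKB-from-¬AU ihA (λ m → there (there m)) hyp₀)))))
      (∨E (lem CU (U-Bounded C r _ _)) hyp₀ (⊥E (⊃E hyp₁ (KB-from-CKB (CKB-from-¬CU ihC (λ m → there (there m)) hyp₀)))))

    correspondence : Hs ⊢ AU ∧' CU ⇔ ¬' KB
    correspondence = ⇔-intro (⊃I forward) backward

  matrixCorrespondence : ∀ {Γ} (A : KFm Γ) → MatrixCorrespondence A
  matrixCorrespondence (k≐ t s) r []ₜ []ₜ _ _ = ⇔¬¬ (renFm r (t ≐ s)) b≐
  matrixCorrespondence (k⊴ t s) r []ₜ []ₜ _ _ = ⇔¬¬ (renFm r (t ⊴ s)) b⊴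
  matrixCorrespondence (k∀⊴ t A) r x y dx dy = ∀⊴-Case.correspondence A (matrixCorrespondence A) r (renTm r t) x y dx dy _
      (matBody-natural (BKT (k∀⊴ t A)) (natural-BKT (k∀⊴ t A)) r _)
    (λ r₂ ỹ → cong (λ a → ∃⊴ a _) (sym (renTm-renTm r₂ r (λ v → refl) t)))
  matrixCorrespondence (k∀ {ρ} A) r (w ∷ₜ x) y (_ , dx) dy =
    substDer (cong (λ z → _ ⇔ ¬' (∀̃⊴BKT (k∀ A) r z (cast (Uys≡BKTys A) y))) (sym (cast-∷ (Uxs≡BKTxs A) w x)))
      (∀⊴-Case.correspondence A (matrixCorrespondence A) r w x y dx dy _
          (matBody-natural (BKT (k∀ A)) (natural-BKT (k∀ A)) r (w ∷ₜ cast (Uxs≡BKTxs A) x)) (λ r₂ ỹ → refl))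
  matrixCorrespondence (k¬ A) = ¬-Case.correspondence A (matrixCorrespondence A)
  matrixCorrespondence (k∨ A C) = ∨-Case.correspondence A C (matrixCorrespondence A) (matrixCorrespondence C)
  matrixCorrespondence (k∧ A C) = ∧-Case.correspondence A C (matrixCorrespondence A) (matrixCorrespondence C)

HA⊴+BLEM : Theory
HA⊴+BLEM = HA⊴ ∪T BLEM

HA⊴+BLEM-renClosed : RenClosed HA⊴+BLEM
HA⊴+BLEM-renClosed r (inj₁ ())
HA⊴+BLEM-renClosed r (inj₂ (blem A b)) = inj₂ (blem (renFm r A) (renFm-Bounded r b))

HA⊴+BLEM-blem : ∀ {Γ} (A : Fm Γ) → Bounded A → HA⊴+BLEM (A ∨' ¬' A)
HA⊴+BLEM-blem A b = inj₂ (blem A b)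

open Deduction HA⊴+BLEM HA⊴+BLEM-renClosed
open Majorizability HA⊴+BLEM HA⊴+BLEM-renClosed
open Correspondence HA⊴+BLEM HA⊴+BLEM-renClosed HA⊴+BLEM-blem

module Claims {Γ : Ctx} (A : KFm Γ) where

  xs ys Ys : List Ty
  xs = Uxs A
  ys = Uys A
  Ys = map (xs ⇒*_) ys

  x≡ : xs ≡ BKTxs A ++ []
  x≡ = Uxs≡BKTxs++[] A

  Y≡ : Ys ≡ KBxs A
  Y≡ = Uxs≡BKTxs (k¬ A)

  BK : Interp Γ
  BK = B (Kriv A)

  BK-matrix : ∀ {Δ} (R : Ren Γ Δ) (Y : Tms Δ Ys) (x : Tms Δ xs) →
    Interp.mat BK R (cast Y≡ Y) (cast x≡ x) ≡ ¬' (∀̃⊴BKT A R (cast (Uxs≡BKTxs A) x) (cast (Uys≡BKTys A) (appTms ys Y x)))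
  BK-matrix R Y x = cong₂ (λ a c → ∀̃⊴* (BKTys A) a (matBody (BKT A) R c) ⊃ ⊥')
    (appTms-cast x≡ (Uys≡BKTys A) Y x)
    (trans (cong (λ z → proj₁ (splitTms (BKTxs A) z)) (sym (cast-cast (Uxs≡BKTxs A) (sym (++-identityʳ (BKTxs A))) x)))
           (splitTms-++[] (BKTxs A) (sym (++-identityʳ (BKTxs A))) (cast (Uxs≡BKTxs A) x)))

  claim1Interp : Interp Γ
  claim1Interp = record { xs = Ys ; ys = xs
    ; mat = λ r Y x → Interp.mat (U A) r x (appTms ys Y x) ⇔ Interp.mat BK r (cast (sym (sym Y≡)) Y) (cast (sym (sym x≡)) x) }

  natural-claim1Interp : NaturalInterp claim1Interp
  natural-claim1Interp s r r' e Y x = cong₂ _⇔_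
    (trans (natural-U A s r r' e x _) (cong (Interp.mat (U A) r' (subTms s x)) (appTms-sub ys s Y x)))
    (trans (natural-B (Kriv A) s r r' e _ _)
        (cong₂ (Interp.mat BK r') (subTms-cast s (sym (sym Y≡)) Y) (subTms-cast s (sym (sym x≡)) x)))

  claim1 : Der HA⊴+BLEM Γ [] (Claim1 A (sym Y≡) (sym x≡))
  claim1 = ∀̃*-intro Ys (∀̃*matBody-natural claim1Interp natural-claim1Interp) λ r e Y dY →
    ∀̃*-intro xs (matBody-natural claim1Interp natural-claim1Interp r Y) λ r₂ e₂ x dx →
      let Yx = appTms ys (renTms r₂ Y) x in
      substDer (cong (Interp.mat (U A) (r₂ ∘R r) x Yx ⇔_)
                     (sym (trans (cong₂ (Interp.mat BK (r₂ ∘R r)) (cast-irrelevant _ Y≡ _) (cast-irrelevant _ x≡ x))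
                         (BK-matrix (r₂ ∘R r) (renTms r₂ Y) x))))
        (matrixCorrespondence A (r₂ ∘R r) x Yx dx (appTms-⊴-refl ys (renTms r₂ Y) x (Majorized-rename e₂ Y Y dY) dx))

  wkR* : ∀ {Θ} (as : List Ty) → Ren Θ (as ++ Θ)
  wkR* [] v = v
  wkR* (a ∷ as) v = there (wkR* as v)

  vars* : ∀ {Θ} (as : List Ty) → Tms (as ++ Θ) as
  vars* [] = []ₜ
  vars* (a ∷ as) = var here ∷ₜ renTms there (vars* as)

  ++ˢ-wkR* : ∀ {Θ Δ as} (ts : Tms Δ as) (s : Sub Θ Δ) {ρ} (v : Var Θ ρ) → (ts ++ˢ s) (wkR* as v) ≡ s v
  ++ˢ-wkR* []ₜ s v = refl
  ++ˢ-wkR* (t ∷ₜ ts) s v = ++ˢ-wkR* ts s v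

  subTms-vars* : ∀ {Θ Δ as} (ts : Tms Δ as) (s : Sub Θ Δ) → subTms (ts ++ˢ s) (vars* as) ≡ ts
  subTms-vars* []ₜ s = refl
  subTms-vars* {as = a ∷ as} (t ∷ₜ ts) s =
    cong (t ∷ₜ_) (trans (subTms-renTms ((t ∷ₜ ts) ++ˢ s) there (λ v → refl) (vars* as)) (subTms-vars* ts s))

  -- bMAC is instantiated at A_U with y⃗, x⃗ as its newest free variables
  openMatrix : Fm (ys ++ xs ++ Γ)
  openMatrix = Interp.mat (U A) (λ v → wkR* ys (wkR* xs v)) (renTms (wkR* ys) (vars* xs)) (vars* ys)

  inst-openMatrix : ∀ {Δ} (r : Ren Γ Δ) x y → inst openMatrix r x y ≡ Interp.mat (U A) r x y
  inst-openMatrix r x y = trans (natural-U A σ _ r (λ v → trans (++ˢ-wkR* y _ (wkR* xs v)) (++ˢ-wkR* x _ v)) _ _)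
    (cong₂ (Interp.mat (U A) r) (trans (subTms-renTms σ (wkR* ys) (λ v → ++ˢ-wkR* y _ v) (vars* xs)) (subTms-vars* x _))
        (subTms-vars* y _))
    where
    σ : Sub (ys ++ xs ++ Γ) _
    σ = y ++ˢ (x ++ˢ (λ v → var (r v)))

  bmacInnerBody : ∀ {Δ} → Ren Γ Δ → Tms Δ Ys → KF Δ xs
  bmacInnerBody r Y r₂ x = ∃̃⊴* ys (appTms ys (renTms r₂ Y) x) (matBody (U A) (r₂ ∘R r) x)

  bmacBody : KF Γ Ys
  bmacBody r Y = ∀̃* xs (bmacInnerBody r Y)

  bmacInstance : Fm Γ
  bmacInstance = AEform (U A) ⊃ ∃̃* Ys bmacBody

  bmac-openMatrix≡bmacInstance :
    (∀̃* xs (λ r x → ∃̃* ys (λ r₂ y → inst openMatrix (r₂ ∘R r) (renTms r₂ x) y))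
      ⊃ ∃̃* Ys (λ r Y → ∀̃* xs (λ r₂ x →
          ∃̃⊴* ys (appTms ys (renTms r₂ Y) x) (λ r₃ y → inst openMatrix (r₃ ∘R (r₂ ∘R r)) (renTms r₃ x) y))))
    ≡ bmacInstance
  bmac-openMatrix≡bmacInstance = cong₂ _⊃_ (∀̃*-cong xs (λ r x → ∃̃*-cong ys (λ r₂ y → inst-openMatrix _ _ _)))
    (∃̃*-cong Ys (λ r Y → ∀̃*-cong xs (λ r₂ x → ∃̃⊴*-cong ys _ (λ r₃ y → inst-openMatrix _ _ _))))

  bmacInnerBody-commutes : ∀ {Δ Δ'} (s : Sub Δ Δ') (r : Ren Γ Δ) (r' : Ren Γ Δ') →
    (∀ {σ} (v : Var Γ σ) → s (r v) ≡ var (r' v)) → ∀ Y → Commutes s (bmacInnerBody r Y) (bmacInnerBody r' (subTms s Y))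
  bmacInnerBody-commutes s r r' c Y s'' r₃ r₄ c' us =
    trans (∃̃⊴*-subFm ys _ (matBody-commutes (U A) (natural-U A) s'' (r₃ ∘R r) (r₄ ∘R r')
        (λ v → trans (c' (r v)) (cong (renTm r₄) (c v))) us))
      (cong (λ z → ∃̃⊴* ys z (matBody (U A) (r₄ ∘R r') (subTms s'' us)))
        (trans (appTms-sub ys s'' _ us)
               (cong (λ z → appTms ys z (subTms s'' us))
                   (trans (subTms-renTms s'' r₃ c' Y) (sym (renTms-subTms r₄ s (λ v → refl) Y))))))

  bmacInnerBody-natural : ∀ {Δ} (r : Ren Γ Δ) Y → Natural (bmacInnerBody r Y)
  bmacInnerBody-natural r Y = subst (λ z → Commutes var (bmacInnerBody r Y) (bmacInnerBody r z)) (subTms-id (λ v → refl) Y)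
    (bmacInnerBody-commutes var r r (λ v → refl) Y)

  bmacBody-natural : Natural bmacBody
  bmacBody-natural s' r₁ r₂ c Y = ∀̃*-subFm xs (bmacInnerBody-commutes s' r₁ r₂ c Y)

  EABody-natural : Natural (λ r' Y' → ∀̃* (KBys A) (matBody BK r' Y'))
  EABody-natural = ∀̃*matBody-natural BK (natural-B (Kriv A))

  -- a witness y ⊴ ŷ for A_U(x, ·) refutes ∀̃ ỹ ⊴ y (A_K)_B(x, ỹ), which follows from the bound ŷ
  bounded-AU⇒BK : ∀ {Δ} (R : Ren Γ Δ) {Hs : List (Fm Δ)} (x : Tms Δ xs) (ŷ : Tms Δ ys) → Majorized Hs x x →
    Hs ⊢ ∃̃⊴* ys ŷ (matBody (U A) R x) → Hs ⊢ ¬' (∀̃⊴BKT A R (cast (Uxs≡BKTxs A) x) (cast (Uys≡BKTys A) ŷ))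
  bounded-AU⇒BK R x ŷ dx d = ∃̃⊴*-elim ys (matBody-natural (U A) (natural-U A) R x) d λ r₃ {Hs'} e₃ y y⊴ŷ dy au →
    ⊃I (⊃E (weaken₁ (⇔-to (matrixCorrespondence A (r₃ ∘R R) (renTms r₃ x) y (Majorized-rename e₃ x x dx) dy) au))
      (substDer (cong (λ c → ∀̃⊴* (BKTys A) (cast (Uys≡BKTys A) y) (matBody (BKT A) (r₃ ∘R R) c))
          (renTms-cast r₃ (Uxs≡BKTxs A) x))
        (∀̃⊴*-matBody-antitone (BKT A) (natural-BKT A) {Hs = _ ∷ []} (λ { (here refl) → hyp₀ ; (there ()) }) hyp₀ _
          (Majorized-subst refl (sym (renTms-cast r₃ (Uys≡BKTys A) ŷ))
              (Majorized-cast (Uys≡BKTys A) _ _ (Majorized-weaken there _ _ y⊴ŷ))))))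

  forward : (AEform (U A) ∷ bmacInstance ∷ []) ⊢ EAform BK
  forward = ∃̃*-elim Ys bmacBody-natural (⊃E hyp₁ hyp₀) λ r {Hs'} e Y dY bmac →
    substDer (sym (renFm-∃̃* (KBxs A) r EABody-natural))
      (∃̃*-intro (KBxs A) (renBody-natural r EABody-natural) (cast Y≡ Y) (Majorized-cast Y≡ Y Y dY)
        (∀̃*-intro (KBys A) (matBody-natural BK (natural-B (Kriv A)) r (cast Y≡ Y)) λ r₂ {Hs''} e₂ x' dx' →
          let x = cast (sym x≡) x'
              dx = Majorized-cast (sym x≡) x' x' dx'
          in substDer (cong (Interp.mat BK (r₂ ∘R r) (renTms r₂ (cast Y≡ Y))) (cast-cast-sym x≡ x'))
               (substDer (cong (λ z → Interp.mat BK (r₂ ∘R r) z (cast x≡ x)) (sym (renTms-cast r₂ Y≡ Y)))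
                 (substDer (sym (BK-matrix (r₂ ∘R r) (renTms r₂ Y) x))
                   (bounded-AU⇒BK (r₂ ∘R r) x _ dx (∀̃*-elim-transport xs (bmacInnerBody-natural r Y) e₂ bmac x dx))))))

  backward : (EAform BK ∷ bmacInstance ∷ []) ⊢ AEform (U A)
  backward = ∀̃*-intro xs (∃̃*matBody-natural (U A) (natural-U A)) λ r {Hs'} e x dx →
    ∃̃*-elim (KBxs A) (renBody-natural r EABody-natural) (substDer (renFm-∃̃* (KBxs A) r EABody-natural) (transport e hyp₀))
      λ r₂ {Hs''} e₂ Y' dY' ea →
        let Y = cast (sym Y≡) Y'
            dY = Majorized-cast (sym Y≡) Y' Y' dY'
            xr = renTms r₂ x
            dxr = Majorized-rename e₂ x x dx
            Yx = appTms ys Y xr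
            ¬BKT = substDer (trans (cong (λ z → Interp.mat BK (r₂ ∘R r) z (cast x≡ xr))
                (trans (renTms-id Y') (sym (cast-cast-sym Y≡ Y'))))
                                   (BK-matrix (r₂ ∘R r) Y xr))
                     (∀̃*-elim (KBys A) (matBody-natural BK (natural-B (Kriv A)) (r₂ ∘R r) Y') ea (cast x≡ xr)
                         (Majorized-cast x≡ xr xr dxr))
        in substDer (sym (renFm-∃̃* ys r₂ (matBody-natural (U A) (natural-U A) r x)))
             (∃̃*-intro ys (renBody-natural r₂ (matBody-natural (U A) (natural-U A) r x)) Yx (appTms-⊴-refl ys Y xr dY dxr)
               (⇔-from (matrixCorrespondence A (r₂ ∘R r) xr Yx dxr (appTms-⊴-refl ys Y xr dY dxr)) ¬BKT))

  claim2 : Der ((HA⊴ ∪T BLEM) ∪T bMAC) Γ [] (Claim2 A)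
  claim2 = ⊃E (Der-mono inj₁ (⊃I (⇔-intro forward backward)))
    (ax (inj₂ (subst bMAC bmac-openMatrix≡bmacInstance (bmac xs ys openMatrix (U-Bounded A _ _ _)))))

mainTheorem1 : ∀ {Γ : Ctx} (A : KFm Γ) →
    Σ (KBxs A ≡ map (Uxs A ⇒*_) (Uys A)) λ eY →
    Σ (KBys A ≡ Uxs A) λ ex →
    Der (HA⊴ ∪T BLEM) Γ [] (Claim1 A eY ex)
    × Der ((HA⊴ ∪T BLEM) ∪T bMAC) Γ [] (Claim2 A)
mainTheorem1 A = sym Y≡ , sym x≡ , claim1 , claim2
  where open Claims A
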